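{- Let $n\ge5$. The group $\widetilde S^{\mathrm{jes}}$ of affine jointly even-signed permutations is generated by $S\cup\{\ell_1\}$. It is also generated by $T\cup L$.
   Context: An affine signed permutation is a bijection $\pi:\mathbb Z\to\mathbb Z$ with $\pi(i+2n)=\pi(i)+2n$ and $\pi(-i)=-\pi(i)$. $\widetilde S^{\mathrm{jes}}$ is the set of affine signed permutations such that $|\{i\in\mathbb Z:i>0,\pi(i)<0\}|+|\{i\in\mathbb Z: i<n,\pi(i)>n\}|$ is even. $\widetilde S^{\mathrm{des}}$ is the subgroup where each of these two numbers is even; it is a Coxeter group with simple reflections $S=\{s_0,\dots,s_{n-1}\}$, $s_0=(\!(1\ { -2})\!)_{2n}$, $s_i=(\!(i\ \ i+1)\!)_{2n}$ ($1\le i\le n-2$), $s_{n-1}=(\!(n-2\ \ n+1)\!)_{2n}$, where $(\!(a\ b)\!)_{2n}$ denotes the permutation swapping $a+2n\ell\leftrightarrow b+2n\ell$ and $-a+2n\ell\leftrightarrow -b+2n\ell$ for all $\ell\in\mathbb Z$. $T=\{(\!(i\ j)\!)_{2n}: i,j\not\equiv0 \bmod n,\ i\not\equiv\pm j\bmod 2n\}$ is its set of reflections. For $i\in\{\pm1,\dots,\pm(n-1)\}$ the loop $\ell_i$ maps $j\mapsto j+2n$ when $j\equiv i$, $j\mapsto j-2n$ when $j\equiv -i\pmod{2n}$, and fixes all other $j$; $L=\{\ell_i\}$. -}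

module Defs where

open import Data.Nat as ℕ using (ℕ; zero; suc)
open import Data.Integer using (ℤ; +_; -_; _+_; _-_; _%ℕ_; _<_; _≤_; ∣_∣)
open import Data.Bool using (Bool; true; false; if_then_else_; _∨_)
open import Data.Product using (Σ; _×_; ∃; ∃-syntax)
open import Data.Sum using (_⊎_)
open import Data.List using (List; length)
open import Data.List.Membership.Propositional using (_∈_)
open import Data.List.Relation.Unary.Unique.Propositional using (Unique)
open import Data.Nat.Divisibility using (_∣_)
open import Relation.Binary.PropositionalEquality using (_≡_)
open import Relation.Nullary using (¬_)
open import Function.Definitions using (Bijective)

period : ℕ → ℤ
period n = + (2 ℕ.* n)

-- Boolean test: a ≡ b (mod m), m a natural number (m = 0 means equality).
congB : ℕ → ℤ → ℤ → Bool
congB zero    a b = isZero ∣ a - b ∣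
  where isZero : ℕ → Bool
        isZero zero = true
        isZero (suc _) = false
congB (suc k) a b with (a - b) %ℕ (suc k)
... | zero  = true
... | suc _ = false

infix 4 _≡[mod_]_
_≡[mod_]_ : ℤ → ℕ → ℤ → Set
a ≡[mod m ] b = congB m a b ≡ true

_≗_ : (ℤ → ℤ) → (ℤ → ℤ) → Set
f ≗ g = ∀ z → f z ≡ g z

-- ((a b))_{2n}: swaps a+2nℓ ↔ b+2nℓ and -a+2nℓ ↔ -b+2nℓ for all ℓ.
transp : ℕ → ℤ → ℤ → ℤ → ℤ
transp n a b j =
  if congB (2 ℕ.* n) j a then j - a + b
  else if congB (2 ℕ.* n) j b then j - b + a
  else if congB (2 ℕ.* n) j (- a) then j + a - b
  else if congB (2 ℕ.* n) j (- b) then j + b - a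
  else j

loop : ℕ → ℤ → ℤ → ℤ
loop n i j =
  if congB (2 ℕ.* n) j i then j + period n
  else if congB (2 ℕ.* n) j (- i) then j - period n
  else j

AffSigned : ℕ → (ℤ → ℤ) → Set
AffSigned n π =
  Bijective _≡_ _≡_ π
  × (∀ i → π (i + period n) ≡ π i + period n)
  × (∀ i → π (- i) ≡ - π i)

Enumerates : (ℤ → Set) → List ℤ → Set
Enumerates P xs = Unique xs × (∀ i → (i ∈ xs → P i) × (P i → i ∈ xs))

JointlyEven : ℕ → (ℤ → ℤ) → Set
JointlyEven n π =
  Σ (List ℤ) λ xs → Σ (List ℤ) λ ys →
    Enumerates (λ i → (+ 0 < i) × (π i < + 0)) xs
    × Enumerates (λ i → (i < + n) × (+ n < π i)) ys
    × (2 ∣ (length xs ℕ.+ length ys))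

Sjes : ℕ → (ℤ → ℤ) → Set
Sjes n π = AffSigned n π × JointlyEven n π

data Gen (X : (ℤ → ℤ) → Set) : (ℤ → ℤ) → Set where
  gen-base : ∀ {f π} → X f → π ≗ f → Gen X π
  gen-id   : ∀ {π} → π ≗ (λ z → z) → Gen X π
  gen-comp : ∀ {f g π} → Gen X f → Gen X g → π ≗ (λ z → f (g z)) → Gen X π
  gen-inv  : ∀ {f π} → Gen X f → (λ z → f (π z)) ≗ (λ z → z)
             → (λ z → π (f z)) ≗ (λ z → z) → Gen X π

SimpleRefl : ℕ → (ℤ → ℤ) → Set
SimpleRefl n f =
  (f ≗ transp n (+ 1) (- + 2))
  ⊎ (∃[ i ] ((1 ℕ.≤ i) × (i ℕ.≤ n ℕ.∸ 2) × (f ≗ transp n (+ i) (+ suc i))))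
  ⊎ (f ≗ transp n (+ (n ℕ.∸ 2)) (+ (n ℕ.+ 1)))

SAndL1 : ℕ → (ℤ → ℤ) → Set
SAndL1 n f = SimpleRefl n f ⊎ (f ≗ loop n (+ 1))

Refl : ℕ → (ℤ → ℤ) → Set
Refl n f = ∃[ i ] ∃[ j ]
  (¬ (i ≡[mod n ] + 0)) × (¬ (j ≡[mod n ] + 0))
  × (¬ (i ≡[mod 2 ℕ.* n ] j)) × (¬ (i ≡[mod 2 ℕ.* n ] (- j)))
  × (f ≗ transp n i j)

Loops : ℕ → (ℤ → ℤ) → Set
Loops n f = ∃[ i ] (1 ℕ.≤ ∣ i ∣) × (∣ i ∣ ℕ.≤ n ℕ.∸ 1) × (f ≗ loop n i)

TAndL : ℕ → (ℤ → ℤ) → Set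
TAndL n f = Refl n f ⊎ Loops n f

-- An affine signed permutation π is determined by its window π(1), …, π(n−1),
-- since it is 2n-periodic, odd, and fixes the classes of 0 and n.  Two
-- parities are attached to π: its sign parity, the number mod 2 of window
-- entries whose residue mod 2n lies in (n, 2n), and its crossing parity, that
-- of |{i > 0 : π i < 0}| + |{i < n : π i > n}|; S̃^jes consists of the π with
-- even crossing parity.  Right multiplication by a reflection of T or a loop
-- of L preserves both parities, whereas changing the sign of one window entry
-- flips both.  Conversely, every π of even sign parity is reduced to the
-- identity by such right multiplications: loops first bring all window
-- entries into (−n, n), then reflections ((x s)) and ((x −s)) fix the window
-- entries one by one, a lone remaining sign change being excluded by the
-- parity.  Running this reduction for the crossing parity shows that the two
-- parities agree.  Running it inside ⟨S ∪ {ℓ₁}⟩, which contains every window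
-- reflection and loop because conjugation by s_i = ((i i+1)) moves them along
-- the window, gives S̃^jes ⊆ ⟨S ∪ {ℓ₁}⟩ ⊆ ⟨T ∪ L⟩ ⊆ S̃^jes.

module Submission where

open import Defs
open import Data.Nat as ℕ using (ℕ; zero; suc; z≤n; s≤s)
import Data.Nat.Properties as ℕP
import Data.Nat.DivMod as ℕD
import Data.Nat.Divisibility as ℕDiv
import Data.Nat.Tactic.RingSolver as NS
open import Data.Integer as ℤ using (ℤ; +_; -_; _+_; _-_; _*_; -[1+_]; ∣_∣; _%ℕ_; _/ℕ_; _<_; _≤_; +≤+; +<+; -≤+; -<+; -<-; 0ℤ; 1ℤ)
import Data.Integer.Properties as ℤP
import Data.Integer.DivMod as ZDM
open ℤP using (neg-involutive)
open import Data.Integer.Divisibility.Signed as ZD using (_∣_; divides; ∣ᵤ⇒∣; ∣⇒∣ᵤ)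
open import Data.Integer.Tactic.RingSolver using (solve-∀; solve)
open import Data.Bool using (Bool; true; false; if_then_else_; not; _xor_)
open import Data.Bool.Properties using (not-involutive; not-distribˡ-xor; xor-comm; xor-assoc; xor-same; true-xor; xor-identityʳ; xor-annihilates-not; xor-∧-commutativeRing)
open import Algebra.Bundles using (CommutativeRing)
open import Algebra.Properties.CommutativeSemigroup (CommutativeRing.+-commutativeSemigroup xor-∧-commutativeRing)
  using () renaming (interchange to xor-interchange)
open import Data.Product using (Σ; _×_; _,_; proj₁; proj₂)
open import Data.Sum using (_⊎_; inj₁; inj₂)
open import Data.Empty using (⊥; ⊥-elim)
open import Data.List using (List; []; _∷_; [_]; length; map)
open import Data.List.Properties using (length-map)
open import Data.List.Membership.Propositional using (_∈_)
open import Data.List.Membership.Propositional.Properties using (∈-map⁺; ∈-map⁻)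
open import Data.List.Relation.Unary.Any using (here; there)
open import Data.List.Relation.Unary.All as All using (All; []; _∷_)
open import Data.List.Relation.Unary.AllPairs using ([]; _∷_)
open import Data.List.Relation.Unary.Unique.Propositional using (Unique)
import Data.List.Relation.Unary.Unique.Propositional.Properties as Unique
open import Relation.Binary.PropositionalEquality hiding (_≗_; [_])
open import Relation.Binary.Definitions using (tri<; tri≈; tri>)
open import Relation.Nullary using (¬_; Dec; yes; no; does)
open import Relation.Nullary.Decidable using (dec-true; dec-false)

≤-by : ∀ {a b} d → 0ℤ ≤ d → b ≡ a + d → a ≤ b
≤-by {a} d 0≤d refl = subst (_≤ a + d) (ℤP.+-identityʳ a) (ℤP.+-monoʳ-≤ a 0≤d)

<-by : ∀ {a b} d → 0ℤ < d → b ≡ a + d → a < b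
<-by {a} d 0<d refl = subst (_< a + d) (ℤP.+-identityʳ a) (ℤP.+-monoʳ-< a 0<d)

i<j⇒0<j-i : ∀ {a b} → a < b → 0ℤ < b - a
i<j⇒0<j-i {a} {b} a<b = subst₂ _<_ (ℤP.+-inverseˡ a) (ℤP.+-comm (- a) b) (ℤP.+-monoʳ-< (- a) a<b)

true≢false : true ≢ false
true≢false ()

module CongB (m : ℕ) where
  D : ℕ
  D = suc m

  %ℕ≡0⇒∣ : ∀ x → x %ℕ D ≡ 0 → + D ∣ x
  %ℕ≡0⇒∣ (+ p) e = ∣ᵤ⇒∣ (ℕDiv.m%n≡0⇒n∣m p D e)
  %ℕ≡0⇒∣ -[1+ p ] e with suc p ℕ.% D in eq
  ... | zero = ∣ᵤ⇒∣ (ℕDiv.m%n≡0⇒n∣m (suc p) D eq)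
  ... | suc r = ⊥-elim (ℕP.m>n⇒m∸n≢0 (subst (ℕ._< D) eq (ℕD.m%n<n (suc p) D)) e)

  ∣⇒%ℕ≡0 : ∀ x → + D ∣ x → x %ℕ D ≡ 0
  ∣⇒%ℕ≡0 (+ p) d = ℕDiv.n∣m⇒m%n≡0 p D (∣⇒∣ᵤ d)
  ∣⇒%ℕ≡0 -[1+ p ] d with suc p ℕ.% D in eq
  ... | zero = refl
  ... | suc r = ⊥-elim (ℕP.0≢1+n (trans (sym (ℕDiv.n∣m⇒m%n≡0 (suc p) D (∣⇒∣ᵤ d))) eq))

  congB⇒∣ : ∀ a b → congB D a b ≡ true → + D ∣ (a - b)
  congB⇒∣ a b e with (a - b) %ℕ D in eq
  ... | zero = %ℕ≡0⇒∣ (a - b) eq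
  ... | suc _ = ⊥-elim (true≢false (sym e))

  ∣⇒congB : ∀ a b → + D ∣ (a - b) → congB D a b ≡ true
  ∣⇒congB a b d with (a - b) %ℕ D in eq
  ... | zero = refl
  ... | suc _ = ⊥-elim (ℕP.0≢1+n (trans (sym (∣⇒%ℕ≡0 _ d)) eq))

  congB-false⇒∤ : ∀ a b → congB D a b ≡ false → ¬ (+ D ∣ (a - b))
  congB-false⇒∤ a b e d = true≢false (trans (sym (∣⇒congB a b d)) e)

  ∤⇒congB-false : ∀ a b → ¬ (+ D ∣ (a - b)) → congB D a b ≡ false
  ∤⇒congB-false a b nd with congB D a b in eq
  ... | true = ⊥-elim (nd (congB⇒∣ a b eq))
  ... | false = refl

-- Finite enumerations and parity

parity : ℕ → Bool
parity zero = false
parity (suc m) = not (parity m)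

parity-+ : ∀ a b → parity (a ℕ.+ b) ≡ parity a xor parity b
parity-+ zero b = refl
parity-+ (suc a) b = trans (cong not (parity-+ a b)) (not-distribˡ-xor (parity a) (parity b))

parity≡false⇒2∣ : ∀ m → parity m ≡ false → 2 ℕDiv.∣ m
parity≡false⇒2∣ zero e = ℕDiv.divides 0 refl
parity≡false⇒2∣ (suc zero) ()
parity≡false⇒2∣ (suc (suc m)) e with parity≡false⇒2∣ m (trans (sym (not-involutive (parity m))) e)
... | ℕDiv.divides q eq = ℕDiv.divides (suc q) (cong (λ z → suc (suc z)) eq)

2∣⇒parity≡false : ∀ m → 2 ℕDiv.∣ m → parity m ≡ false
2∣⇒parity≡false m (ℕDiv.divides q refl) = even q
  where
  even : ∀ q → parity (q ℕ.* 2) ≡ false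
  even zero = refl
  even (suc q) = trans (not-involutive _) (even q)

remove : ℤ → List ℤ → List ℤ
remove c [] = []
remove c (x ∷ xs) with x ℤ.≟ c
... | yes _ = xs
... | no _ = x ∷ remove c xs

remove-length : ∀ {c xs} → c ∈ xs → length xs ≡ suc (length (remove c xs))
remove-length {c} {x ∷ xs} (here refl) with x ℤ.≟ x
... | yes _ = refl
... | no ne = ⊥-elim (ne refl)
remove-length {c} {x ∷ xs} (there p) with x ℤ.≟ c
... | yes _ = refl
... | no _ = cong suc (remove-length p)

remove-∈⁻ : ∀ {c i xs} → i ∈ remove c xs → i ∈ xs
remove-∈⁻ {c} {i} {x ∷ xs} p with x ℤ.≟ c
... | yes _ = there p
remove-∈⁻ {c} {i} {x ∷ xs} (here e) | no _ = here e
remove-∈⁻ {c} {i} {x ∷ xs} (there p) | no _ = there (remove-∈⁻ p)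

All≢-∈ : ∀ {x : ℤ} {xs} → All (λ y → x ≢ y) xs → ∀ {i} → i ∈ xs → x ≢ i
All≢-∈ (px ∷ _) (here refl) = px
All≢-∈ (_ ∷ pxs) (there p) = All≢-∈ pxs p

remove-∉ : ∀ {c i xs} → Unique xs → i ∈ remove c xs → i ≢ c
remove-∉ {c} {i} {x ∷ xs} (ax ∷ u) p with x ℤ.≟ c
... | yes refl = λ e → All≢-∈ ax p (sym e)
remove-∉ {c} {i} {x ∷ xs} (ax ∷ u) (here refl) | no ne = ne
remove-∉ {c} {i} {x ∷ xs} (ax ∷ u) (there p) | no ne = remove-∉ u p

remove-∈⁺ : ∀ {c i xs} → i ∈ xs → i ≢ c → i ∈ remove c xs
remove-∈⁺ {c} {i} {x ∷ xs} p ne with x ℤ.≟ c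
remove-∈⁺ {c} {i} {x ∷ xs} (here refl) ne | yes e = ⊥-elim (ne e)
remove-∈⁺ {c} {i} {x ∷ xs} (there p) ne | yes e = p
remove-∈⁺ {c} {i} {x ∷ xs} (here e) ne | no _ = here e
remove-∈⁺ {c} {i} {x ∷ xs} (there p) ne | no _ = there (remove-∈⁺ p ne)

remove-unique : ∀ {c xs} → Unique xs → Unique (remove c xs)
remove-unique {c} {[]} u = []
remove-unique {c} {x ∷ xs} (ax ∷ u) with x ℤ.≟ c
... | yes _ = u
... | no _ = All.tabulate (λ p → All≢-∈ ax (remove-∈⁻ p)) ∷ remove-unique u

Enumerates-length : ∀ {P : ℤ → Set} {xs ys} → Enumerates P xs → Enumerates P ys → length xs ≡ length ys
Enumerates-length {P} {[]} {[]} ex ey = refl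
Enumerates-length {P} {[]} {y ∷ ys} ex ey with proj₂ (proj₂ ex y) (proj₁ (proj₂ ey y) (here refl))
... | ()
Enumerates-length {P} {x ∷ xs} {ys} (ax ∷ ux , fx) (uy , fy) =
  trans (cong suc (Enumerates-length {Q} {xs} {remove x ys} (ux , λ i → (λ p → proj₁ (fx i) (there p) , λ e → All≢-∈ ax p (sym e)) ,
                                          λ q → lem i q)
                                  (remove-unique uy , λ i → (λ p → proj₁ (fy i) (remove-∈⁻ p) , remove-∉ uy p) ,
                                          λ q → remove-∈⁺ (proj₂ (fy i) (proj₁ q)) (proj₂ q))))
        (sym (remove-length (proj₂ (fy x) (proj₁ (fx x) (here refl)))))
  where
  Q : ℤ → Set
  Q i = P i × (i ≢ x)
  lem : ∀ i → Q i → i ∈ xs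
  lem i (pi , ne) with proj₂ (fx i) pi
  ... | here e = ⊥-elim (ne e)
  ... | there p = p

Enumerates-resp : ∀ {P Q : ℤ → Set} {xs} → Enumerates P xs → (∀ i → P i → Q i) → (∀ i → Q i → P i) → Enumerates Q xs
Enumerates-resp (u , f) pq qp = u , λ i → (λ p → pq i (proj₁ (f i) p)) , (λ q → proj₂ (f i) (qp i q))

Enumerates-map : ∀ {P : ℤ → Set} {xs} (g h : ℤ → ℤ) → (∀ i → h (g i) ≡ i) → (∀ i → g (h i) ≡ i) →
           Enumerates P xs → Enumerates (λ i → P (g i)) (map h xs)
Enumerates-map {P} {xs} g h hg gh (u , f) =
  Unique.map⁺ (λ {x} {y} e → trans (sym (gh x)) (trans (cong g e) (gh y))) u ,
  λ i → (λ p → lem1 i p) , (λ q → subst (_∈ map h xs) (hg i) (∈-map⁺ h (proj₂ (f (g i)) q)))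
  where
  lem1 : ∀ i → i ∈ map h xs → P (g i)
  lem1 i p with ∈-map⁻ h p
  ... | y , yin , refl = subst P (sym (gh y)) (proj₁ (f y) yin)

Enumerates-toggle : ∀ {P Q : ℤ → Set} {xs} c → Enumerates P xs → (∀ i → i ≢ c → P i → Q i) → (∀ i → i ≢ c → Q i → P i) →
              (P c × ¬ Q c) ⊎ (¬ P c × Q c) → Σ (List ℤ) λ ys → Enumerates Q ys × (parity (length ys) ≡ not (parity (length xs)))
Enumerates-toggle {P} {Q} {xs} c (u , f) pq qp (inj₁ (pc , nqc)) =
  remove c xs , (remove-unique u , λ i → (λ p → pq i (remove-∉ u p) (proj₁ (f i) (remove-∈⁻ p))) ,
                                 (λ q → remove-∈⁺ (proj₂ (f i) (qp i (ne i q) q)) (ne i q))) ,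
  trans (sym (not-involutive _)) (cong not (cong parity (sym (remove-length (proj₂ (f c) pc)))))
  where
  ne : ∀ i → Q i → i ≢ c
  ne i q refl = nqc q
Enumerates-toggle {P} {Q} {xs} c (u , f) pq qp (inj₂ (npc , qc)) =
  c ∷ xs , (All.tabulate (λ {i} p e → npc (subst P (sym e) (proj₁ (f i) p))) ∷ u ,
            λ i → (λ { (here refl) → qc ; (there p) → pq i (λ e → npc (subst P e (proj₁ (f i) p))) (proj₁ (f i) p) }) ,
                  (λ q → lem i q)) , refl
  where
  lem : ∀ i → Q i → i ∈ c ∷ xs
  lem i q with i ℤ.≟ c
  ... | yes e = here e
  ... | no ne = there (proj₂ (f i) (qp i ne q))

xorSum : (ℕ → Bool) → ℕ → Bool
xorSum f zero = false
xorSum f (suc m) = xorSum f m xor f (suc m)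

xorSum-cong : ∀ {f g} m → (∀ x → 0 ℕ.< x → x ℕ.≤ m → f x ≡ g x) → xorSum f m ≡ xorSum g m
xorSum-cong zero h = refl
xorSum-cong (suc m) h = cong₂ _xor_ (xorSum-cong m (λ x p q → h x p (ℕP.m≤n⇒m≤1+n q))) (h (suc m) (s≤s z≤n) ℕP.≤-refl)

xorSum-xor : ∀ f g m → xorSum (λ x → f x xor g x) m ≡ xorSum f m xor xorSum g m
xorSum-xor f g zero = refl
xorSum-xor f g (suc m) = trans (cong (_xor (f (suc m) xor g (suc m))) (xorSum-xor f g m)) (xor-interchange (xorSum f m) (xorSum g m) (f (suc m)) (g (suc m)))

xorSum-false : ∀ d m → (∀ x → 0 ℕ.< x → x ℕ.≤ m → d x ≡ false) → xorSum d m ≡ false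
xorSum-false d zero h = refl
xorSum-false d (suc m) h = trans (cong₂ _xor_ (xorSum-false d m (λ x p q → h x p (ℕP.m≤n⇒m≤1+n q))) (h (suc m) (s≤s z≤n) ℕP.≤-refl)) refl

xorSum-single : ∀ d m p → 0 ℕ.< p → p ℕ.≤ m → (∀ x → 0 ℕ.< x → x ℕ.≤ m → x ≢ p → d x ≡ false) → xorSum d m ≡ d p
xorSum-single d zero .zero () z≤n h
xorSum-single d (suc m) p 0<p p≤ h with p ℕ.≟ suc m
... | yes refl = trans (cong (_xor d (suc m)) (xorSum-false d m (λ x a b → h x a (ℕP.m≤n⇒m≤1+n b) (ℕP.<⇒≢ (s≤s b)))) ) refl
... | no ne = trans (cong₂ _xor_ (xorSum-single d m p 0<p (ℕP.≤-pred (ℕP.≤∧≢⇒< p≤ ne)) (λ x a b → h x a (ℕP.m≤n⇒m≤1+n b))) (h (suc m) (s≤s z≤n) ℕP.≤-refl (λ e → ne (sym e)))) (xor-identityʳ (d p))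

xorSum-pair : ∀ d m p q → p ≢ q → 0 ℕ.< p → p ℕ.≤ m → 0 ℕ.< q → q ℕ.≤ m →
           (∀ x → 0 ℕ.< x → x ℕ.≤ m → x ≢ p → x ≢ q → d x ≡ false) → xorSum d m ≡ d p xor d q
xorSum-pair d zero .zero q _ () z≤n _ _ _
xorSum-pair d (suc m) p q pq 0<p p≤ 0<q q≤ h with p ℕ.≟ suc m | q ℕ.≟ suc m
... | yes refl | yes refl = ⊥-elim (pq refl)
... | yes refl | no nq = trans (cong (_xor d (suc m)) (xorSum-single d m q 0<q (ℕP.≤-pred (ℕP.≤∧≢⇒< q≤ nq))
        (λ x a b xq → h x a (ℕP.m≤n⇒m≤1+n b) (ℕP.<⇒≢ (s≤s b)) xq))) (xor-comm (d q) (d (suc m)))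
... | no np | yes refl = cong (_xor d (suc m)) (xorSum-single d m p 0<p (ℕP.≤-pred (ℕP.≤∧≢⇒< p≤ np))
        (λ x a b xp → h x a (ℕP.m≤n⇒m≤1+n b) xp (ℕP.<⇒≢ (s≤s b))))
... | no np | no nq = trans (cong₂ _xor_ (xorSum-pair d m p q pq 0<p (ℕP.≤-pred (ℕP.≤∧≢⇒< p≤ np)) 0<q (ℕP.≤-pred (ℕP.≤∧≢⇒< q≤ nq))
        (λ x a b → h x a (ℕP.m≤n⇒m≤1+n b))) (h (suc m) (s≤s z≤n) ℕP.≤-refl (λ e → np (sym e)) (λ e → nq (sym e)))) (xor-identityʳ _)

module EnumerationTransfer (L R : ℤ → Set) (ρ g h : ℤ → ℤ) (hg : ∀ i → h (g i) ≡ i) (gh : ∀ i → g (h i) ≡ i) where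
  S : (ℤ → ℤ) → ℤ → Set
  S σ i = L i × R (σ i)

  preimage : ∀ {xs} → Enumerates (S ρ) xs → (∀ i → R (ρ (g i)) → (L (g i) → L i) × (L i → L (g i))) →
         Enumerates (S (λ z → ρ (g z))) (map h xs)
  preimage {xs} e f = Enumerates-resp (Enumerates-map {S ρ} g h hg gh e) (λ i p → proj₁ (f i (proj₂ p)) (proj₁ p) , proj₂ p)
                                                     (λ i p → proj₂ (f i (proj₂ p)) (proj₁ p) , proj₂ p)

  preimage-toggle : ∀ {xs} → Enumerates (S ρ) xs → (c : ℤ) →
        (∀ i → i ≢ c → R (ρ (g i)) → (L (g i) → L i) × (L i → L (g i))) →
        R (ρ (g c)) → (L (g c) × ¬ L c) ⊎ (¬ L (g c) × L c) →
        Σ (List ℤ) λ ys → Enumerates (S (λ z → ρ (g z))) ys × (parity (length ys) ≡ not (parity (length xs)))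
  preimage-toggle {xs} e c f rc alt with Enumerates-toggle {λ i → S ρ (g i)} {S (λ z → ρ (g z))} c (Enumerates-map {S ρ} g h hg gh e)
         (λ i ne p → proj₁ (f i ne (proj₂ p)) (proj₁ p) , proj₂ p)
         (λ i ne p → proj₂ (f i ne (proj₂ p)) (proj₁ p) , proj₂ p)
         (alt' alt)
    where
    alt' : (L (g c) × ¬ L c) ⊎ (¬ L (g c) × L c) → (S ρ (g c) × ¬ S (λ z → ρ (g z)) c) ⊎ (¬ S ρ (g c) × S (λ z → ρ (g z)) c)
    alt' (inj₁ (a , b)) = inj₁ ((a , rc) , λ p → b (proj₁ p))
    alt' (inj₂ (a , b)) = inj₂ ((λ p → a (proj₁ p)) , (b , rc))
  ... | ys , ey , py = ys , ey , trans py (cong (λ z → not (parity z)) (length-map h xs))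

xor-cancelˡ : ∀ a b → b ≡ a xor (a xor b)
xor-cancelˡ a b = sym (trans (sym (xor-assoc a a b)) (cong (_xor b) (xor-same a)))

xor-swap-cancel : ∀ a b s → ((a xor (b xor s)) xor (b xor (a xor s))) ≡ false
xor-swap-cancel true true true = refl
xor-swap-cancel true true false = refl
xor-swap-cancel true false true = refl
xor-swap-cancel true false false = refl
xor-swap-cancel false true true = refl
xor-swap-cancel false true false = refl
xor-swap-cancel false false true = refl
xor-swap-cancel false false false = refl

infix 3 _⇔_
_⇔_ : Set → Set → Set
A ⇔ B = (A → B) × (B → A)

⇔-sym : ∀ {A B} → A ⇔ B → B ⇔ A
⇔-sym (f , g) = g , f

⇔-trans : ∀ {A B C} → A ⇔ B → B ⇔ C → A ⇔ C
⇔-trans (f , g) (f' , g') = (λ a → f' (f a)) , (λ c → g (g' c))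

⇔-refl : ∀ {A} → A ⇔ A
⇔-refl = (λ a → a) , (λ a → a)

⇔-substˡ : ∀ {A : ℤ → Set} {a b} {C : Set} → a ≡ b → (A b ⇔ C) → (A a ⇔ C)
⇔-substˡ {A} refl p = p

0≤q+1⇔0≤q : ∀ q → q ≢ - 1ℤ → (0ℤ ≤ q + 1ℤ) ⇔ (0ℤ ≤ q)
0≤q+1⇔0≤q (+ m) ne = (λ _ → +≤+ z≤n) , (λ _ → +≤+ z≤n)
0≤q+1⇔0≤q -[1+ zero ] ne = ⊥-elim (ne refl)
0≤q+1⇔0≤q -[1+ suc m ] ne = (λ ()) , (λ ())

q+1≤0⇔q≤0 : ∀ q → q ≢ 0ℤ → (q + 1ℤ ≤ 0ℤ) ⇔ (q ≤ 0ℤ)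
q+1≤0⇔q≤0 (+ zero) ne = ⊥-elim (ne refl)
q+1≤0⇔q≤0 (+ suc m) ne = (λ { (+≤+ ()) }) , (λ { (+≤+ ()) })
q+1≤0⇔q≤0 -[1+ zero ] ne = (λ _ → -≤+) , (λ _ → +≤+ z≤n)
q+1≤0⇔q≤0 -[1+ suc m ] ne = (λ _ → -≤+) , (λ _ → -≤+)

0<q-1⇔0<q : ∀ q → q ≢ 1ℤ → (0ℤ < q - 1ℤ) ⇔ (0ℤ < q)
0<q-1⇔0<q (+ zero) ne = (λ ()) , (λ { (+<+ ()) })
0<q-1⇔0<q (+ suc zero) ne = ⊥-elim (ne refl)
0<q-1⇔0<q (+ suc (suc m)) ne = (λ _ → +<+ (s≤s z≤n)) , (λ _ → +<+ (s≤s z≤n))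
0<q-1⇔0<q -[1+ m ] ne = (λ ()) , (λ ())

q-1≤0⇔q≤0 : ∀ q → q ≢ 1ℤ → (q - 1ℤ ≤ 0ℤ) ⇔ (q ≤ 0ℤ)
q-1≤0⇔q≤0 (+ zero) ne = (λ _ → +≤+ z≤n) , (λ _ → -≤+)
q-1≤0⇔q≤0 (+ suc zero) ne = ⊥-elim (ne refl)
q-1≤0⇔q≤0 (+ suc (suc m)) ne = (λ { (+≤+ ()) }) , (λ { (+≤+ ()) })
q-1≤0⇔q≤0 -[1+ m ] ne = (λ _ → -≤+) , (λ _ → -≤+)

0≤q⇔0<q : ∀ q → q ≢ 0ℤ → (0ℤ ≤ q) ⇔ (0ℤ < q)
0≤q⇔0<q (+ zero) ne = ⊥-elim (ne refl)
0≤q⇔0<q (+ suc m) ne = (λ _ → +<+ (s≤s z≤n)) , (λ _ → +≤+ z≤n)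
0≤q⇔0<q -[1+ m ] ne = (λ ()) , (λ ())

parity-not-+ : ∀ a b a' b' → parity a' ≡ not (parity a) → parity b' ≡ not (parity b) → parity (a' ℕ.+ b') ≡ parity (a ℕ.+ b)
parity-not-+ a b a' b' p q = trans (parity-+ a' b') (trans (cong₂ _xor_ p q) (trans (xor-annihilates-not (parity a) (parity b)) (sym (parity-+ a b))))

sum1to : (ℕ → ℕ) → ℕ → ℕ
sum1to f zero = 0
sum1to f (suc m) = sum1to f m ℕ.+ f (suc m)

sum1to-mono-≤ : ∀ f g m → (∀ y → 0 ℕ.< y → y ℕ.≤ m → g y ℕ.≤ f y) → sum1to g m ℕ.≤ sum1to f m
sum1to-mono-≤ f g zero h = z≤n
sum1to-mono-≤ f g (suc m) h = ℕP.+-mono-≤ (sum1to-mono-≤ f g m (λ y a b → h y a (ℕP.m≤n⇒m≤1+n b))) (h (suc m) (s≤s z≤n) ℕP.≤-refl)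

sum1to-mono-< : ∀ f g m x → (∀ y → 0 ℕ.< y → y ℕ.≤ m → g y ℕ.≤ f y) → 0 ℕ.< x → x ℕ.≤ m → g x ℕ.< f x → sum1to g m ℕ.< sum1to f m
sum1to-mono-< f g zero x h () z≤n lt
sum1to-mono-< f g (suc m) x h 0<x x≤ lt with x ℕ.≟ suc m
... | yes refl = ℕP.+-mono-≤-< (sum1to-mono-≤ f g m (λ y a b → h y a (ℕP.m≤n⇒m≤1+n b))) lt
... | no ne = ℕP.+-mono-<-≤ (sum1to-mono-< f g m x (λ y a b → h y a (ℕP.m≤n⇒m≤1+n b)) 0<x (ℕP.≤-pred (ℕP.≤∧≢⇒< x≤ ne)) lt) (h (suc m) (s≤s z≤n) ℕP.≤-refl)

search1to : (Q : ℕ → Set) → (∀ y → Dec (Q y)) → ∀ m → (Σ ℕ λ x → (0 ℕ.< x) × (x ℕ.≤ m) × Q x) ⊎ (∀ x → 0 ℕ.< x → x ℕ.≤ m → ¬ Q x)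
search1to Q d zero = inj₂ (λ { x () z≤n })
search1to Q d (suc m) with d (suc m)
... | yes q = inj₁ (suc m , s≤s z≤n , ℕP.≤-refl , q)
... | no nq with search1to Q d m
...   | inj₁ (x , a , b , q) = inj₁ (x , a , ℕP.m≤n⇒m≤1+n b , q)
...   | inj₂ h = inj₂ none
  where
  none : ∀ x → 0 ℕ.< x → x ℕ.≤ suc m → ¬ Q x
  none x a b with x ℕ.≟ suc m
  ... | yes refl = nq
  ... | no ne = h x a (ℕP.≤-pred (ℕP.≤∧≢⇒< b ne))

∣a∣<∣b∣ : ∀ {a b} → 0ℤ < b → - b < a → a < b → ∣ a ∣ ℕ.< ∣ b ∣
∣a∣<∣b∣ {+ k} {+ m} _ _ (+<+ lt) = lt
∣a∣<∣b∣ { -[1+ k ]} {+ suc m} _ (-<- lt) _ = s≤s lt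
∣a∣<∣b∣ { -[1+ k ]} {+ zero} (+<+ ()) _ _
∣a∣<∣b∣ {_} { -[1+ m ]} () _ _

Gen-resp : ∀ {X f π} → Gen X f → π ≗ f → Gen X π
Gen-resp {X} {f} {π} g e = gen-comp {f = f} {g = λ z → z} g (gen-id (λ z → refl)) e

Gen-comp₃ : ∀ {X f g h π} → Gen X f → Gen X g → Gen X h → π ≗ (λ z → f (g (h z))) → Gen X π
Gen-comp₃ {X} {f} {g} {h} gf gg gh e = gen-comp {f = f} {g = λ z → g (h z)} gf (gen-comp {f = g} {g = h} gg gh (λ z → refl)) e

Gen-mono : ∀ {X Y : (ℤ → ℤ) → Set} → (∀ {f} → X f → Y f) → ∀ {π} → Gen X π → Gen Y π
Gen-mono h (gen-base x e) = gen-base (h x) e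
Gen-mono h (gen-id e) = gen-id e
Gen-mono h (gen-comp a b e) = gen-comp (Gen-mono h a) (Gen-mono h b) e
Gen-mono h (gen-inv a l r) = gen-inv (Gen-mono h a) l r

-- Affine signed permutations of period 2n, for n = m + 2

module AffineSigned (m : ℕ) where

  n : ℕ
  n = 2 ℕ.+ m
  2n : ℕ
  2n = 2 ℕ.* n
  2nℤ : ℤ
  2nℤ = + 2n
  nℤ : ℤ
  nℤ = + n

  2n≡n+n : 2n ≡ n ℕ.+ n
  2n≡n+n = cong (n ℕ.+_) (ℕP.+-identityʳ n)

  2nℤ≡nℤ+nℤ : 2nℤ ≡ nℤ + nℤ
  2nℤ≡nℤ+nℤ = cong +_ 2n≡n+n

  open CongB (ℕ.pred 2n)

  congᵇ : ℤ → ℤ → Bool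
  congᵇ = congB 2n

  infix 4 _≈_
  record _≈_ (a b : ℤ) : Set where
    constructor mk≈
    field un≈ : 2nℤ ∣ (a - b)
  open _≈_ public

  ≈-by : ∀ {a b} (q : ℤ) → a ≡ b + q * 2nℤ → a ≈ b
  ≈-by {a} {b} q e = mk≈ (divides q (trans (cong (_- b) e) (l b q 2nℤ)))
    where
    l : ∀ b q m → b + q * m - b ≡ q * m
    l = solve-∀

  ≈-witness : ∀ {a b} → a ≈ b → Σ ℤ λ q → a ≡ b + q * 2nℤ
  ≈-witness {a} {b} (mk≈ (divides q e)) = q , trans (lem a b) (cong (λ x → b + x) e)
    where
    lem : ∀ a b → a ≡ b + (a - b)
    lem = solve-∀

  ≈-refl : ∀ {a} → a ≈ a
  ≈-refl {a} = ≈-by 0ℤ (l a 2nℤ)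
    where
    l : ∀ a m → a ≡ a + 0ℤ * m
    l = solve-∀

  ≈-sym : ∀ {a b} → a ≈ b → b ≈ a
  ≈-sym {a} {b} p with ≈-witness {a} {b} p
  ... | q , refl = ≈-by (- q) (l b q 2nℤ)
    where
    l : ∀ b q m → b ≡ b + q * m + - q * m
    l = solve-∀

  ≈-trans : ∀ {a b c} → a ≈ b → b ≈ c → a ≈ c
  ≈-trans {a} {b} {c} p r with ≈-witness {a} {b} p | ≈-witness {b} {c} r
  ... | q , refl | q' , refl = ≈-by (q + q') (l c q q' 2nℤ)
    where
    l : ∀ c q q' m → c + q' * m + q * m ≡ c + (q + q') * m
    l = solve-∀

  ≈-+ : ∀ {a b} c → a ≈ b → a + c ≈ b + c
  ≈-+ {a} {b} c p with ≈-witness {a} {b} p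
  ... | q , refl = ≈-by q (l b c q 2nℤ)
    where
    l : ∀ b c q m → b + q * m + c ≡ b + c + q * m
    l = solve-∀

  ≈-neg : ∀ {a b} → a ≈ b → - a ≈ - b
  ≈-neg {a} {b} p with ≈-witness {a} {b} p
  ... | q , refl = ≈-by (- q) (l b q 2nℤ)
    where
    l : ∀ b q m → - (b + q * m) ≡ - b + (- q) * m
    l = solve-∀

  +2nℤ≈ : ∀ a → a + 2nℤ ≈ a
  +2nℤ≈ a = ≈-by 1ℤ (l a 2nℤ)
    where
    l : ∀ a m → a + m ≡ a + 1ℤ * m
    l = solve-∀

  small-multiple≡0 : ∀ d → ∣ d ∣ ℕ.< 2n → 2nℤ ∣ d → d ≡ 0ℤ
  small-multiple≡0 d lt ∣d with ∣ d ∣ in eq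
  ... | zero = ℤP.∣i∣≡0⇒i≡0 eq
  ... | suc x = ⊥-elim (ℕDiv.>⇒∤ lt (subst (2n ℕDiv.∣_) eq (∣⇒∣ᵤ ∣d)))

  Small : ℤ → Set
  Small v = ∣ v ∣ ℕ.< n

  Small-neg : ∀ {v} → Small v → Small (- v)
  Small-neg {v} s = subst (ℕ._< n) (sym (ℤP.∣-i∣≡∣i∣ v)) s

  Small-≈⇒≡ : ∀ {u v} → Small u → Small v → u ≈ v → u ≡ v
  Small-≈⇒≡ {u} {v} su sv e = l u v (small-multiple≡0 (u - v) lt (un≈ e))
    where lt : ∣ u - v ∣ ℕ.< 2n
          lt = ℕP.≤-<-trans (ℤP.∣i-j∣≤∣i∣+∣j∣ u v) (subst (ℕ._< 2n) refl (subst (∣ u ∣ ℕ.+ ∣ v ∣ ℕ.<_) (sym 2n≡n+n) (ℕP.+-mono-< su sv)))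
          l : ∀ u v → u - v ≡ 0ℤ → u ≡ v
          l u v e = trans (l2 u v) (trans (cong (_+ v) e) (ℤP.+-identityˡ v))
            where l2 : ∀ u v → u ≡ u - v + v
                  l2 = solve-∀

  eqᵇ : ℤ → ℤ → Bool
  eqᵇ u v = does (u ℤ.≟ v)

  ≈⇒congᵇ : ∀ {a b} → a ≈ b → congB 2n a b ≡ true
  ≈⇒congᵇ {a} {b} e = ∣⇒congB a b (un≈ e)
  ≉⇒congᵇ : ∀ {a b} → ¬ a ≈ b → congB 2n a b ≡ false
  ≉⇒congᵇ {a} {b} ne = ∤⇒congB-false a b (λ d → ne (mk≈ d))
  congᵇ⇒≈ : ∀ {a b} → congB 2n a b ≡ true → a ≈ b
  congᵇ⇒≈ {a} {b} e = mk≈ (congB⇒∣ a b e)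
  congᵇ⇒≉ : ∀ {a b} → congB 2n a b ≡ false → ¬ a ≈ b
  congᵇ⇒≉ {a} {b} e d = congB-false⇒∤ a b e (un≈ d)

  ≈? : ∀ a b → Dec (a ≈ b)
  ≈? a b with congB 2n a b in eq
  ... | true = yes (congᵇ⇒≈ eq)
  ... | false = no (congᵇ⇒≉ eq)

  congᵇ-inspect : ∀ j x → Σ Bool λ c → congᵇ j x ≡ c
  congᵇ-inspect j x with ≈? j x
  ... | yes p = true , ≈⇒congᵇ p
  ... | no p = false , ≉⇒congᵇ p

  residue : ℤ → ℕ
  residue v = v %ℕ 2n

  residue<2n : ∀ v → residue v ℕ.< 2n
  residue<2n v = ZDM.n%ℕd<d v 2n

  ≈residue : ∀ v → v ≈ + residue v
  ≈residue v = ≈-by (v /ℕ 2n) (ZDM.a≡a%ℕn+[a/ℕn]*n v 2n)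

  residue-injective : ∀ {x y} → x ℕ.< 2n → y ℕ.< 2n → + x ≈ + y → x ≡ y
  residue-injective {x} {y} x<M y<M e = ℤP.+-injective (l (+ x) (+ y) (small-multiple≡0 (+ x - + y) lt (un≈ e)))
    where
    lt : ∣ + x - + y ∣ ℕ.< 2n
    lt = subst (λ z → ∣ z ∣ ℕ.< 2n) (sym (ℤP.m-n≡m⊖n x y))
          (ℕP.≤-<-trans (ℤP.∣m⊝n∣≤m⊔n x y) (ℕP.⊔-lub x<M y<M))
    l : ∀ u v → u - v ≡ 0ℤ → u ≡ v
    l u v e = trans (l2 u v) (trans (cong (_+ v) e) (ℤP.+-identityˡ v))
      where
      l2 : ∀ u v → u ≡ u - v + v
      l2 = solve-∀

  residue-resp : ∀ {a b} → a ≈ b → residue a ≡ residue b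
  residue-resp {a} {b} a≉b = residue-injective (residue<2n a) (residue<2n b) (≈-trans (≈-sym (≈residue a)) (≈-trans a≉b (≈residue b)))

  residue-≈ : ∀ {a r} → a ≈ + r → r ℕ.< 2n → residue a ≡ r
  residue-≈ {a} {r} e r<M = residue-injective (residue<2n a) r<M (≈-trans (≈-sym (≈residue a)) e)

  +[2n∸r]≡2nℤ-r : ∀ r → r ℕ.≤ 2n → + (2n ℕ.∸ r) ≡ 2nℤ - + r
  +[2n∸r]≡2nℤ-r r r≤M = sym (trans (ℤP.m-n≡m⊖n 2n r) (ℤP.⊖-≥ r≤M))

  -r≈2n∸r : ∀ r → r ℕ.≤ 2n → - (+ r) ≈ + (2n ℕ.∸ r)
  -r≈2n∸r r r≤M = ≈-by (- 1ℤ) (trans (l (+ r) 2nℤ) (cong (λ z → z + - 1ℤ * 2nℤ) (sym (+[2n∸r]≡2nℤ-r r r≤M))))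
    where
    l : ∀ r m → - r ≡ m - r + - 1ℤ * m
    l = solve-∀

  -- upperHalf v holds iff v ≡ −x (mod 2n) for some window entry x.
  upperHalf : ℤ → Bool
  upperHalf v = does (n ℕ.<? residue v)

  upperHalf-resp : ∀ {a b} → a ≈ b → upperHalf a ≡ upperHalf b
  upperHalf-resp e = cong (λ r → does (n ℕ.<? r)) (residue-resp e)

  n<2n : n ℕ.< 2n
  n<2n = subst (n ℕ.<_) (sym 2n≡n+n) (ℕP.m<m+n n (s≤s z≤n))

  upperHalf-pos : ∀ x → x ℕ.< n → upperHalf (+ x) ≡ false
  upperHalf-pos x x<n = trans (cong (λ r → does (n ℕ.<? r)) (residue-≈ (≈-refl {+ x}) (ℕP.<-trans x<n n<2n)))
                         (dec-false (n ℕ.<? x) (λ p → ℕP.<-asym p x<n))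

  n<2n∸r : ∀ r → 0 ℕ.< r → r ℕ.< n → n ℕ.< 2n ℕ.∸ r
  n<2n∸r r 0<r r<n = subst (n ℕ.<_) (sym e) (ℕP.m<m+n n (ℕP.m<n⇒0<n∸m r<n))
    where
    e : 2n ℕ.∸ r ≡ n ℕ.+ (n ℕ.∸ r)
    e = trans (cong (ℕ._∸ r) 2n≡n+n) (ℕP.+-∸-assoc n (ℕP.<⇒≤ r<n))

  2n∸r≤n : ∀ r → n ℕ.≤ r → 2n ℕ.∸ r ℕ.≤ n
  2n∸r≤n r n≤r = subst (2n ℕ.∸ r ℕ.≤_) e (ℕP.∸-monoʳ-≤ 2n n≤r)
    where
    e : 2n ℕ.∸ n ≡ n
    e = trans (cong (ℕ._∸ n) 2n≡n+n) (ℕP.m+n∸n≡m n n)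

  2n∸r<2n : ∀ r → 0 ℕ.< r → r ℕ.≤ 2n → 2n ℕ.∸ r ℕ.< 2n
  2n∸r<2n r 0<r r≤M = ℕP.∸-monoʳ-< 0<r r≤M

  upperHalf-neg : ∀ x → 0 ℕ.< x → x ℕ.< n → upperHalf (- + x) ≡ true
  upperHalf-neg x 0<x x<n = trans (cong (λ r → does (n ℕ.<? r)) (residue-≈ (-r≈2n∸r x x≤M) (2n∸r<2n x 0<x x≤M)))
                                (dec-true (n ℕ.<? _) (n<2n∸r x 0<x x<n))
    where x≤M = ℕP.<⇒≤ (ℕP.<-trans x<n n<2n)

  upperHalf-neg-flip : ∀ v → ¬ v ≈ 0ℤ → ¬ v ≈ nℤ → upperHalf (- v) ≡ not (upperHalf v)
  upperHalf-neg-flip v v≉0 v≉n = trans (cong (λ r → does (n ℕ.<? r)) rr) (main r refl)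
    where
    r = residue v
    r≤M = ℕP.<⇒≤ (residue<2n v)
    r≢0 : r ≢ 0
    r≢0 e = v≉0 (subst (λ z → v ≈ + z) e (≈residue v))
    r≢n : r ≢ n
    r≢n e = v≉n (subst (λ z → v ≈ + z) e (≈residue v))
    0<r : 0 ℕ.< r
    0<r = ℕP.n≢0⇒n>0 r≢0
    rr : residue (- v) ≡ 2n ℕ.∸ r
    rr = residue-≈ (≈-trans (≈-neg (≈residue v)) (-r≈2n∸r r r≤M)) (2n∸r<2n r 0<r r≤M)
    main : ∀ r' → r' ≡ r → does (n ℕ.<? (2n ℕ.∸ r)) ≡ not (does (n ℕ.<? r'))
    main r' refl with ℕP.<-cmp r n
    ... | tri< r<n _ _ = trans (dec-true (n ℕ.<? _) (n<2n∸r r 0<r r<n)) (cong not (sym (dec-false (n ℕ.<? r) (λ p → ℕP.<-asym p r<n))))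
    ... | tri≈ _ e _ = ⊥-elim (r≢n e)
    ... | tri> _ _ n<r = trans (dec-false (n ℕ.<? _) (λ p → ℕP.<⇒≱ p (2n∸r≤n r (ℕP.<⇒≤ n<r)))) (cong not (sym (dec-true (n ℕ.<? r) n<r)))

  0≤q*2nℤ : ∀ {q} → 0ℤ ≤ q → 0ℤ ≤ q * 2nℤ
  0≤q*2nℤ {q} p = subst (_≤ q * 2nℤ) (ℤP.*-zeroˡ 2nℤ) (ℤP.*-monoʳ-≤-nonNeg 2nℤ p)

  q<0⇒0≤-q-1 : ∀ {q} → q < 0ℤ → 0ℤ ≤ - q - 1ℤ
  q<0⇒0≤-q-1 {q} p = subst (0ℤ ≤_) (l q) (ℤP.i≤j⇒0≤j-i (ℤP.i<j⇒suc[i]≤j p))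
    where
    l : ∀ q → 0ℤ - (1ℤ + q) ≡ - q - 1ℤ
    l = solve-∀

  <+multiple⇔0≤ : ∀ {c u} (q : ℤ) → c < u → u ≤ c + 2nℤ → (c < u + q * 2nℤ → 0ℤ ≤ q) × (0ℤ ≤ q → c < u + q * 2nℤ)
  <+multiple⇔0≤ {c} {u} q c<u u≤ = f , g
    where
    g : 0ℤ ≤ q → c < u + q * 2nℤ
    g p = <-by ((u - c) + q * 2nℤ) (ℤP.+-mono-<-≤ (i<j⇒0<j-i c<u) (0≤q*2nℤ p)) (l c u q 2nℤ)
      where
      l : ∀ c u q m → u + q * m ≡ c + ((u - c) + q * m)
      l = solve-∀
    f : c < u + q * 2nℤ → 0ℤ ≤ q
    f p with 0ℤ ℤ.≤? q
    ... | yes r = r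
    ... | no r = ⊥-elim (ℤP.<⇒≱ p (≤-by ((c + 2nℤ - u) + (- q - 1ℤ) * 2nℤ)
                   (ℤP.+-mono-≤ (≤⇒0≤' u≤) (0≤q*2nℤ (q<0⇒0≤-q-1 (ℤP.≰⇒> r)))) (l c u q 2nℤ)))
      where
      l : ∀ c u q m → c ≡ u + q * m + ((c + m - u) + (- q - 1ℤ) * m)
      l = solve-∀
      ≤⇒0≤' : u ≤ c + 2nℤ → 0ℤ ≤ c + 2nℤ - u
      ≤⇒0≤' = ℤP.i≤j⇒0≤j-i

  0<q⇒0≤q-1 : ∀ {q} → 0ℤ < q → 0ℤ ≤ q - 1ℤ
  0<q⇒0≤q-1 {q} p = subst (0ℤ ≤_) (l q) (ℤP.i≤j⇒0≤j-i (ℤP.i<j⇒suc[i]≤j p))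
    where
    l : ∀ q → q - (1ℤ + 0ℤ) ≡ q - 1ℤ
    l = solve-∀

  q≤0⇒0≤-q : ∀ {q} → q ≤ 0ℤ → 0ℤ ≤ - q
  q≤0⇒0≤-q {q} p = subst (0ℤ ≤_) (l q) (ℤP.i≤j⇒0≤j-i p)
    where
    l : ∀ q → 0ℤ - q ≡ - q
    l = solve-∀

  +multiple<⇔≤0 : ∀ {c u} (q : ℤ) → c - 2nℤ ≤ u → u < c → (u + q * 2nℤ < c → q ≤ 0ℤ) × (q ≤ 0ℤ → u + q * 2nℤ < c)
  +multiple<⇔≤0 {c} {u} q le u<c = f , g
    where
    g : q ≤ 0ℤ → u + q * 2nℤ < c
    g p = <-by ((c - u) + (- q) * 2nℤ) (ℤP.+-mono-<-≤ (i<j⇒0<j-i u<c) (0≤q*2nℤ (q≤0⇒0≤-q p))) (l c u q 2nℤ)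
      where
      l : ∀ c u q m → c ≡ u + q * m + ((c - u) + (- q) * m)
      l = solve-∀
    f : u + q * 2nℤ < c → q ≤ 0ℤ
    f p with q ℤ.≤? 0ℤ
    ... | yes r = r
    ... | no r = ⊥-elim (ℤP.<⇒≱ p (≤-by ((u - (c - 2nℤ)) + (q - 1ℤ) * 2nℤ)
                   (ℤP.+-mono-≤ (ℤP.i≤j⇒0≤j-i le) (0≤q*2nℤ (0<q⇒0≤q-1 (ℤP.≰⇒> r)))) (l c u q 2nℤ)))
      where
      l : ∀ c u q m → u + q * m ≡ c + ((u - (c - m)) + (q - 1ℤ) * m)
      l = solve-∀

  Aff : (ℤ → ℤ) → Set
  Aff = AffSigned n

  module AffProps {π : ℤ → ℤ} (A : Aff π) where
    inj : ∀ {x y} → π x ≡ π y → x ≡ y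
    inj = proj₁ (proj₁ A)

    per : ∀ i → π (i + 2nℤ) ≡ π i + 2nℤ
    per = proj₁ (proj₂ A)

    odd : ∀ i → π (- i) ≡ - π i
    odd = proj₂ (proj₂ A)

    surj : ∀ y → Σ ℤ λ x → π x ≡ y
    surj y with proj₂ (proj₁ A) y
    ... | x , f = x , f refl

    per⁻ : ∀ i → π (i - 2nℤ) ≡ π i - 2nℤ
    per⁻ i = trans (l (π (i - 2nℤ)) 2nℤ) (cong (_- 2nℤ) (trans (sym (per (i - 2nℤ))) (cong π (l2 i 2nℤ))))
      where
      l : ∀ a m → a ≡ a + m - m
      l = solve-∀
      l2 : ∀ i m → i - m + m ≡ i
      l2 = solve-∀

    per-posmultiple : ∀ i m → π (i + + m * 2nℤ) ≡ π i + + m * 2nℤ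
    per-posmultiple i zero = trans (cong π (l i 2nℤ)) (sym (l (π i) 2nℤ))
      where
      l : ∀ i m → i + 0ℤ * m ≡ i
      l = solve-∀
    per-posmultiple i (suc m) = begin
      π (i + + suc m * 2nℤ) ≡⟨ cong π (l i (+ m) 2nℤ) ⟩
      π ((i + + m * 2nℤ) + 2nℤ) ≡⟨ per _ ⟩
      π (i + + m * 2nℤ) + 2nℤ ≡⟨ cong (_+ 2nℤ) (per-posmultiple i m) ⟩
      π i + + m * 2nℤ + 2nℤ ≡⟨ sym (l (π i) (+ m) 2nℤ) ⟩
      π i + + suc m * 2nℤ ∎
      where
      open ≡-Reasoning
      l : ∀ i m' mz → i + (1ℤ + m') * mz ≡ (i + m' * mz) + mz
      l = solve-∀

    per-negmultiple : ∀ i m → π (i + -[1+ m ] * 2nℤ) ≡ π i + -[1+ m ] * 2nℤ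
    per-negmultiple i zero = trans (cong π (l i 2nℤ)) (trans (per⁻ i) (sym (l (π i) 2nℤ)))
      where
      l : ∀ i m → i + - 1ℤ * m ≡ i - m
      l = solve-∀
    per-negmultiple i (suc m) = begin
      π (i + -[1+ suc m ] * 2nℤ) ≡⟨ cong (λ z → π (i + z * 2nℤ)) ns ⟩
      π (i + (-[1+ m ] - 1ℤ) * 2nℤ) ≡⟨ cong π (l i (-[1+ m ]) 2nℤ) ⟩
      π ((i + -[1+ m ] * 2nℤ) - 2nℤ) ≡⟨ per⁻ _ ⟩
      π (i + -[1+ m ] * 2nℤ) - 2nℤ ≡⟨ cong (_- 2nℤ) (per-negmultiple i m) ⟩
      π i + -[1+ m ] * 2nℤ - 2nℤ ≡⟨ sym (l (π i) (-[1+ m ]) 2nℤ) ⟩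
      π i + (-[1+ m ] - 1ℤ) * 2nℤ ≡⟨ cong (λ z → π i + z * 2nℤ) (sym ns) ⟩
      π i + -[1+ suc m ] * 2nℤ ∎
      where
      open ≡-Reasoning
      ns : -[1+ suc m ] ≡ -[1+ m ] - 1ℤ
      ns = cong (λ x → -[1+ suc x ]) (sym (ℕP.+-identityʳ m))
      l : ∀ i m' mz → i + (m' - 1ℤ) * mz ≡ (i + m' * mz) - mz
      l = solve-∀

    per-multiple : ∀ i q → π (i + q * 2nℤ) ≡ π i + q * 2nℤ
    per-multiple i (+ m) = per-posmultiple i m
    per-multiple i -[1+ m ] = per-negmultiple i m

    resp≈ : ∀ {a b} → a ≈ b → π a ≈ π b
    resp≈ {a} {b} e with ≈-witness e
    ... | q , refl = ≈-by q (per-multiple b q)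

    fixes-0 : π 0ℤ ≡ 0ℤ
    fixes-0 = l (π 0ℤ) (odd 0ℤ)
      where
      l : ∀ x → x ≡ - x → x ≡ 0ℤ
      l (+ zero) e = refl
      l (+ suc x) ()
      l -[1+ x ] ()

    fixes-n : π nℤ ≡ nℤ
    fixes-n = ℤP.*-cancelˡ-≡ (+ 2) _ _ (trans (double (π nℤ)) (trans s2 (trans 2nℤ≡nℤ+nℤ (sym (double nℤ)))))
      where
      l3 : ∀ a m → m ≡ a + a → a ≡ - a + m
      l3 a m refl = solve [ a ]
      e : π nℤ ≡ - π nℤ + 2nℤ
      e = trans (cong π (l3 nℤ 2nℤ 2nℤ≡nℤ+nℤ)) (trans (per (- nℤ)) (cong (_+ 2nℤ) (odd nℤ)))
      double : ∀ x → + 2 * x ≡ x + x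
      double = solve-∀
      l4 : ∀ x m → x + (- x + m) ≡ m
      l4 = solve-∀
      s2 : π nℤ + π nℤ ≡ 2nℤ
      s2 = trans (cong (λ z → π nℤ + z) e) (l4 (π nℤ) 2nℤ)

    reflects≈ : ∀ {v w} → π v ≈ π w → v ≈ w
    reflects≈ {v} {w} e with ≈-witness e
    ... | q , e' = ≈-by q (inj (trans e' (sym (per-multiple w q))))

    pres-≉0 : ∀ {v} → ¬ v ≈ 0ℤ → ¬ π v ≈ 0ℤ
    pres-≉0 {v} ne e = ne (reflects≈ (subst (π v ≈_) (sym fixes-0) e))

    pres-≉n : ∀ {v} → ¬ v ≈ nℤ → ¬ π v ≈ nℤ
    pres-≉n {v} ne e = ne (reflects≈ (subst (π v ≈_) (sym fixes-n) e))

    upperHalf-odd : ∀ v → ¬ v ≈ 0ℤ → ¬ v ≈ nℤ → upperHalf (π (- v)) ≡ not (upperHalf (π v))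
    upperHalf-odd v a b = trans (cong upperHalf (odd v)) (upperHalf-neg-flip (π v) (pres-≉0 a) (pres-≉n b))

  upper-residue≡ : ∀ r → n ℕ.< r → r ℕ.< 2n → + r ≡ - (+ (2n ℕ.∸ r)) + 2nℤ
  upper-residue≡ r n<r r<M = trans (l (+ r) 2nℤ) (cong (λ z → - z + 2nℤ) (sym (+[2n∸r]≡2nℤ-r r (ℕP.<⇒≤ r<M))))
    where
    l : ∀ r m → r ≡ - (m - r) + m
    l = solve-∀

  upper-residue-bounds : ∀ r → n ℕ.< r → r ℕ.< 2n → (0 ℕ.< 2n ℕ.∸ r) × (2n ℕ.∸ r ℕ.< n)
  upper-residue-bounds r n<r r<M = ℕP.m<n⇒0<n∸m r<M , subst (2n ℕ.∸ r ℕ.<_) e (ℕP.∸-monoʳ-< n<r (ℕP.<⇒≤ r<M))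
    where
    e : 2n ℕ.∸ n ≡ n
    e = trans (cong (ℕ._∸ n) 2n≡n+n) (ℕP.m+n∸n≡m n n)

  Aff-ext : ∀ {π σ} → Aff π → Aff σ → (∀ x → 0 ℕ.< x → x ℕ.< n → π (+ x) ≡ σ (+ x)) → ∀ z → π z ≡ σ z
  Aff-ext {π} {σ} Aπ Aσ h z = begin
      π z ≡⟨ cong π dz ⟩
      π (+ residue z + q * 2nℤ) ≡⟨ Pi.per-multiple _ q ⟩
      π (+ residue z) + q * 2nℤ ≡⟨ cong (_+ q * 2nℤ) (base (residue z) (residue<2n z)) ⟩
      σ (+ residue z) + q * 2nℤ ≡⟨ sym (Si.per-multiple _ q) ⟩
      σ (+ residue z + q * 2nℤ) ≡⟨ cong σ (sym dz) ⟩
      σ z ∎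
    where
    open ≡-Reasoning
    module Pi = AffProps Aπ
    module Si = AffProps Aσ
    q = z /ℕ 2n
    dz : z ≡ + residue z + q * 2nℤ
    dz = ZDM.a≡a%ℕn+[a/ℕn]*n z 2n
    base : ∀ r → r ℕ.< 2n → π (+ r) ≡ σ (+ r)
    base zero _ = trans Pi.fixes-0 (sym Si.fixes-0)
    base (suc r) r<M with ℕP.<-cmp (suc r) n
    ... | tri< lt _ _ = h (suc r) (s≤s z≤n) lt
    ... | tri≈ _ refl _ = trans Pi.fixes-n (sym Si.fixes-n)
    ... | tri> _ _ gt = begin
        π (+ suc r) ≡⟨ cong π (upper-residue≡ (suc r) gt r<M) ⟩
        π (- w + 2nℤ) ≡⟨ Pi.per _ ⟩
        π (- w) + 2nℤ ≡⟨ cong (_+ 2nℤ) (Pi.odd w) ⟩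
        - π w + 2nℤ ≡⟨ cong (λ x → - x + 2nℤ) (h _ (proj₁ bd) (proj₂ bd)) ⟩
        - σ w + 2nℤ ≡⟨ cong (_+ 2nℤ) (sym (Si.odd w)) ⟩
        σ (- w) + 2nℤ ≡⟨ sym (Si.per _) ⟩
        σ (- w + 2nℤ) ≡⟨ cong σ (sym (upper-residue≡ (suc r) gt r<M)) ⟩
        σ (+ suc r) ∎
      where
      w = + (2n ℕ.∸ suc r)
      bd = upper-residue-bounds (suc r) gt r<M

  Aff-resp : ∀ {f π} → Aff f → π ≗ f → Aff π
  Aff-resp {f} {π} (((inj , sur)) , per , odd) e =
    ((λ {x} {y} p → inj (trans (sym (e x)) (trans p (e y)))) ,
     (λ y → proj₁ (sur y) , λ {z} zx → trans (e z) (proj₂ (sur y) zx))) ,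
    (λ i → trans (e _) (trans (per i) (cong (_+ 2nℤ) (sym (e i))))) ,
    (λ i → trans (e _) (trans (odd i) (cong -_ (sym (e i)))))

  Aff-id : ∀ {π} → π ≗ (λ z → z) → Aff π
  Aff-id {π} e = Aff-resp {f = λ z → z} (((λ p → p) , (λ y → y , λ zx → zx)) , (λ i → refl) , (λ i → refl)) e

  Aff-∘ : ∀ {f g π} → Aff f → Aff g → π ≗ (λ z → f (g z)) → Aff π
  Aff-∘ {f} {g} {π} Af Ag e = Aff-resp {f = λ z → f (g z)}
    (((λ p → Gi.inj (Fi.inj p)) ,
      (λ y → proj₁ (Gi.surj (proj₁ (Fi.surj y))) , λ {z} zx → trans (cong (λ w → f (g w)) zx) (trans (cong f (proj₂ (Gi.surj (proj₁ (Fi.surj y))))) (proj₂ (Fi.surj y))))) ,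
     (λ i → trans (cong f (Gi.per i)) (Fi.per _)) ,
     (λ i → trans (cong f (Gi.odd i)) (Fi.odd _))) e
    where
    module Fi = AffProps Af
    module Gi = AffProps Ag

  Aff-inverse : ∀ {f π} → Aff f → (∀ z → f (π z) ≡ z) → (∀ z → π (f z) ≡ z) → Aff π
  Aff-inverse {f} {π} Af l r =
    ((λ {x} {y} p → trans (sym (l x)) (trans (cong f p) (l y))) ,
     (λ y → f y , λ {z} zx → trans (cong π zx) (r y))) ,
    (λ i → trans (cong (λ w → π (w + 2nℤ)) (sym (l i))) (trans (cong π (sym (Fi.per (π i)))) (r _))) ,
    (λ i → trans (cong (λ w → π (- w)) (sym (l i))) (trans (cong π (sym (Fi.odd (π i)))) (r _)))
    where
    module Fi = AffProps Af

  congᵇ-respˡ : ∀ {j j' x} → j ≈ j' → congᵇ j x ≡ congᵇ j' x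
  congᵇ-respˡ {j} {j'} {x} e with ≈? j x
  ... | yes p = trans (≈⇒congᵇ p) (sym (≈⇒congᵇ (≈-trans (≈-sym e) p)))
  ... | no p = trans (≉⇒congᵇ p) (sym (≉⇒congᵇ (λ q → p (≈-trans e q))))

  -≈⇒≈- : ∀ {a b} → - a ≈ b → a ≈ - b
  -≈⇒≈- {a} {b} e = subst (_≈ - b) (neg-involutive a) (≈-neg e)

  -≈-⇒≈ : ∀ {a b} → - a ≈ - b → a ≈ b
  -≈-⇒≈ {a} {b} e = subst₂ _≈_ (neg-involutive a) (neg-involutive b) (≈-neg e)

  congᵇ-negˡ : ∀ j x → congᵇ (- j) x ≡ congᵇ j (- x)
  congᵇ-negˡ j x with ≈? (- j) x
  ... | yes p = trans (≈⇒congᵇ p) (sym (≈⇒congᵇ (-≈⇒≈- p)))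
  ... | no p = trans (≉⇒congᵇ p) (sym (≉⇒congᵇ (λ q → p (subst (λ z → - j ≈ z) (neg-involutive x) (≈-neg q)))))

  congᵇ-neg : ∀ j x → congᵇ (- j) (- x) ≡ congᵇ j x
  congᵇ-neg j x = trans (congᵇ-negˡ j (- x)) (cong (congᵇ j) (neg-involutive x))

  TranspCases : Bool → Bool → Bool → Bool → ℤ → ℤ → ℤ → ℤ
  TranspCases c1 c2 c3 c4 a b j =
    if c1 then j - a + b
    else if c2 then j - b + a
    else if c3 then j + a - b
    else if c4 then j + b - a
    else j

  transp-cases : ∀ a b j → transp n a b j ≡ TranspCases (congᵇ j a) (congᵇ j b) (congᵇ j (- a)) (congᵇ j (- b)) a b j
  transp-cases a b j = refl

  LoopCases : Bool → Bool → ℤ → ℤ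
  LoopCases c1 c2 j = if c1 then j + 2nℤ else if c2 then j - 2nℤ else j

  loop-cases : ∀ i j → loop n i j ≡ LoopCases (congᵇ j i) (congᵇ j (- i)) j
  loop-cases i j = refl

  record Nondegenerate (a b : ℤ) : Set where
    field
      a≉b : ¬ a ≈ b
      a≉-b : ¬ a ≈ - b
      a≉-a : ¬ a ≈ - a
      b≉-b : ¬ b ≈ - b

  congᵇ-+2nℤ : ∀ {j x} → congᵇ (j + 2nℤ) x ≡ congᵇ j x
  congᵇ-+2nℤ {j} = congᵇ-respˡ (+2nℤ≈ j)

  transp-per : ∀ a b j → transp n a b (j + 2nℤ) ≡ transp n a b j + 2nℤ
  transp-per a b j rewrite congᵇ-+2nℤ {j} {a} | congᵇ-+2nℤ {j} {b} | congᵇ-+2nℤ {j} { - a} | congᵇ-+2nℤ {j} { - b}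
    with congᵇ j a | congᵇ j b | congᵇ j (- a) | congᵇ j (- b)
  ... | true | _ | _ | _ = l j a b 2nℤ
    where
    l : ∀ j a b m → j + m - a + b ≡ j - a + b + m
    l = solve-∀
  ... | false | true | _ | _ = l j a b 2nℤ
    where
    l : ∀ j a b m → j + m - b + a ≡ j - b + a + m
    l = solve-∀
  ... | false | false | true | _ = l j a b 2nℤ
    where
    l : ∀ j a b m → j + m + a - b ≡ j + a - b + m
    l = solve-∀
  ... | false | false | false | true = l j a b 2nℤ
    where
    l : ∀ j a b m → j + m + b - a ≡ j + b - a + m
    l = solve-∀
  ... | false | false | false | false = refl

  ≈-common : ∀ {j x y} → j ≈ x → j ≈ y → x ≈ y
  ≈-common p q = ≈-trans (≈-sym p) q

  congᵇ-apart : ∀ {x y j} → ¬ x ≈ y → j ≈ x → congᵇ j y ≡ false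
  congᵇ-apart x≉y jx = ≉⇒congᵇ (λ jy → x≉y (≈-common jx jy))

  transp-at-a : ∀ {a b j} → congᵇ j a ≡ true → transp n a b j ≡ j - a + b
  transp-at-a {a} {b} {j} e = subst (λ c → TranspCases c (congᵇ j b) (congᵇ j (- a)) (congᵇ j (- b)) a b j ≡ j - a + b) (sym e) refl
  transp-at-b : ∀ {a b j} → congᵇ j a ≡ false → congᵇ j b ≡ true → transp n a b j ≡ j - b + a
  transp-at-b {a} {b} {j} e1 e2 = subst₂ (λ c d → TranspCases c d (congᵇ j (- a)) (congᵇ j (- b)) a b j ≡ j - b + a) (sym e1) (sym e2) refl
  transp-at-neg-a : ∀ {a b j} → congᵇ j a ≡ false → congᵇ j b ≡ false → congᵇ j (- a) ≡ true → transp n a b j ≡ j + a - b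
  transp-at-neg-a {a} {b} {j} e1 e2 e3 rewrite transp-cases a b j | e1 | e2 | e3 = refl
  transp-at-neg-b : ∀ {a b j} → congᵇ j a ≡ false → congᵇ j b ≡ false → congᵇ j (- a) ≡ false → congᵇ j (- b) ≡ true → transp n a b j ≡ j + b - a
  transp-at-neg-b {a} {b} {j} e1 e2 e3 e4 rewrite transp-cases a b j | e1 | e2 | e3 | e4 = refl
  transp-away : ∀ {a b j} → congᵇ j a ≡ false → congᵇ j b ≡ false → congᵇ j (- a) ≡ false → congᵇ j (- b) ≡ false → transp n a b j ≡ j
  transp-away {a} {b} {j} e1 e2 e3 e4 rewrite transp-cases a b j | e1 | e2 | e3 | e4 = refl

  module Transp {a b : ℤ} (nd : Nondegenerate a b) where
    open Nondegenerate nd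

    odd : ∀ j → transp n a b (- j) ≡ - transp n a b j
    odd j rewrite congᵇ-negˡ j a | congᵇ-negˡ j b | congᵇ-neg j a | congᵇ-neg j b
      with congᵇ j a in e1 | congᵇ j b in e2 | congᵇ j (- a) in e3 | congᵇ j (- b) in e4
    ... | true | _ | true | _ = ⊥-elim (a≉-a (≈-common (congᵇ⇒≈ {j} {a} e1) (congᵇ⇒≈ {j} { - a} e3)))
    ... | true | _ | false | true = ⊥-elim (a≉-b (≈-common (congᵇ⇒≈ {j} {a} e1) (congᵇ⇒≈ {j} { - b} e4)))
    ... | true | _ | false | false = l j a b
      where
      l : ∀ j a b → - j + a - b ≡ - (j - a + b)
      l = solve-∀
    ... | false | true | true | _ = ⊥-elim (a≉-b (-≈⇒≈- (≈-common (congᵇ⇒≈ {j} { - a} e3) (congᵇ⇒≈ {j} {b} e2))))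
    ... | false | true | false | true = ⊥-elim (b≉-b (≈-common (congᵇ⇒≈ {j} {b} e2) (congᵇ⇒≈ {j} { - b} e4)))
    ... | false | true | false | false = l j a b
      where
      l : ∀ j a b → - j + b - a ≡ - (j - b + a)
      l = solve-∀
    ... | false | false | true | _ = l j a b
      where
      l : ∀ j a b → - j - a + b ≡ - (j + a - b)
      l = solve-∀
    ... | false | false | false | true = l j a b
      where
      l : ∀ j a b → - j - b + a ≡ - (j + b - a)
      l = solve-∀
    ... | false | false | false | false = refl

    inv-at-a : ∀ {j} → congᵇ j a ≡ true → transp n a b (transp n a b j) ≡ j
    inv-at-a {j} e1 = trans (cong (transp n a b) (transp-at-a {a} {b} {j} e1))
        (trans (transp-at-b {a} {b} {j'} (congᵇ-apart (λ p → a≉b (≈-sym p)) j'b) (≈⇒congᵇ j'b)) (l j a b))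
      where
      j' = j - a + b
      j'b : j' ≈ b
      j'b = subst (λ z → j' ≈ z) (l2 a b) (≈-+ b (≈-+ (- a) (congᵇ⇒≈ {j} {a} e1)))
        where
        l2 : ∀ a b → a - a + b ≡ b
        l2 = solve-∀
      l : ∀ j a b → j - a + b - b + a ≡ j
      l = solve-∀

    inv-at-b : ∀ {j} → congᵇ j a ≡ false → congᵇ j b ≡ true → transp n a b (transp n a b j) ≡ j
    inv-at-b {j} e1 e2 = trans (cong (transp n a b) (transp-at-b {a} {b} {j} e1 e2))
        (trans (transp-at-a {a} {b} {j'} (≈⇒congᵇ j'a)) (l j a b))
      where
      j' = j - b + a
      j'a : j' ≈ a
      j'a = subst (λ z → j' ≈ z) (l2 a b) (≈-+ a (≈-+ (- b) (congᵇ⇒≈ {j} {b} e2)))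
        where
        l2 : ∀ a b → b - b + a ≡ a
        l2 = solve-∀
      l : ∀ j a b → j - b + a - a + b ≡ j
      l = solve-∀

    inv-at-neg-a : ∀ {j} → congᵇ j a ≡ false → congᵇ j b ≡ false → congᵇ j (- a) ≡ true → transp n a b (transp n a b j) ≡ j
    inv-at-neg-a {j} e1 e2 e3 = trans (cong (transp n a b) (transp-at-neg-a {a} {b} {j} e1 e2 e3))
        (trans (transp-at-neg-b {a} {b} {j'} (congᵇ-apart (λ p → a≉-b (≈-sym p)) j'b)
                                   (congᵇ-apart (λ p → b≉-b (≈-sym p)) j'b)
                                   (congᵇ-apart (λ p → a≉b (≈-sym (-≈-⇒≈ p))) j'b)
                                   (≈⇒congᵇ j'b)) (l j a b))
      where
      j' = j + a - b
      j'b : j' ≈ - b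
      j'b = subst (λ z → j' ≈ z) (l2 a b) (≈-+ (- b) (≈-+ a (congᵇ⇒≈ {j} { - a} e3)))
        where
        l2 : ∀ a b → - a + a - b ≡ - b
        l2 = solve-∀
      l : ∀ j a b → j + a - b + b - a ≡ j
      l = solve-∀

    inv-at-neg-b : ∀ {j} → congᵇ j a ≡ false → congᵇ j b ≡ false → congᵇ j (- a) ≡ false → congᵇ j (- b) ≡ true → transp n a b (transp n a b j) ≡ j
    inv-at-neg-b {j} e1 e2 e3 e4 = trans (cong (transp n a b) (transp-at-neg-b {a} {b} {j} e1 e2 e3 e4))
        (trans (transp-at-neg-a {a} {b} {j'} (congᵇ-apart (λ p → a≉-a (≈-sym p)) j'a)
                                   (congᵇ-apart (λ p → a≉-b (-≈⇒≈- p)) j'a)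
                                   (≈⇒congᵇ j'a)) (l j a b))
      where
      j' = j + b - a
      j'a : j' ≈ - a
      j'a = subst (λ z → j' ≈ z) (l2 a b) (≈-+ (- a) (≈-+ b (congᵇ⇒≈ {j} { - b} e4)))
        where
        l2 : ∀ a b → - b + b - a ≡ - a
        l2 = solve-∀
      l : ∀ j a b → j + b - a + a - b ≡ j
      l = solve-∀

    inv : ∀ j → transp n a b (transp n a b j) ≡ j
    inv j with congᵇ-inspect j a | congᵇ-inspect j b | congᵇ-inspect j (- a) | congᵇ-inspect j (- b)
    ... | true , e1 | _ | _ | _ = inv-at-a e1
    ... | false , e1 | true , e2 | _ | _ = inv-at-b e1 e2
    ... | false , e1 | false , e2 | true , e3 | _ = inv-at-neg-a e1 e2 e3
    ... | false , e1 | false , e2 | false , e3 | true , e4 = inv-at-neg-b e1 e2 e3 e4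
    ... | false , e1 | false , e2 | false , e3 | false , e4 =
      trans (cong (transp n a b) (transp-away {a} {b} {j} e1 e2 e3 e4)) (transp-away {a} {b} {j} e1 e2 e3 e4)

    aff : Aff (transp n a b)
    aff = ((λ {x} {y} p → trans (sym (inv x)) (trans (cong (transp n a b) p) (inv y))) ,
           (λ y → transp n a b y , λ {z} zx → trans (cong (transp n a b) zx) (inv y))) ,
          transp-per a b , odd

    transp-comm : ∀ j → transp n a b j ≡ transp n b a j
    transp-comm j with congᵇ-inspect j a | congᵇ-inspect j b | congᵇ-inspect j (- a) | congᵇ-inspect j (- b)
    ... | true , e1 | _ | _ | _ = trans (transp-at-a {a} {b} {j} e1) (sym (transp-at-b {b} {a} {j} (congᵇ-apart a≉b (congᵇ⇒≈ {j} {a} e1)) e1))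
    ... | false , e1 | true , e2 | _ | _ = trans (transp-at-b {a} {b} {j} e1 e2) (sym (transp-at-a {b} {a} {j} e2))
    ... | false , e1 | false , e2 | true , e3 | _ = trans (transp-at-neg-a {a} {b} {j} e1 e2 e3)
          (sym (transp-at-neg-b {b} {a} {j} e2 e1 (congᵇ-apart (λ p → a≉b (-≈-⇒≈ p)) (congᵇ⇒≈ {j} { - a} e3)) e3))
    ... | false , e1 | false , e2 | false , e3 | true , e4 = trans (transp-at-neg-b {a} {b} {j} e1 e2 e3 e4) (sym (transp-at-neg-a {b} {a} {j} e2 e1 e4))
    ... | false , e1 | false , e2 | false , e3 | false , e4 = trans (transp-away {a} {b} {j} e1 e2 e3 e4) (sym (transp-away {b} {a} {j} e2 e1 e4 e3))

    transp-neg : ∀ j → transp n a b j ≡ transp n (- a) (- b) j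
    transp-neg j with congᵇ-inspect j a | congᵇ-inspect j b | congᵇ-inspect j (- a) | congᵇ-inspect j (- b)
    ... | true , e1 | _ | _ | _ = trans (transp-at-a {a} {b} {j} e1)
          (trans (l j a b) (sym (transp-at-neg-a { - a} { - b} {j} (congᵇ-apart a≉-a ja) (congᵇ-apart a≉-b ja) (trans (cong (congᵇ j) (neg-involutive a)) e1))))
      where
      ja = congᵇ⇒≈ {j} {a} e1
      l : ∀ j a b → j - a + b ≡ j + - a - - b
      l = solve-∀
    ... | false , e1 | true , e2 | _ | _ = trans (transp-at-b {a} {b} {j} e1 e2)
          (trans (l j a b) (sym (transp-at-neg-b { - a} { - b} {j} (congᵇ-apart (λ p → a≉-b (-≈⇒≈- (≈-sym p))) jb) (congᵇ-apart b≉-b jb) (trans (cong (congᵇ j) (neg-involutive a)) e1) (trans (cong (congᵇ j) (neg-involutive b)) e2))))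
      where
      jb = congᵇ⇒≈ {j} {b} e2
      l : ∀ j a b → j - b + a ≡ j + - b - - a
      l = solve-∀
    ... | false , e1 | false , e2 | true , e3 | _ = trans (transp-at-neg-a {a} {b} {j} e1 e2 e3) (trans (l j a b) (sym (transp-at-a { - a} { - b} {j} e3)))
      where
      l : ∀ j a b → j + a - b ≡ j - - a + - b
      l = solve-∀
    ... | false , e1 | false , e2 | false , e3 | true , e4 = trans (transp-at-neg-b {a} {b} {j} e1 e2 e3 e4) (trans (l j a b) (sym (transp-at-b { - a} { - b} {j} e3 e4)))
      where
      l : ∀ j a b → j + b - a ≡ j - - b + - a
      l = solve-∀
    ... | false , e1 | false , e2 | false , e3 | false , e4 = trans (transp-away {a} {b} {j} e1 e2 e3 e4)
          (sym (transp-away { - a} { - b} {j} e3 e4 (trans (cong (congᵇ j) (neg-involutive a)) e1) (trans (cong (congᵇ j) (neg-involutive b)) e2)))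

    shift≈ : ∀ {j x} y → j ≈ x → j - x + y ≈ y
    shift≈ {j} {x} y e = subst (λ z → j - x + y ≈ z) (l x y) (≈-+ y (≈-+ (- x) e))
      where
      l : ∀ x y → x - x + y ≡ y
      l = solve-∀

    c-a : ∀ {j} → j ≈ a → transp n a b j ≈ b
    c-a {j} e = subst (_≈ b) (sym (transp-at-a {a} {b} {j} (≈⇒congᵇ e))) (shift≈ b e)

    c-b : ∀ {j} → j ≈ b → transp n a b j ≈ a
    c-b {j} e = subst (_≈ a) (sym (transp-at-b {a} {b} {j} (congᵇ-apart (λ p → a≉b (≈-sym p)) e) (≈⇒congᵇ e))) (shift≈ a e)

    c-na : ∀ {j} → j ≈ - a → transp n a b j ≈ - b
    c-na {j} e = subst (_≈ - b) (trans (l j a b) (sym (transp-at-neg-a {a} {b} {j} (congᵇ-apart (λ p → a≉-a (≈-sym p)) e) (congᵇ-apart (λ p → a≉-b (-≈⇒≈- p)) e) (≈⇒congᵇ e)))) (shift≈ (- b) e)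
      where
      l : ∀ j a b → j - - a + - b ≡ j + a - b
      l = solve-∀

    c-nb : ∀ {j} → j ≈ - b → transp n a b j ≈ - a
    c-nb {j} e = subst (_≈ - a) (trans (l j a b) (sym (transp-at-neg-b {a} {b} {j} (congᵇ-apart (λ p → a≉-b (≈-sym p)) e) (congᵇ-apart (λ p → b≉-b (≈-sym p)) e) (congᵇ-apart (λ p → a≉b (≈-sym (-≈-⇒≈ p))) e) (≈⇒congᵇ e)))) (shift≈ (- a) e)
      where
      l : ∀ j a b → j - - b + - a ≡ j + b - a
      l = solve-∀

    c-0 : ∀ {j} → ¬ j ≈ a → ¬ j ≈ b → ¬ j ≈ - a → ¬ j ≈ - b → transp n a b j ≡ j
    c-0 {j} p q r s = transp-away {a} {b} {j} (≉⇒congᵇ p) (≉⇒congᵇ q) (≉⇒congᵇ r) (≉⇒congᵇ s)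

  loop-at-i : ∀ {i j} → congᵇ j i ≡ true → loop n i j ≡ j + 2nℤ
  loop-at-i {i} {j} e rewrite loop-cases i j | e = refl
  loop-at-neg-i : ∀ {i j} → congᵇ j i ≡ false → congᵇ j (- i) ≡ true → loop n i j ≡ j - 2nℤ
  loop-at-neg-i {i} {j} e1 e2 rewrite loop-cases i j | e1 | e2 = refl
  loop-away : ∀ {i j} → congᵇ j i ≡ false → congᵇ j (- i) ≡ false → loop n i j ≡ j
  loop-away {i} {j} e1 e2 rewrite loop-cases i j | e1 | e2 = refl

  loop-≈ : ∀ i j → loop n i j ≈ j
  loop-≈ i j with congᵇ-inspect j i | congᵇ-inspect j (- i)
  ... | true , e1 | _ = subst (_≈ j) (sym (loop-at-i {i} {j} e1)) (+2nℤ≈ j)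
  ... | false , e1 | true , e2 = subst (_≈ j) (sym (loop-at-neg-i {i} {j} e1 e2)) (≈-by (- 1ℤ) (l j 2nℤ))
    where
    l : ∀ j m → j - m ≡ j + - 1ℤ * m
    l = solve-∀
  ... | false , e1 | false , e2 = subst (_≈ j) (sym (loop-away {i} {j} e1 e2)) ≈-refl

  module Loop {i : ℤ} (i≉-i : ¬ i ≈ - i) where
    per : ∀ j → loop n i (j + 2nℤ) ≡ loop n i j + 2nℤ
    per j with congᵇ-inspect j i | congᵇ-inspect j (- i)
    ... | true , e1 | _ = trans (loop-at-i {i} {j + 2nℤ} (trans (congᵇ-+2nℤ {j} {i}) e1)) (cong (_+ 2nℤ) (sym (loop-at-i {i} {j} e1)))
    ... | false , e1 | true , e2 = trans (loop-at-neg-i {i} {j + 2nℤ} (trans (congᵇ-+2nℤ {j} {i}) e1) (trans (congᵇ-+2nℤ {j} { - i}) e2)) (trans (l j 2nℤ) (cong (_+ 2nℤ) (sym (loop-at-neg-i {i} {j} e1 e2))))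
      where
      l : ∀ j m → j + m - m ≡ j - m + m
      l = solve-∀
    ... | false , e1 | false , e2 = trans (loop-away {i} {j + 2nℤ} (trans (congᵇ-+2nℤ {j} {i}) e1) (trans (congᵇ-+2nℤ {j} { - i}) e2)) (cong (_+ 2nℤ) (sym (loop-away {i} {j} e1 e2)))

    odd : ∀ j → loop n i (- j) ≡ - loop n i j
    odd j with congᵇ-inspect j i | congᵇ-inspect j (- i)
    ... | true , e1 | true , e2 = ⊥-elim (i≉-i (≈-common (congᵇ⇒≈ {j} {i} e1) (congᵇ⇒≈ {j} { - i} e2)))
    ... | true , e1 | false , e2 = trans (loop-at-neg-i {i} { - j} (trans (congᵇ-negˡ j i) e2) (trans (congᵇ-neg j i) e1))
                                   (trans (l j 2nℤ) (cong -_ (sym (loop-at-i {i} {j} e1))))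
      where
      l : ∀ j m → - j - m ≡ - (j + m)
      l = solve-∀
    ... | false , e1 | true , e2 = trans (loop-at-i {i} { - j} (trans (congᵇ-negˡ j i) e2))
                                   (trans (l j 2nℤ) (cong -_ (sym (loop-at-neg-i {i} {j} e1 e2))))
      where
      l : ∀ j m → - j + m ≡ - (j - m)
      l = solve-∀
    ... | false , e1 | false , e2 = trans (loop-away {i} { - j} (trans (congᵇ-negˡ j i) e2) (trans (congᵇ-neg j i) e1))
                                   (cong -_ (sym (loop-away {i} {j} e1 e2)))

    inv : ∀ j → loop n (- i) (loop n i j) ≡ j
    inv j with congᵇ-inspect j i | congᵇ-inspect j (- i)
    ... | true , e1 | _ = trans (cong (loop n (- i)) (loop-at-i {i} {j} e1))
          (trans (loop-at-neg-i { - i} {j + 2nℤ} (≉⇒congᵇ (λ p → i≉-i (≈-common (≈-trans (+2nℤ≈ j) (congᵇ⇒≈ {j} {i} e1)) p)))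
                       (trans (cong (congᵇ (j + 2nℤ)) (neg-involutive i)) (≈⇒congᵇ (≈-trans (+2nℤ≈ j) (congᵇ⇒≈ {j} {i} e1)))))
                 (l j 2nℤ))
      where
      l : ∀ j m → j + m - m ≡ j
      l = solve-∀
    ... | false , e1 | true , e2 = trans (cong (loop n (- i)) (loop-at-neg-i {i} {j} e1 e2))
          (trans (loop-at-i { - i} {j - 2nℤ} (≈⇒congᵇ (≈-trans jm (congᵇ⇒≈ {j} { - i} e2)))) (l j 2nℤ))
      where
      l : ∀ j m → j - m + m ≡ j
      l = solve-∀
      jm : j - 2nℤ ≈ j
      jm = ≈-by (- 1ℤ) (l2 j 2nℤ)
        where
        l2 : ∀ j m → j - m ≡ j + - 1ℤ * m
        l2 = solve-∀
    ... | false , e1 | false , e2 = trans (cong (loop n (- i)) (loop-away {i} {j} e1 e2))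
          (loop-away { - i} {j} e2 (trans (cong (congᵇ j) (neg-involutive i)) e1))

  loop-inverseˡ : ∀ {i} → ¬ i ≈ - i → ∀ z → loop n (- i) (loop n i z) ≡ z
  loop-inverseˡ i≉-i = Loop.inv i≉-i

  loop-inverseʳ : ∀ {i} → ¬ i ≈ - i → ∀ z → loop n i (loop n (- i) z) ≡ z
  loop-inverseʳ {i} i≉-i z = subst (λ w → loop n w (loop n (- i) z) ≡ z) (neg-involutive i) (Loop.inv -i≉i z)
    where
    -i≉i : ¬ (- i) ≈ - - i
    -i≉i p = i≉-i (≈-sym (subst (λ z → - i ≈ z) (neg-involutive i) p))

  Aff-loop : ∀ {i} → ¬ i ≈ - i → Aff (loop n i)
  Aff-loop {i} i≉-i =
    ((λ {x} {y} p → trans (sym (loop-inverseˡ i≉-i x)) (trans (cong (loop n (- i)) p) (loop-inverseˡ i≉-i y))) ,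
     (λ y → loop n (- i) y , λ {z} zx → trans (cong (loop n i) zx) (loop-inverseʳ i≉-i y))) ,
    Loop.per i≉-i , Loop.odd i≉-i

  -- The sign change of the class of a: an affine signed permutation outside
  -- S̃^jes, used to move between the two parities.
  signFlip : ℤ → ℤ → ℤ
  signFlip a j = if congᵇ j a then j - a - a else if congᵇ j (- a) then j + a + a else j

  flip-at-a : ∀ {a j} → congᵇ j a ≡ true → signFlip a j ≡ j - a - a
  flip-at-a {a} {j} e = subst (λ c → (if c then j - a - a else if congᵇ j (- a) then j + a + a else j) ≡ j - a - a) (sym e) refl
  flip-at-neg-a : ∀ {a j} → congᵇ j a ≡ false → congᵇ j (- a) ≡ true → signFlip a j ≡ j + a + a
  flip-at-neg-a {a} {j} e1 e2 = subst₂ (λ c d → (if c then j - a - a else if d then j + a + a else j) ≡ j + a + a) (sym e1) (sym e2) refl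
  flip-away : ∀ {a j} → congᵇ j a ≡ false → congᵇ j (- a) ≡ false → signFlip a j ≡ j
  flip-away {a} {j} e1 e2 = subst₂ (λ c d → (if c then j - a - a else if d then j + a + a else j) ≡ j) (sym e1) (sym e2) refl

  module SignFlip {a : ℤ} (a≉-a : ¬ a ≈ - a) where
    per : ∀ j → signFlip a (j + 2nℤ) ≡ signFlip a j + 2nℤ
    per j with congᵇ-inspect j a | congᵇ-inspect j (- a)
    ... | true , e1 | _ = trans (flip-at-a {a} {j + 2nℤ} (trans (congᵇ-+2nℤ {j} {a}) e1)) (trans (l j a 2nℤ) (cong (_+ 2nℤ) (sym (flip-at-a {a} {j} e1))))
      where
      l : ∀ j a m → j + m - a - a ≡ j - a - a + m
      l = solve-∀
    ... | false , e1 | true , e2 = trans (flip-at-neg-a {a} {j + 2nℤ} (trans (congᵇ-+2nℤ {j} {a}) e1) (trans (congᵇ-+2nℤ {j} { - a}) e2)) (trans (l j a 2nℤ) (cong (_+ 2nℤ) (sym (flip-at-neg-a {a} {j} e1 e2))))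
      where
      l : ∀ j a m → j + m + a + a ≡ j + a + a + m
      l = solve-∀
    ... | false , e1 | false , e2 = trans (flip-away {a} {j + 2nℤ} (trans (congᵇ-+2nℤ {j} {a}) e1) (trans (congᵇ-+2nℤ {j} { - a}) e2)) (cong (_+ 2nℤ) (sym (flip-away {a} {j} e1 e2)))

    odd : ∀ j → signFlip a (- j) ≡ - signFlip a j
    odd j with congᵇ-inspect j a | congᵇ-inspect j (- a)
    ... | true , e1 | true , e2 = ⊥-elim (a≉-a (≈-common (congᵇ⇒≈ {j} {a} e1) (congᵇ⇒≈ {j} { - a} e2)))
    ... | true , e1 | false , e2 = trans (flip-at-neg-a {a} { - j} (trans (congᵇ-negˡ j a) e2) (trans (congᵇ-neg j a) e1))
                                   (trans (l j a) (cong -_ (sym (flip-at-a {a} {j} e1))))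
      where
      l : ∀ j a → - j + a + a ≡ - (j - a - a)
      l = solve-∀
    ... | false , e1 | true , e2 = trans (flip-at-a {a} { - j} (trans (congᵇ-negˡ j a) e2))
                                   (trans (l j a) (cong -_ (sym (flip-at-neg-a {a} {j} e1 e2))))
      where
      l : ∀ j a → - j - a - a ≡ - (j + a + a)
      l = solve-∀
    ... | false , e1 | false , e2 = trans (flip-away {a} { - j} (trans (congᵇ-negˡ j a) e2) (trans (congᵇ-neg j a) e1))
                                   (cong -_ (sym (flip-away {a} {j} e1 e2)))

    inv : ∀ j → signFlip a (signFlip a j) ≡ j
    inv j with congᵇ-inspect j a | congᵇ-inspect j (- a)
    ... | true , e1 | _ = trans (cong (signFlip a) (flip-at-a {a} {j} e1))
          (trans (flip-at-neg-a {a} {j - a - a} (≉⇒congᵇ (λ p → a≉-a (≈-sym (≈-common p' p)))) (≈⇒congᵇ p')) (l j a))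
      where
      l : ∀ j a → j - a - a + a + a ≡ j
      l = solve-∀
      p' : j - a - a ≈ - a
      p' = subst (λ z → j - a - a ≈ z) (l2 a) (≈-+ (- a) (≈-+ (- a) (congᵇ⇒≈ {j} {a} e1)))
        where
        l2 : ∀ a → a - a - a ≡ - a
        l2 = solve-∀
    ... | false , e1 | true , e2 = trans (cong (signFlip a) (flip-at-neg-a {a} {j} e1 e2))
          (trans (flip-at-a {a} {j + a + a} (≈⇒congᵇ p')) (l j a))
      where
      l : ∀ j a → j + a + a - a - a ≡ j
      l = solve-∀
      p' : j + a + a ≈ a
      p' = subst (λ z → j + a + a ≈ z) (l2 a) (≈-+ a (≈-+ a (congᵇ⇒≈ {j} { - a} e2)))
        where
        l2 : ∀ a → - a + a + a ≡ a
        l2 = solve-∀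
    ... | false , e1 | false , e2 = trans (cong (signFlip a) (flip-away {a} {j} e1 e2)) (flip-away {a} {j} e1 e2)

    aff : Aff (signFlip a)
    aff = ((λ {x} {y} p → trans (sym (inv x)) (trans (cong (signFlip a) p) (inv y))) ,
           (λ y → signFlip a y , λ {z} zx → trans (cong (signFlip a) zx) (inv y))) , per , odd

  module Conjugation {s : ℤ → ℤ} (As : Aff s) where
    open AffProps As

    congᵇ-map : ∀ x y → congᵇ (s x) (s y) ≡ congᵇ x y
    congᵇ-map x y with ≈? x y
    ... | yes p = trans (≈⇒congᵇ (resp≈ p)) (sym (≈⇒congᵇ p))
    ... | no p = trans (≉⇒congᵇ (λ q → p (reflects≈ q))) (sym (≉⇒congᵇ p))

    congᵇ-map-neg : ∀ x y → congᵇ (s x) (- s y) ≡ congᵇ x (- y)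
    congᵇ-map-neg x y = trans (cong (congᵇ (s x)) (sym (odd y))) (congᵇ-map x (- y))

    map-shift : ∀ {x a} b → x ≈ a → s (x - a + b) ≡ s x - s a + s b
    map-shift {x} {a} b e with ≈-witness e
    ... | q , refl = begin
        s (a + q * 2nℤ - a + b) ≡⟨ cong s (l a b q 2nℤ) ⟩
        s (b + q * 2nℤ) ≡⟨ per-multiple b q ⟩
        s b + q * 2nℤ ≡⟨ l2 (s a) (s b) (q * 2nℤ) ⟩
        s a + q * 2nℤ - s a + s b ≡⟨ cong (λ z → z - s a + s b) (sym (per-multiple a q)) ⟩
        s (a + q * 2nℤ) - s a + s b ∎
      where
      open ≡-Reasoning
      l : ∀ a b q m → a + q * m - a + b ≡ b + q * m
      l = solve-∀
      l2 : ∀ sa sb w → sb + w ≡ sa + w - sa + sb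
      l2 = solve-∀

    conj-transp : ∀ a b x → s (transp n a b x) ≡ transp n (s a) (s b) (s x)
    conj-transp a b x with congᵇ-inspect x a | congᵇ-inspect x b | congᵇ-inspect x (- a) | congᵇ-inspect x (- b)
    ... | true , e1 | _ | _ | _ = trans (cong s (transp-at-a {a} {b} {x} e1))
          (trans (map-shift b (congᵇ⇒≈ {x} {a} e1)) (sym (transp-at-a {s a} {s b} {s x} (trans (congᵇ-map x a) e1))))
    ... | false , e1 | true , e2 | _ | _ = trans (cong s (transp-at-b {a} {b} {x} e1 e2))
          (trans (map-shift a (congᵇ⇒≈ {x} {b} e2)) (sym (transp-at-b {s a} {s b} {s x} (trans (congᵇ-map x a) e1) (trans (congᵇ-map x b) e2))))
    ... | false , e1 | false , e2 | true , e3 | _ = trans (cong s (transp-at-neg-a {a} {b} {x} e1 e2 e3))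
          (trans (cong s (l x a b)) (trans (map-shift (- b) (congᵇ⇒≈ {x} { - a} e3))
            (trans (trans (cong₂ (λ u v → s x - u + v) (odd a) (odd b)) (sym (l x' (s a) (s b))))
            (sym (transp-at-neg-a {s a} {s b} {s x} (trans (congᵇ-map x a) e1) (trans (congᵇ-map x b) e2) (trans (congᵇ-map-neg x a) e3))))))
      where
      x' = s x
      l : ∀ x a b → x + a - b ≡ x - - a + - b
      l = solve-∀
    ... | false , e1 | false , e2 | false , e3 | true , e4 = trans (cong s (transp-at-neg-b {a} {b} {x} e1 e2 e3 e4))
          (trans (cong s (l x b a)) (trans (map-shift (- a) (congᵇ⇒≈ {x} { - b} e4))
            (trans (trans (cong₂ (λ u v → s x - u + v) (odd b) (odd a)) (sym (l x' (s b) (s a))))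
            (sym (transp-at-neg-b {s a} {s b} {s x} (trans (congᵇ-map x a) e1) (trans (congᵇ-map x b) e2) (trans (congᵇ-map-neg x a) e3) (trans (congᵇ-map-neg x b) e4))))))
      where
      x' = s x
      l : ∀ x a b → x + a - b ≡ x - - a + - b
      l = solve-∀
    ... | false , e1 | false , e2 | false , e3 | false , e4 = trans (cong s (transp-away {a} {b} {x} e1 e2 e3 e4))
          (sym (transp-away {s a} {s b} {s x} (trans (congᵇ-map x a) e1) (trans (congᵇ-map x b) e2) (trans (congᵇ-map-neg x a) e3) (trans (congᵇ-map-neg x b) e4)))

    conj-loop : ∀ i x → s (loop n i x) ≡ loop n (s i) (s x)
    conj-loop i x with congᵇ-inspect x i | congᵇ-inspect x (- i)
    ... | true , e1 | _ = trans (cong s (loop-at-i {i} {x} e1)) (trans (per x) (sym (loop-at-i {s i} {s x} (trans (congᵇ-map x i) e1))))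
    ... | false , e1 | true , e2 = trans (cong s (loop-at-neg-i {i} {x} e1 e2)) (trans (per⁻ x) (sym (loop-at-neg-i {s i} {s x} (trans (congᵇ-map x i) e1) (trans (congᵇ-map-neg x i) e2))))
    ... | false , e1 | false , e2 = trans (cong s (loop-away {i} {x} e1 e2)) (sym (loop-away {s i} {s x} (trans (congᵇ-map x i) e1) (trans (congᵇ-map-neg x i) e2)))

  n∸1 : ℕ
  n∸1 = 1 ℕ.+ m

  signParity : (ℤ → ℤ) → Bool
  signParity ρ = xorSum (λ x → upperHalf (ρ (+ x))) n∸1

  signed : Bool → ℤ → ℤ
  signed false v = v
  signed true v = - v

  -signed : ∀ σ v → - signed σ v ≡ signed (not σ) v
  -signed false v = refl
  -signed true v = neg-involutive v

  signed-involutive : ∀ σ v → signed σ (signed σ v) ≡ v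
  signed-involutive false v = refl
  signed-involutive true v = neg-involutive v

  ≈-signed : ∀ σ {u v} → u ≈ v → signed σ u ≈ signed σ v
  ≈-signed false e = e
  ≈-signed true e = ≈-neg e

  record WindowRep (a : ℤ) : Set where
    constructor mkRep
    field
      x : ℕ
      0<x : 0 ℕ.< x
      x<n : x ℕ.< n
      σ : Bool
      eq : a ≈ signed σ (+ x)

  windowRep : ∀ {a} → ¬ a ≈ 0ℤ → ¬ a ≈ nℤ → WindowRep a
  windowRep {a} a0 an with residue a in er
  ... | zero = ⊥-elim (a0 (subst (λ z → a ≈ + z) er (≈residue a)))
  ... | suc r with ℕP.<-cmp (suc r) n
  ... | tri< lt _ _ = mkRep (suc r) (s≤s z≤n) lt false (subst (λ z → a ≈ + z) er (≈residue a))
  ... | tri≈ _ e _ = ⊥-elim (an (subst (λ z → a ≈ + z) (trans er e) (≈residue a)))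
  ... | tri> _ _ gt = mkRep (2n ℕ.∸ suc r) (proj₁ bd) (proj₂ bd) true
          (≈-trans (subst (λ z → a ≈ + z) er (≈residue a)) (subst (_≈ - + (2n ℕ.∸ suc r)) (sym (upper-residue≡ (suc r) gt' r<M)) (+2nℤ≈ _)))
    where
    gt' : n ℕ.< suc r
    gt' = gt
    r<M : suc r ℕ.< 2n
    r<M = subst (ℕ._< 2n) er (residue<2n a)
    bd = upper-residue-bounds (suc r) gt' r<M

  InWindow : ℕ → Set
  InWindow x = (0 ℕ.< x) × (x ℕ.< n)

  InWindow⇒Small : ∀ {x} → InWindow x → Small (+ x)
  InWindow⇒Small (_ , lt) = lt

  InWindow⇒≉0 : ∀ {x} → InWindow x → ¬ (+ x) ≈ 0ℤ
  InWindow⇒≉0 {x} (0<x , x<n) e = ℕP.<⇒≢ 0<x (sym (residue-injective (ℕP.<-trans x<n n<2n) (ℕP.<-trans (s≤s z≤n) n<2n) e))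

  InWindow⇒≉n : ∀ {x} → InWindow x → ¬ (+ x) ≈ nℤ
  InWindow⇒≉n {x} (0<x , x<n) e = ℕP.<⇒≢ x<n (residue-injective (ℕP.<-trans x<n n<2n) n<2n e)

  InWindow-signed-unique : ∀ {x y} σ → InWindow x → InWindow y → + x ≈ signed σ (+ y) → (x ≡ y) × (σ ≡ false)
  InWindow-signed-unique {x} {y} false wx wy e = ℤP.+-injective (Small-≈⇒≡ (InWindow⇒Small wx) (InWindow⇒Small wy) e) , refl
  InWindow-signed-unique {x} {suc y} true wx wy e with Small-≈⇒≡ (InWindow⇒Small wx) (Small-neg {+ suc y} (InWindow⇒Small wy)) e
  ... | ()

  signed-signed : ∀ s σ v → signed s (signed σ v) ≡ signed (s xor σ) v
  signed-signed false σ v = refl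
  signed-signed true false v = refl
  signed-signed true true v = neg-involutive v

  not-signed-class : ∀ {y x} σ {c} → InWindow y → InWindow x → y ≢ x → c ≈ signed σ (+ x) → ¬ (+ y) ≈ c × ¬ (+ y) ≈ - c
  not-signed-class {y} {x} σ {c} wy wx ne e = (λ p → ne (proj₁ (InWindow-signed-unique σ wy wx (≈-trans p e))))
                                  , (λ p → ne (proj₁ (InWindow-signed-unique (not σ) wy wx (subst (λ z → + y ≈ z) (-signed σ (+ x)) (≈-trans p (≈-neg e))))))

  signed-back : ∀ σ {c x} → c ≈ signed σ (+ x) → + x ≈ signed σ c
  signed-back σ {c} {x} e = ≈-sym (subst (λ z → signed σ c ≈ z) (signed-involutive σ (+ x)) (≈-signed σ e))

  module SignParity {ρ : ℤ → ℤ} (Aρ : Aff ρ) where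
    open AffProps Aρ

    f : ℕ → Bool
    f y = upperHalf (ρ (+ y))

    upperHalf-signed : ∀ σ {x} → InWindow x → upperHalf (ρ (signed σ (+ x))) ≡ f x xor σ
    upperHalf-signed false wx = sym (xor-identityʳ _)
    upperHalf-signed true {x} wx = trans (upperHalf-odd (+ x) (InWindow⇒≉0 wx) (InWindow⇒≉n wx)) (xor-true (f x))
      where
      xor-true : ∀ b → not b ≡ b xor true
      xor-true b = trans (sym (true-xor b)) (xor-comm true b)

    upperHalf-≈signed : ∀ σ {v x} → InWindow x → v ≈ signed σ (+ x) → upperHalf (ρ v) ≡ f x xor σ
    upperHalf-≈signed σ wx e = trans (upperHalf-resp (resp≈ e)) (upperHalf-signed σ wx)

    signParity-two-point : ∀ {t : ℤ → ℤ} xa xb → InWindow xa → InWindow xb → xa ≢ xb → (s : Bool) →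
            (∀ y → InWindow y → y ≢ xa → y ≢ xb → t (+ y) ≡ + y) →
            t (+ xa) ≈ signed s (+ xb) → t (+ xb) ≈ signed s (+ xa) →
            signParity (λ z → ρ (t z)) ≡ signParity ρ
    signParity-two-point {t} xa xb wa wb ne s h ea eb = begin
        xorSum g n∸1 ≡⟨ xorSum-cong n∸1 (λ y _ _ → xor-cancelˡ (f y) (g y)) ⟩
        xorSum (λ y → f y xor (f y xor g y)) n∸1 ≡⟨ xorSum-xor f (λ y → f y xor g y) n∸1 ⟩
        xorSum f n∸1 xor xorSum (λ y → f y xor g y) n∸1 ≡⟨ cong (xorSum f n∸1 xor_) (xorSum-pair _ n∸1 xa xb ne (proj₁ wa) (ℕP.≤-pred (proj₂ wa)) (proj₁ wb) (ℕP.≤-pred (proj₂ wb))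
                                                    (λ y a b p q → trans (cong (f y xor_) (cong (λ z → upperHalf (ρ z)) (h y (a , s≤s b) p q))) (xor-same (f y)))) ⟩
        xorSum f n∸1 xor ((f xa xor g xa) xor (f xb xor g xb)) ≡⟨ cong (xorSum f n∸1 xor_) (trans (cong₂ (λ u v → (f xa xor u) xor (f xb xor v)) (upperHalf-≈signed s wb ea) (upperHalf-≈signed s wa eb)) (xor-swap-cancel (f xa) (f xb) s)) ⟩
        xorSum f n∸1 xor false ≡⟨ xor-identityʳ _ ⟩
        xorSum f n∸1 ∎
      where
      open ≡-Reasoning
      g : ℕ → Bool
      g y = upperHalf (ρ (t (+ y)))

    signParity-transp : ∀ {a b} → Nondegenerate a b → ¬ a ≈ 0ℤ → ¬ a ≈ nℤ → ¬ b ≈ 0ℤ → ¬ b ≈ nℤ → signParity (λ z → ρ (transp n a b z)) ≡ signParity ρ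
    signParity-transp {a} {b} nd a0 an b0 bn with windowRep a0 an | windowRep b0 bn
    ... | mkRep xa 0<xa xa<n σa ea | mkRep xb 0<xb xb<n σb eb =
        signParity-two-point {t = transp n a b} xa xb wa wb ne (σa xor σb) h
          (subst (λ z → transp n a b (+ xa) ≈ z) (signed-signed σa σb (+ xb)) (≈-trans (ta σa (signed-back σa ea)) (≈-signed σa eb)))
          (subst (λ z → transp n a b (+ xb) ≈ z) (trans (signed-signed σb σa (+ xa)) (cong (λ s → signed s (+ xa)) (xor-comm σb σa))) (≈-trans (tb σb (signed-back σb eb)) (≈-signed σb ea)))
      where
      open Nondegenerate nd
      open Transp nd using (c-a; c-b; c-na; c-nb; c-0)
      wa : InWindow xa
      wa = 0<xa , xa<n
      wb : InWindow xb
      wb = 0<xb , xb<n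
      ta : ∀ σ {j} → j ≈ signed σ a → transp n a b j ≈ signed σ b
      ta false e = c-a e
      ta true e = c-na e
      tb : ∀ σ {j} → j ≈ signed σ b → transp n a b j ≈ signed σ a
      tb false e = c-b e
      tb true e = c-nb e
      ne' : ∀ sa sb x → a ≈ signed sa (+ x) → b ≈ signed sb (+ x) → ⊥
      ne' false false x ea eb = a≉b (≈-trans ea (≈-sym eb))
      ne' true true x ea eb = a≉b (≈-trans ea (≈-sym eb))
      ne' false true x ea eb = a≉-b (≈-trans ea (subst (λ z → z ≈ - b) (neg-involutive (+ x)) (≈-neg (≈-sym eb))))
      ne' true false x ea eb = a≉-b (≈-trans ea (≈-neg (≈-sym eb)))
      ne : xa ≢ xb
      ne refl = ne' σa σb xa ea eb
      h : ∀ y → InWindow y → y ≢ xa → y ≢ xb → transp n a b (+ y) ≡ + y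
      h y wy na nb = c-0 (proj₁ (not-signed-class σa wy wa na ea)) (proj₁ (not-signed-class σb wy wb nb eb))
                         (proj₂ (not-signed-class σa wy wa na ea)) (proj₂ (not-signed-class σb wy wb nb eb))

    signParity-loop : ∀ i → signParity (λ z → ρ (loop n i z)) ≡ signParity ρ
    signParity-loop i = xorSum-cong n∸1 (λ y _ _ → upperHalf-resp (resp≈ (loop-≈ i (+ y))))

    signParity-flip : ∀ x0 → InWindow x0 → signParity (λ z → ρ (signFlip (+ x0) z)) ≡ not (signParity ρ)
    signParity-flip x0 w0 = begin
        xorSum g n∸1 ≡⟨ xorSum-cong n∸1 (λ y _ _ → xor-cancelˡ (f y) (g y)) ⟩
        xorSum (λ y → f y xor (f y xor g y)) n∸1 ≡⟨ xorSum-xor f (λ y → f y xor g y) n∸1 ⟩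
        xorSum f n∸1 xor xorSum (λ y → f y xor g y) n∸1 ≡⟨ cong (xorSum f n∸1 xor_) (xorSum-single _ n∸1 x0 (proj₁ w0) (ℕP.≤-pred (proj₂ w0))
              (λ y a b p → trans (cong (f y xor_) (cong (λ z → upperHalf (ρ z)) (h y (a , s≤s b) p))) (xor-same (f y)))) ⟩
        xorSum f n∸1 xor (f x0 xor g x0) ≡⟨ cong (λ z → xorSum f n∸1 xor (f x0 xor z)) gx0 ⟩
        xorSum f n∸1 xor (f x0 xor not (f x0)) ≡⟨ bl (xorSum f n∸1) (f x0) ⟩
        not (xorSum f n∸1) ∎
      where
      open ≡-Reasoning
      g : ℕ → Bool
      g y = upperHalf (ρ (signFlip (+ x0) (+ y)))
      bl : ∀ a b → a xor (b xor not b) ≡ not a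
      bl true true = refl
      bl true false = refl
      bl false true = refl
      bl false false = refl
      h : ∀ y → InWindow y → y ≢ x0 → signFlip (+ x0) (+ y) ≡ + y
      h y wy ne = flip-away {+ x0} {+ y} (≉⇒congᵇ (proj₁ (not-signed-class false wy w0 ne ≈-refl))) (≉⇒congᵇ (proj₂ (not-signed-class false wy w0 ne ≈-refl)))
      fx : signFlip (+ x0) (+ x0) ≡ - (+ x0)
      fx = trans (flip-at-a {+ x0} {+ x0} (≈⇒congᵇ (≈-refl {+ x0}))) (l (+ x0))
        where
        l : ∀ a → a - a - a ≡ - a
        l = solve-∀
      gx0 : g x0 ≡ not (f x0)
      gx0 = trans (cong (λ z → upperHalf (ρ z)) fx) (trans (upperHalf-signed true w0) (xt (f x0)))
        where
        xt : ∀ b → b xor true ≡ not b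
        xt true = refl
        xt false = refl

  signParity-id : ∀ {π} → π ≗ (λ z → z) → signParity π ≡ false
  signParity-id {π} e = trans (xorSum-cong n∸1 (λ y _ b → cong upperHalf (e (+ y)))) (xorSum-false _ n∸1 (λ y _ b → upperHalf-pos y (s≤s b)))

  Small⇒<2n : ∀ {u} → Small u → ∣ u ∣ ℕ.< 2n
  Small⇒<2n s = ℕP.<-trans s n<2n

  0<shift⇔0≤q : ∀ {u} (q : ℤ) → 0ℤ < u → Small u → (0ℤ < u + q * 2nℤ → 0ℤ ≤ q) × (0ℤ ≤ q → 0ℤ < u + q * 2nℤ)
  0<shift⇔0≤q {+ u} q 0<u s = <+multiple⇔0≤ q 0<u (+≤+ (ℕP.<⇒≤ (Small⇒<2n {+ u} s)))

  Small⇒-n< : ∀ {u} → Small u → - nℤ < u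
  Small⇒-n< {+ m} s = -<+
  Small⇒-n< { -[1+ m ]} (s≤s s) = -<- s

  Small⇒<n : ∀ {u} → Small u → u < nℤ
  Small⇒<n {+ m} s = +<+ s
  Small⇒<n { -[1+ m ]} s = -<+

  Small⇒0<u+n : ∀ {u} → Small u → 0ℤ < u + nℤ
  Small⇒0<u+n {u} s = subst (0ℤ <_) (l u nℤ) (i<j⇒0<j-i (Small⇒-n< {u} s))
    where
    l : ∀ u n → u - - n ≡ u + n
    l = solve-∀

  0≤nℤ : 0ℤ ≤ nℤ
  0≤nℤ = +≤+ z≤n

  0<shift⇔0<q : ∀ {u} (q : ℤ) → u < 0ℤ → Small u → (0ℤ < u + q * 2nℤ → 0ℤ < q) × (0ℤ < q → 0ℤ < u + q * 2nℤ)
  0<shift⇔0<q {u} q u<0 s = (λ p → ℤP.suc[i]≤j⇒i<j (≤⇒ (proj₁ P1 (subst (0ℤ <_) (l u q 2nℤ) p)))) ,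
                   (λ p → subst (0ℤ <_) (sym (l u q 2nℤ)) (proj₂ P1 (0<q⇒0≤q-1 p)))
    where
    u' = u + 2nℤ
    0<u' : 0ℤ < u'
    0<u' = subst (0ℤ <_) (trans (l2 u nℤ) (cong (λ w → u + w) (sym 2nℤ≡nℤ+nℤ))) (ℤP.+-mono-<-≤ (Small⇒0<u+n {u} s) 0≤nℤ)
      where
      l2 : ∀ u n → u + n + n ≡ u + (n + n)
      l2 = solve-∀
    u'≤ : u' ≤ 0ℤ + 2nℤ
    u'≤ = ℤP.+-monoˡ-≤ 2nℤ (ℤP.<⇒≤ u<0)
    P1 = <+multiple⇔0≤ {0ℤ} {u'} (q - 1ℤ) 0<u' u'≤
    l : ∀ u q m → u + q * m ≡ (u + m) + (q - 1ℤ) * m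
    l = solve-∀
    ≤⇒ : 0ℤ ≤ q - 1ℤ → ℤ.suc 0ℤ ≤ q
    ≤⇒ p = ≤-by (q - 1ℤ) p (l3 q)
      where
      l3 : ∀ q → q ≡ ℤ.suc 0ℤ + (q - 1ℤ)
      l3 = solve-∀

  shift<n⇔q≤0 : ∀ {u} (q : ℤ) → Small u → (u + q * 2nℤ < nℤ → q ≤ 0ℤ) × (q ≤ 0ℤ → u + q * 2nℤ < nℤ)
  shift<n⇔q≤0 {u} q s = +multiple<⇔≤0 q le (Small⇒<n {u} s)
    where
    le : nℤ - 2nℤ ≤ u
    le = subst (_≤ u) (trans (l nℤ) (cong (λ m → nℤ - m) (sym 2nℤ≡nℤ+nℤ))) (ℤP.<⇒≤ (Small⇒-n< {u} s))
      where
      l : ∀ n → - n ≡ n - (n + n)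
      l = solve-∀

  SameSide : ℤ → ℤ → Set
  SameSide u v = (Small u × Small v) × ((0ℤ < u × 0ℤ < v) ⊎ (u < 0ℤ × v < 0ℤ))

  SameSide-0<shift : ∀ {u v} → SameSide u v → ∀ q → (0ℤ < u + q * 2nℤ) ⇔ (0ℤ < v + q * 2nℤ)
  SameSide-0<shift {u} {v} ((su , sv) , inj₁ (pu , pv)) q = ⇔-trans (0<shift⇔0≤q {u} q pu su) (⇔-sym (0<shift⇔0≤q {v} q pv sv))
  SameSide-0<shift {u} {v} ((su , sv) , inj₂ (pu , pv)) q = ⇔-trans (0<shift⇔0<q {u} q pu su) (⇔-sym (0<shift⇔0<q {v} q pv sv))

  Small-shift<n : ∀ {u v} → Small u → Small v → ∀ q → (u + q * 2nℤ < nℤ) ⇔ (v + q * 2nℤ < nℤ)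
  Small-shift<n {u} {v} su sv q = ⇔-trans (shift<n⇔q≤0 {u} q su) (⇔-sym (shift<n⇔q≤0 {v} q sv))

  shift-preserves-sides : ∀ {i u v} (t : ℤ → ℤ) → i ≈ u → t i ≡ i - u + v → SameSide u v → ((0ℤ < t i) ⇔ (0ℤ < i)) × ((t i < nℤ) ⇔ (i < nℤ))
  shift-preserves-sides {i} {u} {v} t e te ss with ≈-witness e
  ... | q , refl = subst (λ z → ((0ℤ < z) ⇔ (0ℤ < u + q * 2nℤ)) × ((z < nℤ) ⇔ (u + q * 2nℤ < nℤ))) (sym (trans te (l u v q 2nℤ)))
                    (⇔-sym (SameSide-0<shift {u} {v} ss q) , ⇔-sym (Small-shift<n {u} {v} (proj₁ (proj₁ ss)) (proj₂ (proj₁ ss)) q))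
    where
    l : ∀ u v q m → u + q * m - u + v ≡ v + q * m
    l = solve-∀

  Positive Negative BelowN AboveN : ℤ → Set
  Positive i = 0ℤ < i
  Negative v = v < 0ℤ
  BelowN i = i < nℤ
  AboveN v = nℤ < v

  CrossesZero CrossesN : (ℤ → ℤ) → ℤ → Set
  CrossesZero ρ i = Positive i × Negative (ρ i)
  CrossesN ρ i = BelowN i × AboveN (ρ i)

  CrossingParity : (ℤ → ℤ) → Bool → Set
  CrossingParity ρ b = Σ (List ℤ) λ xs → Σ (List ℤ) λ ys → Enumerates (CrossesZero ρ) xs × Enumerates (CrossesN ρ) ys × (parity (length xs ℕ.+ length ys) ≡ b)

  CrossingParity-resp : ∀ {ρ σ b} → ρ ≗ σ → CrossingParity ρ b → CrossingParity σ b
  CrossingParity-resp {ρ} {σ} e (xs , ys , ex , ey , p) =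
    xs , ys , Enumerates-resp ex (λ i q → proj₁ q , subst Negative (e i) (proj₂ q)) (λ i q → proj₁ q , subst Negative (sym (e i)) (proj₂ q)) ,
              Enumerates-resp ey (λ i q → proj₁ q , subst AboveN (e i) (proj₂ q)) (λ i q → proj₁ q , subst AboveN (sym (e i)) (proj₂ q)) , p

  CrossingParity-unique : ∀ {ρ b b'} → CrossingParity ρ b → CrossingParity ρ b' → b ≡ b'
  CrossingParity-unique (xs , ys , ex , ey , p) (xs' , ys' , ex' , ey' , p') =
    trans (sym p) (trans (cong parity (cong₂ ℕ._+_ (Enumerates-length ex ex') (Enumerates-length ey ey'))) p')

  CrossingParity-id : ∀ {π} → π ≗ (λ z → z) → CrossingParity π false
  CrossingParity-id {π} e = [] , [] , ([] , λ i → (λ ()) , λ q → ⊥-elim (ℤP.<-asym (proj₁ q) (subst (_< 0ℤ) (e i) (proj₂ q)))) ,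
                          ([] , λ i → (λ ()) , λ q → ⊥-elim (ℤP.<-asym (proj₁ q) (subst (nℤ <_) (e i) (proj₂ q)))) , refl

  JointlyEven⇒CrossingParity : ∀ {π} → JointlyEven n π → CrossingParity π false
  JointlyEven⇒CrossingParity (xs , ys , ex , ey , d) = xs , ys , ex , ey , 2∣⇒parity≡false _ d

  CrossingParity⇒JointlyEven : ∀ {π} → CrossingParity π false → JointlyEven n π
  CrossingParity⇒JointlyEven (xs , ys , ex , ey , p) = xs , ys , ex , ey , parity≡false⇒2∣ _ p

  InWindow⇒0< : ∀ {a} → InWindow a → 0ℤ < + a
  InWindow⇒0< (0<a , _) = +<+ 0<a

  InWindow⇒-<0 : ∀ {a} → InWindow a → - (+ a) < 0ℤ
  InWindow⇒-<0 {suc a} _ = -<+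

  InWindow-≉- : ∀ {a b} → InWindow a → InWindow b → ¬ (+ a) ≈ - (+ b)
  InWindow-≉- {a} {suc b} wa wb e with Small-≈⇒≡ {+ a} { - (+ suc b)} (InWindow⇒Small wa) (Small-neg {+ suc b} (InWindow⇒Small wb)) e
  ... | ()

  Nondegenerate-window : ∀ {a b} → InWindow a → InWindow b → a ≢ b → Nondegenerate (+ a) (+ b)
  Nondegenerate-window {a} {b} wa wb ne = record
    { a≉b = λ e → ne (ℤP.+-injective (Small-≈⇒≡ {+ a} {+ b} (InWindow⇒Small wa) (InWindow⇒Small wb) e))
    ; a≉-b = InWindow-≉- wa wb
    ; a≉-a = InWindow-≉- wa wa
    ; b≉-b = InWindow-≉- wb wb }

  SameSide-pos : ∀ {a b} → InWindow a → InWindow b → SameSide (+ a) (+ b)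
  SameSide-pos wa wb = (InWindow⇒Small wa , InWindow⇒Small wb) , inj₁ (InWindow⇒0< wa , InWindow⇒0< wb)

  SameSide-neg : ∀ {a b} → InWindow a → InWindow b → SameSide (- (+ a)) (- (+ b))
  SameSide-neg {a} {b} wa wb = (Small-neg {+ a} (InWindow⇒Small wa) , Small-neg {+ b} (InWindow⇒Small wb)) , inj₂ (InWindow⇒-<0 wa , InWindow⇒-<0 wb)

  transp-preserves-sides : ∀ {a b} → InWindow a → InWindow b → a ≢ b → ∀ i →
            ((0ℤ < transp n (+ a) (+ b) i) ⇔ (0ℤ < i)) × ((transp n (+ a) (+ b) i < nℤ) ⇔ (i < nℤ))
  transp-preserves-sides {a} {b} wa wb ne i with congᵇ-inspect i (+ a) | congᵇ-inspect i (+ b) | congᵇ-inspect i (- + a) | congᵇ-inspect i (- + b)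
  ... | true , e1 | _ | _ | _ = shift-preserves-sides (transp n (+ a) (+ b)) (congᵇ⇒≈ {i} {+ a} e1) (transp-at-a {+ a} {+ b} {i} e1) (SameSide-pos wa wb)
  ... | false , e1 | true , e2 | _ | _ = shift-preserves-sides (transp n (+ a) (+ b)) (congᵇ⇒≈ {i} {+ b} e2) (transp-at-b {+ a} {+ b} {i} e1 e2) (SameSide-pos wb wa)
  ... | false , e1 | false , e2 | true , e3 | _ = shift-preserves-sides (transp n (+ a) (+ b)) (congᵇ⇒≈ {i} { - + a} e3) (trans (transp-at-neg-a {+ a} {+ b} {i} e1 e2 e3) (l i (+ a) (+ b))) (SameSide-neg wa wb)
    where
    l : ∀ i a b → i + a - b ≡ i - - a + - b
    l = solve-∀
  ... | false , e1 | false , e2 | false , e3 | true , e4 = shift-preserves-sides (transp n (+ a) (+ b)) (congᵇ⇒≈ {i} { - + b} e4) (trans (transp-at-neg-b {+ a} {+ b} {i} e1 e2 e3 e4) (l i (+ a) (+ b))) (SameSide-neg wb wa)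
    where
    l : ∀ i a b → i + b - a ≡ i - - b + - a
    l = solve-∀
  ... | false , e1 | false , e2 | false , e3 | false , e4 = subst (λ z → ((0ℤ < z) ⇔ (0ℤ < i)) × ((z < nℤ) ⇔ (i < nℤ))) (sym (transp-away {+ a} {+ b} {i} e1 e2 e3 e4)) (⇔-refl , ⇔-refl)

  CrossingParity-transp : ∀ {ρ b0 a b} → InWindow a → InWindow b → a ≢ b → CrossingParity ρ b0 → CrossingParity (λ z → ρ (transp n (+ a) (+ b) z)) b0
  CrossingParity-transp {ρ} {b0} {a} {b} wa wb ne (xs , ys , ex , ey , p) =
    map g xs , map g ys ,
    TransferA.preimage ex (λ i _ → proj₁ (transp-preserves-sides wa wb ne i)) ,
    TransferB.preimage ey (λ i _ → proj₁ (proj₂ (transp-preserves-sides wa wb ne i)) , proj₂ (proj₂ (transp-preserves-sides wa wb ne i))) ,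
    trans (cong parity (cong₂ ℕ._+_ (length-map g xs) (length-map g ys))) p
    where
    g = transp n (+ a) (+ b)
    inv = Transp.inv (Nondegenerate-window wa wb ne)
    module TransferA = EnumerationTransfer Positive Negative ρ g g inv inv
    module TransferB = EnumerationTransfer BelowN AboveN ρ g g inv inv

  module LoopSides {x : ℕ} (wx : InWindow x) where
    X = + x
    g = loop n X
    xx : ¬ X ≈ - X
    xx = InWindow-≉- wx wx
    sx = InWindow⇒Small wx
    snx = Small-neg {X} sx

    sides-0-at-x : ∀ i → i ≢ X - 2nℤ → congᵇ i X ≡ true → (0ℤ < g i) ⇔ (0ℤ < i)
    sides-0-at-x i ne₁ e1 with ≈-witness (congᵇ⇒≈ {i} {X} e1)
    ... | q , refl = ⇔-substˡ {λ z → 0ℤ < z} (trans (loop-at-i {X} {X + q * 2nℤ} e1) (l X q 2nℤ))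
                       (⇔-trans (0<shift⇔0≤q {X} (q + 1ℤ) (InWindow⇒0< wx) sx)
                       (⇔-trans (0≤q+1⇔0≤q q (λ e → ne₁ (trans (cong (λ w → X + w * 2nℤ) e) (l2 X 2nℤ))))
                                (⇔-sym (0<shift⇔0≤q {X} q (InWindow⇒0< wx) sx))))
      where
      l : ∀ x q m → x + q * m + m ≡ x + (q + 1ℤ) * m
      l = solve-∀
      l2 : ∀ x m → x + - 1ℤ * m ≡ x - m
      l2 = solve-∀

    sides-0-at-neg-x : ∀ i → i ≢ 2nℤ - X → congᵇ i X ≡ false → congᵇ i (- X) ≡ true → (0ℤ < g i) ⇔ (0ℤ < i)
    sides-0-at-neg-x i ne₂ e1 e2 with ≈-witness (congᵇ⇒≈ {i} { - X} e2)
    ... | q , refl = ⇔-substˡ {λ z → 0ℤ < z} (trans (loop-at-neg-i {X} { - X + q * 2nℤ} e1 e2) (l (- X) q 2nℤ))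
                       (⇔-trans (0<shift⇔0<q { - X} (q - 1ℤ) (InWindow⇒-<0 wx) snx)
                       (⇔-trans (0<q-1⇔0<q q (λ e → ne₂ (trans (cong (λ w → - X + w * 2nℤ) e) (l2 X 2nℤ))))
                                (⇔-sym (0<shift⇔0<q { - X} q (InWindow⇒-<0 wx) snx))))
      where
      l : ∀ x q m → x + q * m - m ≡ x + (q - 1ℤ) * m
      l = solve-∀
      l2 : ∀ x m → - x + 1ℤ * m ≡ m - x
      l2 = solve-∀

    sides-0 : ∀ i → i ≢ X - 2nℤ → i ≢ 2nℤ - X → (0ℤ < g i) ⇔ (0ℤ < i)
    sides-0 i ne₁ ne₂ with congᵇ-inspect i X | congᵇ-inspect i (- X)
    ... | true , e1 | _ = sides-0-at-x i ne₁ e1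
    ... | false , e1 | true , e2 = sides-0-at-neg-x i ne₂ e1 e2
    ... | false , e1 | false , e2 = ⇔-substˡ {λ z → 0ℤ < z} (loop-away {X} {i} e1 e2) ⇔-refl

    sides-n-at-x : ∀ i → i ≢ X → congᵇ i X ≡ true → (g i < nℤ) ⇔ (i < nℤ)
    sides-n-at-x i ne₁ e1 with ≈-witness (congᵇ⇒≈ {i} {X} e1)
    ... | q , refl = ⇔-substˡ {λ z → z < nℤ} (trans (loop-at-i {X} {X + q * 2nℤ} e1) (l X q 2nℤ))
                       (⇔-trans (shift<n⇔q≤0 {X} (q + 1ℤ) sx)
                       (⇔-trans (q+1≤0⇔q≤0 q (λ e → ne₁ (trans (cong (λ w → X + w * 2nℤ) e) (l2 X 2nℤ))))
                                (⇔-sym (shift<n⇔q≤0 {X} q sx))))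
      where
      l : ∀ x q m → x + q * m + m ≡ x + (q + 1ℤ) * m
      l = solve-∀
      l2 : ∀ x m → x + 0ℤ * m ≡ x
      l2 = solve-∀

    sides-n-at-neg-x : ∀ i → i ≢ 2nℤ - X → congᵇ i X ≡ false → congᵇ i (- X) ≡ true → (g i < nℤ) ⇔ (i < nℤ)
    sides-n-at-neg-x i ne₂ e1 e2 with ≈-witness (congᵇ⇒≈ {i} { - X} e2)
    ... | q , refl = ⇔-substˡ {λ z → z < nℤ} (trans (loop-at-neg-i {X} { - X + q * 2nℤ} e1 e2) (l (- X) q 2nℤ))
                       (⇔-trans (shift<n⇔q≤0 { - X} (q - 1ℤ) snx)
                       (⇔-trans (q-1≤0⇔q≤0 q (λ e → ne₂ (trans (cong (λ w → - X + w * 2nℤ) e) (l2 X 2nℤ))))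
                                (⇔-sym (shift<n⇔q≤0 { - X} q snx))))
      where
      l : ∀ x q m → x + q * m - m ≡ x + (q - 1ℤ) * m
      l = solve-∀
      l2 : ∀ x m → - x + 1ℤ * m ≡ m - x
      l2 = solve-∀

    sides-n : ∀ i → i ≢ X → i ≢ 2nℤ - X → (g i < nℤ) ⇔ (i < nℤ)
    sides-n i ne₁ ne₂ with congᵇ-inspect i X | congᵇ-inspect i (- X)
    ... | true , e1 | _ = sides-n-at-x i ne₁ e1
    ... | false , e1 | true , e2 = sides-n-at-neg-x i ne₂ e1 e2
    ... | false , e1 | false , e2 = ⇔-substˡ {λ z → z < nℤ} (loop-away {X} {i} e1 e2) ⇔-refl

  -n+2n≡n : - nℤ + 2nℤ ≡ nℤ
  -n+2n≡n = trans (cong (λ w → - nℤ + w) 2nℤ≡nℤ+nℤ) (l nℤ)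
    where
    l : ∀ n → - n + (n + n) ≡ n
    l = solve-∀

  -n<v⇒n<v+2n : ∀ {v} → - nℤ < v → nℤ < v + 2nℤ
  -n<v⇒n<v+2n {v} p = subst (_< v + 2nℤ) -n+2n≡n (ℤP.+-monoˡ-< 2nℤ p)

  n<v+2n⇒-n<v : ∀ {v} → nℤ < v + 2nℤ → - nℤ < v
  n<v+2n⇒-n<v {v} p = subst₂ _<_ (trans (cong (_- 2nℤ) (sym -n+2n≡n)) (l (- nℤ) 2nℤ)) (l v 2nℤ) (ℤP.+-monoˡ-< (- 2nℤ) p)
    where
    l : ∀ a m → a + m - m ≡ a
    l = solve-∀

  v<-n⇒n<-v : ∀ {v} → v < - nℤ → nℤ < - v
  v<-n⇒n<-v {v} p = subst (_< - v) (neg-involutive nℤ) (ℤP.neg-mono-< p)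

  n<-v⇒v<-n : ∀ {v} → nℤ < - v → v < - nℤ
  n<-v⇒v<-n {v} p = subst (_< - nℤ) (neg-involutive v) (ℤP.neg-mono-< p)

  0<v⇒-v<0 : ∀ {v} → 0ℤ < v → - v < 0ℤ
  0<v⇒-v<0 p = ℤP.neg-mono-< p

  -v<0⇒0<v : ∀ {v} → - v < 0ℤ → 0ℤ < v
  -v<0⇒0<v {v} p = subst (0ℤ <_) (neg-involutive v) (ℤP.neg-mono-< p)

  module WindowBounds {x : ℕ} (wx : InWindow x) where
    X = + x
    X<n : X < nℤ
    X<n = +<+ (proj₂ wx)
    X<2n : X < 2nℤ
    X<2n = +<+ (ℕP.<-trans (proj₂ wx) n<2n)
    0<2n-X : 0ℤ < 2nℤ - X
    0<2n-X = i<j⇒0<j-i X<2n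
    ¬0<X-2n : ¬ 0ℤ < X - 2nℤ
    ¬0<X-2n p = ℤP.<-asym p (<-by (2nℤ - X) 0<2n-X (l X 2nℤ))
      where
      l : ∀ x m → 0ℤ ≡ x - m + (m - x)
      l = solve-∀
    ¬0<-X : ¬ 0ℤ < - X
    ¬0<-X p = ℤP.<-asym p (InWindow⇒-<0 wx)
    ¬X+2n<n : ¬ X + 2nℤ < nℤ
    ¬X+2n<n p = ℤP.<⇒≱ p (≤-by (X + nℤ) (ℤP.≤-trans (+≤+ z≤n) (ℤP.≤-refl {X + nℤ})) (trans (cong (λ w → X + w) 2nℤ≡nℤ+nℤ) (l X nℤ)))
      where
      l : ∀ x n → x + (n + n) ≡ n + (x + n)
      l = solve-∀
    -X<n : - X < nℤ
    -X<n = ℤP.<-trans (InWindow⇒-<0 wx) (+<+ (ℕP.<-trans (proj₁ wx) (proj₂ wx)))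
    ¬2n-X<n : ¬ 2nℤ - X < nℤ
    ¬2n-X<n p = ℤP.<⇒≱ p (≤-by (nℤ - X) (ℤP.<⇒≤ (i<j⇒0<j-i X<n)) (trans (cong (λ w → w - X) 2nℤ≡nℤ+nℤ) (l X nℤ)))
      where
      l : ∀ x n → n + n - x ≡ n + (n - x)
      l = solve-∀

  module LoopCrossings {ρ : ℤ → ℤ} {x : ℕ} (Aρ : Aff ρ) (wx : InWindow x) where
    open AffProps Aρ
    open LoopSides wx
    open WindowBounds wx hiding (X)
    h = loop n (- X)
    module TransferA = EnumerationTransfer Positive Negative ρ g h (loop-inverseˡ xx) (loop-inverseʳ xx)
    module TransferB = EnumerationTransfer BelowN AboveN ρ g h (loop-inverseˡ xx) (loop-inverseʳ xx)
    X-2n = X - 2nℤ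
    2n-X = 2nℤ - X
    g[X-2n]≡X : g X-2n ≡ X
    g[X-2n]≡X = trans (loop-at-i {X} {X-2n} (≈⇒congᵇ (≈-by (- 1ℤ) (l X 2nℤ)))) (l2 X 2nℤ)
      where
      l : ∀ x m → x - m ≡ x + - 1ℤ * m
      l = solve-∀
      l2 : ∀ x m → x - m + m ≡ x
      l2 = solve-∀
    2n-X≈-X : 2n-X ≈ - X
    2n-X≈-X = ≈-by 1ℤ (l X 2nℤ)
      where
      l : ∀ x m → m - x ≡ - x + 1ℤ * m
      l = solve-∀
    g[2n-X]≡-X : g 2n-X ≡ - X
    g[2n-X]≡-X = trans (loop-at-neg-i {X} {2n-X} (≉⇒congᵇ (λ q → xx (≈-common q 2n-X≈-X))) (≈⇒congᵇ 2n-X≈-X)) (l X 2nℤ)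
      where
      l : ∀ x m → m - x - m ≡ - x
      l = solve-∀
    gX : g X ≡ X + 2nℤ
    gX = loop-at-i {X} {X} (≈⇒congᵇ (≈-refl {X}))
    ρX≢0 : ρ X ≢ 0ℤ
    ρX≢0 e = ℤP.<⇒≢ (InWindow⇒0< wx) (sym (inj (trans e (sym fixes-0))))
    ρX≢-n : ρ X ≢ - nℤ
    ρX≢-n e = ℤP.<⇒≢ (ℤP.<-trans (ℤP.neg-mono-< (+<+ (ℕP.<-trans (proj₁ wx) (proj₂ wx)))) (InWindow⇒0< wx))
                (sym (inj (trans e (sym (trans (odd nℤ) (cong -_ fixes-n))))))
    crossesZero-toggle : ∀ {xs} → Enumerates (CrossesZero ρ) xs →
      Σ (List ℤ) λ ys → Enumerates (CrossesZero (λ z → ρ (g z))) ys × (parity (length ys) ≡ not (parity (length xs)))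
    crossesZero-toggle ex with ℤP.<-cmp (ρ X) 0ℤ
    ... | tri< lt _ _ = TransferA.preimage-toggle ex X-2n cond (subst (λ z → ρ z < 0ℤ) (sym g[X-2n]≡X) lt)
                          (inj₁ (subst (0ℤ <_) (sym g[X-2n]≡X) (InWindow⇒0< wx) , ¬0<X-2n))
      where
      cond : ∀ i → i ≢ X-2n → ρ (g i) < 0ℤ → ((0ℤ < g i) → (0ℤ < i)) × ((0ℤ < i) → (0ℤ < g i))
      cond i ne r with i ℤ.≟ 2n-X
      ... | yes refl = ⊥-elim (ℤP.<-asym lt (-v<0⇒0<v (subst (_< 0ℤ) (trans (cong ρ g[2n-X]≡-X) (odd X)) r)))
      ... | no ne2 = sides-0 i ne ne2
    ... | tri≈ _ e _ = ⊥-elim (ρX≢0 e)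
    ... | tri> _ _ gt = TransferA.preimage-toggle ex 2n-X cond (subst (λ z → ρ z < 0ℤ) (sym g[2n-X]≡-X) (subst (_< 0ℤ) (sym (odd X)) (0<v⇒-v<0 gt)))
                          (inj₂ ((λ q → ¬0<-X (subst (0ℤ <_) g[2n-X]≡-X q)) , 0<2n-X))
      where
      cond : ∀ i → i ≢ 2n-X → ρ (g i) < 0ℤ → ((0ℤ < g i) → (0ℤ < i)) × ((0ℤ < i) → (0ℤ < g i))
      cond i ne r with i ℤ.≟ X-2n
      ... | yes refl = ⊥-elim (ℤP.<-asym gt (subst (_< 0ℤ) (cong ρ g[X-2n]≡X) r))
      ... | no ne1 = sides-0 i ne1 ne
    crossesN-toggle : ∀ {ys} → Enumerates (CrossesN ρ) ys →
      Σ (List ℤ) λ ys' → Enumerates (CrossesN (λ z → ρ (g z))) ys' × (parity (length ys') ≡ not (parity (length ys)))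
    crossesN-toggle ey with ℤP.<-cmp (ρ X) (- nℤ)
    ... | tri< lt _ _ = TransferB.preimage-toggle ey 2n-X cond (subst (λ z → nℤ < ρ z) (sym g[2n-X]≡-X) (subst (nℤ <_) (sym (odd X)) (v<-n⇒n<-v lt)))
                          (inj₁ (subst (_< nℤ) (sym g[2n-X]≡-X) -X<n , ¬2n-X<n))
      where
      cond : ∀ i → i ≢ 2n-X → nℤ < ρ (g i) → ((g i < nℤ) → (i < nℤ)) × ((i < nℤ) → (g i < nℤ))
      cond i ne r with i ℤ.≟ X
      ... | yes refl = ⊥-elim (ℤP.<-asym lt (n<v+2n⇒-n<v (subst (nℤ <_) (trans (cong ρ gX) (per X)) r)))
      ... | no neX = sides-n i neX ne
    ... | tri≈ _ e _ = ⊥-elim (ρX≢-n e)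
    ... | tri> _ _ gt = TransferB.preimage-toggle ey X cond (subst (λ z → nℤ < ρ z) (sym gX) (subst (nℤ <_) (sym (per X)) (-n<v⇒n<v+2n gt)))
                          (inj₂ ((λ q → ¬X+2n<n (subst (_< nℤ) gX q)) , WindowBounds.X<n wx))
      where
      cond : ∀ i → i ≢ X → nℤ < ρ (g i) → ((g i < nℤ) → (i < nℤ)) × ((i < nℤ) → (g i < nℤ))
      cond i ne r with i ℤ.≟ 2n-X
      ... | yes refl = ⊥-elim (ℤP.<-asym gt (n<-v⇒v<-n (subst (nℤ <_) (trans (cong ρ g[2n-X]≡-X) (odd X)) r)))
      ... | no ne2 = sides-n i ne ne2

  CrossingParity-loop : ∀ {ρ b0 x} → Aff ρ → InWindow x → CrossingParity ρ b0 → CrossingParity (λ z → ρ (loop n (+ x) z)) b0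
  CrossingParity-loop {ρ} {b0} {x} Aρ wx (xs , ys , ex , ey , p)
    with LoopCrossings.crossesZero-toggle Aρ wx ex | LoopCrossings.crossesN-toggle Aρ wx ey
  ... | ys1 , e1 , p1 | ys2 , e2 , p2 = ys1 , ys2 , e1 , e2 , trans (parity-not-+ (length xs) (length ys) (length ys1) (length ys2) p1 p2) p

  module FlipSides {x : ℕ} (wx : InWindow x) where
    X = + x
    g = signFlip X
    xx : ¬ X ≈ - X
    xx = InWindow-≉- wx wx
    sx = InWindow⇒Small wx
    snx = Small-neg {X} sx

    sides-0-at-x : ∀ i → i ≢ X → congᵇ i X ≡ true → (0ℤ < g i) ⇔ (0ℤ < i)
    sides-0-at-x i ne₁ e1 with ≈-witness (congᵇ⇒≈ {i} {X} e1)
    ... | q , refl = ⇔-substˡ {λ z → 0ℤ < z} (trans (flip-at-a {X} {X + q * 2nℤ} e1) (l X q 2nℤ))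
                       (⇔-trans (0<shift⇔0<q { - X} q (InWindow⇒-<0 wx) snx)
                       (⇔-trans (⇔-sym (0≤q⇔0<q q (λ e → ne₁ (trans (cong (λ w → X + w * 2nℤ) e) (l2 X 2nℤ)))))
                                (⇔-sym (0<shift⇔0≤q {X} q (InWindow⇒0< wx) sx))))
      where
      l : ∀ x q m → x + q * m - x - x ≡ - x + q * m
      l = solve-∀
      l2 : ∀ x m → x + 0ℤ * m ≡ x
      l2 = solve-∀

    sides-0-at-neg-x : ∀ i → i ≢ - X → congᵇ i X ≡ false → congᵇ i (- X) ≡ true → (0ℤ < g i) ⇔ (0ℤ < i)
    sides-0-at-neg-x i ne₂ e1 e2 with ≈-witness (congᵇ⇒≈ {i} { - X} e2)
    ... | q , refl = ⇔-substˡ {λ z → 0ℤ < z} (trans (flip-at-neg-a {X} { - X + q * 2nℤ} e1 e2) (l X q 2nℤ))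
                       (⇔-trans (0<shift⇔0≤q {X} q (InWindow⇒0< wx) sx)
                       (⇔-trans (0≤q⇔0<q q (λ e → ne₂ (trans (cong (λ w → - X + w * 2nℤ) e) (l2 (- X) 2nℤ))))
                                (⇔-sym (0<shift⇔0<q { - X} q (InWindow⇒-<0 wx) snx))))
      where
      l : ∀ x q m → - x + q * m + x + x ≡ x + q * m
      l = solve-∀
      l2 : ∀ x m → x + 0ℤ * m ≡ x
      l2 = solve-∀

    sides-0 : ∀ i → i ≢ X → i ≢ - X → (0ℤ < g i) ⇔ (0ℤ < i)
    sides-0 i ne₁ ne₂ with congᵇ-inspect i X | congᵇ-inspect i (- X)
    ... | true , e1 | _ = sides-0-at-x i ne₁ e1
    ... | false , e1 | true , e2 = sides-0-at-neg-x i ne₂ e1 e2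
    ... | false , e1 | false , e2 = ⇔-substˡ {λ z → 0ℤ < z} (flip-away {X} {i} e1 e2) ⇔-refl

    sides-n-at-x : ∀ i → congᵇ i X ≡ true → (g i < nℤ) ⇔ (i < nℤ)
    sides-n-at-x i e1 with ≈-witness (congᵇ⇒≈ {i} {X} e1)
    ... | q , refl = ⇔-substˡ {λ z → z < nℤ} (trans (flip-at-a {X} {X + q * 2nℤ} e1) (l X q 2nℤ))
                       (⇔-sym (Small-shift<n {X} { - X} sx snx q))
      where
      l : ∀ x q m → x + q * m - x - x ≡ - x + q * m
      l = solve-∀

    sides-n-at-neg-x : ∀ i → congᵇ i X ≡ false → congᵇ i (- X) ≡ true → (g i < nℤ) ⇔ (i < nℤ)
    sides-n-at-neg-x i e1 e2 with ≈-witness (congᵇ⇒≈ {i} { - X} e2)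
    ... | q , refl = ⇔-substˡ {λ z → z < nℤ} (trans (flip-at-neg-a {X} { - X + q * 2nℤ} e1 e2) (l X q 2nℤ))
                       (⇔-sym (Small-shift<n { - X} {X} snx sx q))
      where
      l : ∀ x q m → - x + q * m + x + x ≡ x + q * m
      l = solve-∀

    sides-n : ∀ i → (g i < nℤ) ⇔ (i < nℤ)
    sides-n i with congᵇ-inspect i X | congᵇ-inspect i (- X)
    ... | true , e1 | _ = sides-n-at-x i e1
    ... | false , e1 | true , e2 = sides-n-at-neg-x i e1 e2
    ... | false , e1 | false , e2 = ⇔-substˡ {λ z → z < nℤ} (flip-away {X} {i} e1 e2) ⇔-refl

  module FlipCrossings {ρ : ℤ → ℤ} {x : ℕ} (Aρ : Aff ρ) (wx : InWindow x) where
    open AffProps Aρ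
    open FlipSides wx
    open WindowBounds wx using (¬0<-X)
    inv = SignFlip.inv xx
    module TransferA = EnumerationTransfer Positive Negative ρ g g inv inv
    module TransferB = EnumerationTransfer BelowN AboveN ρ g g inv inv
    gX : g X ≡ - X
    gX = trans (flip-at-a {X} {X} (≈⇒congᵇ (≈-refl {X}))) (l X)
      where
      l : ∀ x → x - x - x ≡ - x
      l = solve-∀
    gnX : g (- X) ≡ X
    gnX = trans (flip-at-neg-a {X} { - X} (≉⇒congᵇ (λ q → xx (≈-sym q))) (≈⇒congᵇ (≈-refl { - X}))) (l X)
      where
      l : ∀ x → - x + x + x ≡ x
      l = solve-∀
    ρX≢0 : ρ X ≢ 0ℤ
    ρX≢0 e = ℤP.<⇒≢ (InWindow⇒0< wx) (sym (inj (trans e (sym fixes-0))))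
    crossesZero-toggle : ∀ {xs} → Enumerates (CrossesZero ρ) xs →
      Σ (List ℤ) λ ys → Enumerates (CrossesZero (λ z → ρ (g z))) ys × (parity (length ys) ≡ not (parity (length xs)))
    crossesZero-toggle ex with ℤP.<-cmp (ρ X) 0ℤ
    ... | tri< lt _ _ = TransferA.preimage-toggle ex (- X) cond (subst (λ z → ρ z < 0ℤ) (sym gnX) lt)
                          (inj₁ (subst (0ℤ <_) (sym gnX) (InWindow⇒0< wx) , ¬0<-X))
      where
      cond : ∀ i → i ≢ - X → ρ (g i) < 0ℤ → ((0ℤ < g i) → (0ℤ < i)) × ((0ℤ < i) → (0ℤ < g i))
      cond i ne r with i ℤ.≟ X
      ... | yes refl = ⊥-elim (ℤP.<-asym lt (-v<0⇒0<v (subst (_< 0ℤ) (trans (cong ρ gX) (odd X)) r)))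
      ... | no ne1 = sides-0 i ne1 ne
    ... | tri≈ _ e _ = ⊥-elim (ρX≢0 e)
    ... | tri> _ _ gt = TransferA.preimage-toggle ex X cond (subst (λ z → ρ z < 0ℤ) (sym gX) (subst (_< 0ℤ) (sym (odd X)) (0<v⇒-v<0 gt)))
                          (inj₂ ((λ q → ¬0<-X (subst (0ℤ <_) gX q)) , InWindow⇒0< wx))
      where
      cond : ∀ i → i ≢ X → ρ (g i) < 0ℤ → ((0ℤ < g i) → (0ℤ < i)) × ((0ℤ < i) → (0ℤ < g i))
      cond i ne r with i ℤ.≟ - X
      ... | yes refl = ⊥-elim (ℤP.<-asym gt (subst (_< 0ℤ) (cong ρ gnX) r))
      ... | no ne2 = sides-0 i ne ne2

  CrossingParity-flip : ∀ {ρ b0 x} → Aff ρ → InWindow x → CrossingParity ρ b0 → CrossingParity (λ z → ρ (signFlip (+ x) z)) (not b0)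
  CrossingParity-flip {ρ} {b0} {x} Aρ wx (xs , ys , ex , ey , p) with FlipCrossings.crossesZero-toggle Aρ wx ex
  ... | ys1 , e1 , p1 = ys1 , map g ys , e1 , TransferB.preimage ey (λ i _ → sides-n i) ,
    trans (parity-+ (length ys1) (length (map g ys)))
      (trans (cong₂ _xor_ p1 (cong parity (length-map g ys)))
        (trans (sym (not-distribˡ-xor (parity (length xs)) (parity (length ys))))
               (cong not (trans (sym (parity-+ (length xs) (length ys))) p))))
    where
    open FlipSides wx
    module TransferB = EnumerationTransfer BelowN AboveN ρ g g (SignFlip.inv xx) (SignFlip.inv xx)

  CrossingParity-loop⁻ : ∀ {ρ b0 x} → Aff ρ → InWindow x → CrossingParity ρ b0 → CrossingParity (λ z → ρ (loop n (- (+ x)) z)) b0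
  CrossingParity-loop⁻ {ρ} {b0} {x} Aρ wx h =
    CrossingParity-resp eq (subst (CrossingParity _) (not-involutive b0) (CrossingParity-flip A2 wx (CrossingParity-loop A1 wx (CrossingParity-flip Aρ wx h))))
    where
    X = + x
    xx = InWindow-≉- wx wx
    Af = SignFlip.aff xx
    A1 : Aff (λ z → ρ (signFlip X z))
    A1 = Aff-∘ Aρ Af (λ z → refl)
    A2 : Aff (λ z → ρ (signFlip X (loop n X z)))
    A2 = Aff-∘ A1 (Aff-loop xx) (λ z → refl)
    gX : signFlip X X ≡ - X
    gX = trans (flip-at-a {X} {X} (≈⇒congᵇ (≈-refl {X}))) (l X)
      where
      l : ∀ x → x - x - x ≡ - x
      l = solve-∀
    eq : (λ z → ρ (signFlip X (loop n X (signFlip X z)))) ≗ (λ z → ρ (loop n (- X) z))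
    eq z = cong ρ (trans (Conjugation.conj-loop Af X (signFlip X z)) (cong₂ (loop n) gX (SignFlip.inv xx z)))

  CrossingParity-transp⁻ : ∀ {ρ b0 a b} → Aff ρ → InWindow a → InWindow b → a ≢ b → CrossingParity ρ b0 → CrossingParity (λ z → ρ (transp n (+ a) (- (+ b)) z)) b0
  CrossingParity-transp⁻ {ρ} {b0} {a} {b} Aρ wa wb ne h =
    CrossingParity-resp eq (subst (CrossingParity _) (not-involutive b0) (CrossingParity-flip A2 wb (CrossingParity-transp {ρ = λ z → ρ (signFlip B z)} wa wb ne (CrossingParity-flip Aρ wb h))))
    where
    A = + a
    B = + b
    b≉-b = InWindow-≉- wb wb
    Af = SignFlip.aff b≉-b
    A1 : Aff (λ z → ρ (signFlip B z))
    A1 = Aff-∘ Aρ Af (λ z → refl)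
    A2 : Aff (λ z → ρ (signFlip B (transp n A B z)))
    A2 = Aff-∘ A1 (Transp.aff (Nondegenerate-window wa wb ne)) (λ z → refl)
    gB : signFlip B B ≡ - B
    gB = trans (flip-at-a {B} {B} (≈⇒congᵇ (≈-refl {B}))) (l B)
      where
      l : ∀ x → x - x - x ≡ - x
      l = solve-∀
    gA : signFlip B A ≡ A
    gA = flip-away {B} {A} (≉⇒congᵇ (Nondegenerate.a≉b (Nondegenerate-window wa wb ne))) (≉⇒congᵇ (InWindow-≉- wa wb))
    eq : (λ z → ρ (signFlip B (transp n A B (signFlip B z)))) ≗ (λ z → ρ (transp n A (- B) z))
    eq z = cong ρ (trans (Conjugation.conj-transp Af A B (signFlip B z)) (trans (cong₂ (λ u v → transp n u v (signFlip B (signFlip B z))) gA gB) (cong (transp n A (- B)) (SignFlip.inv b≉-b z))))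

  ∣v∣≡n⇒v≡±n : ∀ v → ∣ v ∣ ≡ n → v ≡ nℤ ⊎ v ≡ - nℤ
  ∣v∣≡n⇒v≡±n (+ m) refl = inj₁ refl
  ∣v∣≡n⇒v≡±n -[1+ m ] refl = inj₂ refl

  -n≈n : - nℤ ≈ nℤ
  -n≈n = ≈-by (- 1ℤ) (trans (l nℤ) (cong (λ w → nℤ + - 1ℤ * w) (sym 2nℤ≡nℤ+nℤ)))
    where
    l : ∀ n → - n ≡ n + - 1ℤ * (n + n)
    l = solve-∀

  module WindowTransp {x s : ℕ} (wx : InWindow x) (ws : InWindow s) (ne : x ≢ s) where
    X = + x
    S = + s
    nd = Nondegenerate-window wx ws ne

    transp-x : transp n X S X ≡ S
    transp-x = trans (transp-at-a {X} {S} {X} (≈⇒congᵇ (≈-refl {X}))) (l X S)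
      where
      l : ∀ x s → x - x + s ≡ s
      l = solve-∀
    transp-s : transp n X S S ≡ X
    transp-s = trans (transp-at-b {X} {S} {S} (≉⇒congᵇ (λ p → Nondegenerate.a≉b nd (≈-sym p))) (≈⇒congᵇ (≈-refl {S}))) (l X S)
      where
      l : ∀ x s → s - s + x ≡ x
      l = solve-∀
    transp-other : ∀ {y} → InWindow y → y ≢ x → y ≢ s → transp n X S (+ y) ≡ + y
    transp-other {y} wy ne₁ ne₂ = transp-away {X} {S} {+ y} (≉⇒congᵇ (proj₁ (not-signed-class false wy wx ne₁ ≈-refl)))
                                            (≉⇒congᵇ (proj₁ (not-signed-class false wy ws ne₂ ≈-refl)))
                                            (≉⇒congᵇ (InWindow-≉- wy wx)) (≉⇒congᵇ (InWindow-≉- wy ws))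

    transp⁻-x : transp n X (- S) X ≡ - S
    transp⁻-x = trans (transp-at-a {X} { - S} {X} (≈⇒congᵇ (≈-refl {X}))) (l X (- S))
      where
      l : ∀ x s → x - x + s ≡ s
      l = solve-∀
    transp⁻-s : transp n X (- S) S ≡ - X
    transp⁻-s = trans (transp-at-neg-b {X} { - S} {S} (≉⇒congᵇ (λ p → Nondegenerate.a≉b nd (≈-sym p))) (≉⇒congᵇ (InWindow-≉- ws ws)) (≉⇒congᵇ (InWindow-≉- ws wx))
                                          (≈⇒congᵇ (subst (λ z → S ≈ z) (sym (neg-involutive S)) (≈-refl {S})))) (l X S)
      where
      l : ∀ x s → s + - s - x ≡ - x
      l = solve-∀
    transp⁻-other : ∀ {y} → InWindow y → y ≢ x → y ≢ s → transp n X (- S) (+ y) ≡ + y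
    transp⁻-other {y} wy ne₁ ne₂ = transp-away {X} { - S} {+ y} (≉⇒congᵇ (proj₁ (not-signed-class false wy wx ne₁ ≈-refl)))
                                            (≉⇒congᵇ (InWindow-≉- wy ws))
                                            (≉⇒congᵇ (InWindow-≉- wy wx))
                                            (≉⇒congᵇ (λ p → proj₁ (not-signed-class false wy ws ne₂ ≈-refl) (subst (λ z → + y ≈ z) (neg-involutive S) p)))

  module WindowLoop {x : ℕ} (wx : InWindow x) where
    X = + x
    xx = InWindow-≉- wx wx
    loop-x : loop n X X ≡ X + 2nℤ
    loop-x = loop-at-i {X} {X} (≈⇒congᵇ (≈-refl {X}))
    loop⁻-x : loop n (- X) X ≡ X - 2nℤ
    loop⁻-x = loop-at-neg-i { - X} {X} (≉⇒congᵇ xx) (≈⇒congᵇ (subst (λ z → X ≈ z) (sym (neg-involutive X)) (≈-refl {X})))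
    loop-other : ∀ {y} → InWindow y → y ≢ x → loop n X (+ y) ≡ + y
    loop-other {y} wy ne = loop-away {X} {+ y} (≉⇒congᵇ (proj₁ (not-signed-class false wy wx ne ≈-refl))) (≉⇒congᵇ (InWindow-≉- wy wx))
    loop⁻-other : ∀ {y} → InWindow y → y ≢ x → loop n (- X) (+ y) ≡ + y
    loop⁻-other {y} wy ne = loop-away { - X} {+ y} (≉⇒congᵇ (InWindow-≉- wy wx))
                           (≉⇒congᵇ (λ p → proj₁ (not-signed-class false wy wx ne ≈-refl) (subst (λ z → + y ≈ z) (neg-involutive X) p)))

  record ReductionSteps (Φ : (ℤ → ℤ) → Set) : Set where
    field
      step-id : ∀ {π} → π ≗ (λ z → z) → Φ π
      step-loop : ∀ {ρ x} → Aff ρ → InWindow x → Φ (λ z → ρ (loop n (+ x) z)) → Φ ρ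
      step-loop⁻ : ∀ {ρ x} → Aff ρ → InWindow x → Φ (λ z → ρ (loop n (- (+ x)) z)) → Φ ρ
      step-transp : ∀ {ρ a b} → Aff ρ → InWindow a → InWindow b → a ≢ b → Φ (λ z → ρ (transp n (+ a) (+ b) z)) → Φ ρ
      step-transp⁻ : ∀ {ρ a b} → Aff ρ → InWindow a → InWindow b → a ≢ b → Φ (λ z → ρ (transp n (+ a) (- (+ b)) z)) → Φ ρ

  count-false : Bool → ℕ
  count-false true = 0
  count-false false = 1

  count-false≤1 : ∀ b → count-false b ℕ.≤ 1
  count-false≤1 true = z≤n
  count-false≤1 false = ℕP.≤-refl

  eqᵇ-false : ∀ {u v} → u ≢ v → eqᵇ u v ≡ false
  eqᵇ-false {u} {v} ne = dec-false (u ℤ.≟ v) ne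

  eqᵇ-true : ∀ {u v} → u ≡ v → eqᵇ u v ≡ true
  eqᵇ-true {u} {v} e = dec-true (u ℤ.≟ v) e

  #moved : (ℤ → ℤ) → ℕ
  #moved ρ = sum1to (λ y → count-false (eqᵇ (ρ (+ y)) (+ y))) n∸1

  windowMass : (ℤ → ℤ) → ℕ
  windowMass ρ = sum1to (λ y → ∣ ρ (+ y) ∣) n∸1

  ≉0-neg : ∀ {v} → ¬ v ≈ 0ℤ → ¬ (- v) ≈ 0ℤ
  ≉0-neg {v} ne p = ne (subst₂ _≈_ (neg-involutive v) refl (≈-neg p))

  ≉n-neg : ∀ {v} → ¬ v ≈ nℤ → ¬ (- v) ≈ nℤ
  ≉n-neg {v} ne p = ne (≈-trans (subst₂ _≈_ (neg-involutive v) refl (≈-neg p)) -n≈n)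

  Nondegenerate-window⁻ : ∀ {a b} → InWindow a → InWindow b → a ≢ b → Nondegenerate (+ a) (- (+ b))
  Nondegenerate-window⁻ {a} {b} wa wb ne = record
    { a≉b = InWindow-≉- wa wb
    ; a≉-b = λ p → Nondegenerate.a≉b (Nondegenerate-window wa wb ne) (subst (λ z → + a ≈ z) (neg-involutive (+ b)) p)
    ; a≉-a = InWindow-≉- wa wa
    ; b≉-b = λ p → InWindow-≉- wb wb (-≈-⇒≈ p) }

  window-preimage : ∀ {ρ} → Aff ρ → (∀ y → InWindow y → Small (ρ (+ y))) → ∀ x → InWindow x → Σ ℕ λ s → InWindow s × ((ρ (+ s) ≡ + x) ⊎ (ρ (+ s) ≡ - (+ x)))
  window-preimage {ρ} Aρ sm x wx with surj (+ x)
    where open AffProps Aρ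
  ... | z , ez = go (≈? z 0ℤ) (≈? z nℤ)
    where
    open AffProps Aρ
    go : Dec (z ≈ 0ℤ) → Dec (z ≈ nℤ) → Σ ℕ λ s → InWindow s × ((ρ (+ s) ≡ + x) ⊎ (ρ (+ s) ≡ - (+ x)))
    go (yes p) _ = ⊥-elim (InWindow⇒≉0 wx (subst (_≈ 0ℤ) ez (subst (ρ z ≈_) fixes-0 (resp≈ p))))
    go (no _) (yes p) = ⊥-elim (InWindow⇒≉n wx (subst (_≈ nℤ) ez (subst (ρ z ≈_) fixes-n (resp≈ p))))
    go (no p0) (no pn) with windowRep p0 pn
    ... | mkRep s 0<s s<n false e = s , (0<s , s<n) , inj₁ (sym (Small-≈⇒≡ {+ x} {ρ (+ s)} (InWindow⇒Small wx) (sm s (0<s , s<n)) (subst (_≈ ρ (+ s)) ez (resp≈ e))))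
    ... | mkRep s 0<s s<n true e = s , (0<s , s<n) , inj₂ (trans (sym (neg-involutive (ρ (+ s)))) (cong -_ (sym (Small-≈⇒≡ {+ x} { - ρ (+ s)} (InWindow⇒Small wx) (Small-neg {ρ (+ s)} (sm s (0<s , s<n))) (subst₂ _≈_ ez (odd (+ s)) (resp≈ e))))))

  lone-sign-change : ∀ ρ x → InWindow x → ρ (+ x) ≡ - (+ x) → (∀ y → InWindow y → y ≢ x → ρ (+ y) ≡ + y) → signParity ρ ≡ true
  lone-sign-change ρ x wx ex fixed =
    trans (xorSum-single _ n∸1 x (proj₁ wx) (ℕP.≤-pred (proj₂ wx))
            (λ y a b ne → trans (cong upperHalf (fixed y (a , s≤s b) ne)) (upperHalf-pos y (s≤s b))))
          (trans (cong upperHalf ex) (upperHalf-neg x (proj₁ wx) (proj₂ wx)))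

  0<2nℤ : 0ℤ < 2nℤ
  0<2nℤ = +<+ (s≤s z≤n)

  mass-decreases⁺ : ∀ v → n ℕ.< v → ∣ + v - 2nℤ ∣ ℕ.< v
  mass-decreases⁺ v n<v = ∣a∣<∣b∣ {+ v - 2nℤ} {+ v} (+<+ (ℕP.<-trans (s≤s z≤n) n<v)) lower upper
    where
    pv : 0ℤ < + v - nℤ
    pv = i<j⇒0<j-i (+<+ n<v)
    lower : - (+ v) < + v - 2nℤ
    lower = <-by ((+ v - nℤ) + (+ v - nℤ)) (ℤP.+-mono-< pv pv) (trans (cong (λ w → + v - w) 2nℤ≡nℤ+nℤ) (l (+ v) nℤ))
      where
      l : ∀ v n → v - (n + n) ≡ - v + ((v - n) + (v - n))
      l = solve-∀
    upper : + v - 2nℤ < + v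
    upper = <-by 2nℤ 0<2nℤ (l (+ v) 2nℤ)
      where
      l : ∀ v m → v ≡ v - m + m
      l = solve-∀

  mass-decreases⁻ : ∀ v → n ℕ.< suc v → ∣ -[1+ v ] + 2nℤ ∣ ℕ.< suc v
  mass-decreases⁻ v n<v = ∣a∣<∣b∣ {w + 2nℤ} { - w} (+<+ (s≤s z≤n)) lower upper
    where
    w = -[1+ v ]
    pv : 0ℤ < - w - nℤ
    pv = i<j⇒0<j-i (+<+ n<v)
    lower : w < w + 2nℤ
    lower = <-by 2nℤ 0<2nℤ refl
    upper : w + 2nℤ < - w
    upper = <-by ((- w - nℤ) + (- w - nℤ)) (ℤP.+-mono-< pv pv) (trans (l w nℤ) (cong (λ m → w + m + ((- w - nℤ) + (- w - nℤ))) (sym 2nℤ≡nℤ+nℤ)))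
      where
      l : ∀ w n → - w ≡ w + (n + n) + ((- w - n) + (- w - n))
      l = solve-∀

  window-Small : ∀ {ρ} → Aff ρ → (∀ y → 0 ℕ.< y → y ℕ.< n → ¬ n ℕ.< ∣ ρ (+ y) ∣) → ∀ y → InWindow y → Small (ρ (+ y))
  window-Small {ρ} Aρ h y wy with ∣ ρ (+ y) ∣ ℕ.≟ n
  ... | no ne = ℕP.≤∧≢⇒< (ℕP.≮⇒≥ (h y (proj₁ wy) (proj₂ wy))) ne
  ... | yes e with ∣v∣≡n⇒v≡±n (ρ (+ y)) e
  ...   | inj₁ e' = ⊥-elim (AffProps.pres-≉n Aρ (InWindow⇒≉n wy) (subst (_≈ nℤ) (sym e') ≈-refl))
  ...   | inj₂ e' = ⊥-elim (AffProps.pres-≉n Aρ (InWindow⇒≉n wy) (subst (_≈ nℤ) (sym e') -n≈n))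

  -x≉x : ∀ {x} → InWindow x → ¬ (- (+ x)) ≈ - - (+ x)
  -x≉x {x} wx p = InWindow-≉- wx wx (≈-sym (subst (λ z → - (+ x) ≈ z) (neg-involutive (+ x)) p))

  windowMass-move : ∀ {ρ ρ' x} → InWindow x → (∀ y → InWindow y → y ≢ x → ρ' (+ y) ≡ ρ (+ y)) →
                    ∣ ρ' (+ x) ∣ ℕ.< ∣ ρ (+ x) ∣ → windowMass ρ' ℕ.< windowMass ρ
  windowMass-move {ρ} {ρ'} {x} wx same lt = sum1to-mono-< _ _ n∸1 x h (proj₁ wx) (ℕP.≤-pred (proj₂ wx)) lt
    where
    h : ∀ y → 0 ℕ.< y → y ℕ.≤ n∸1 → ∣ ρ' (+ y) ∣ ℕ.≤ ∣ ρ (+ y) ∣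
    h y a b with y ℕ.≟ x
    ... | yes refl = ℕP.<⇒≤ lt
    ... | no ne = ℕP.≤-reflexive (cong ∣_∣ (same y (a , s≤s b) ne))

  windowMass-loop⁻ : ∀ {ρ x v} → Aff ρ → InWindow x → ρ (+ x) ≡ + v → n ℕ.< ∣ + v ∣ →
                     windowMass (λ z → ρ (loop n (- (+ x)) z)) ℕ.< windowMass ρ
  windowMass-loop⁻ {ρ} {x} {v} Aρ wx eq big =
    windowMass-move {ρ} {λ z → ρ (loop n (- (+ x)) z)} wx (λ y wy ne → cong ρ (WindowLoop.loop⁻-other wx wy ne)) (subst₂ ℕ._<_ (cong ∣_∣ (sym ex)) (cong ∣_∣ (sym eq)) (mass-decreases⁺ v big))
    where
    ex : ρ (loop n (- (+ x)) (+ x)) ≡ + v - 2nℤ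
    ex = trans (cong ρ (WindowLoop.loop⁻-x wx)) (trans (AffProps.per⁻ Aρ (+ x)) (cong (_- 2nℤ) eq))

  windowMass-loop : ∀ {ρ x v} → Aff ρ → InWindow x → ρ (+ x) ≡ -[1+ v ] → n ℕ.< ∣ -[1+ v ] ∣ →
                    windowMass (λ z → ρ (loop n (+ x) z)) ℕ.< windowMass ρ
  windowMass-loop {ρ} {x} {v} Aρ wx eq big =
    windowMass-move {ρ} {λ z → ρ (loop n (+ x) z)} wx (λ y wy ne → cong ρ (WindowLoop.loop-other wx wy ne)) (subst₂ ℕ._<_ (cong ∣_∣ (sym ex)) (cong ∣_∣ (sym eq)) (mass-decreases⁻ v big))
    where
    ex : ρ (loop n (+ x) (+ x)) ≡ -[1+ v ] + 2nℤ
    ex = trans (cong ρ (WindowLoop.loop-x wx)) (trans (AffProps.per Aρ (+ x)) (cong (_+ 2nℤ) eq))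

  module Reduction {Φ : (ℤ → ℤ) → Set} (H : ReductionSteps Φ) where
    open ReductionSteps H

    moved? : ∀ (ρ : ℤ → ℤ) y → Dec (ρ (+ y) ≢ + y)
    moved? ρ y with ρ (+ y) ℤ.≟ + y
    ... | yes e = no (λ ne → ne e)
    ... | no ne = yes ne

    not-moved : ∀ (ρ : ℤ → ℤ) y → ¬ (ρ (+ y) ≢ + y) → ρ (+ y) ≡ + y
    not-moved ρ y nn' with ρ (+ y) ℤ.≟ + y
    ... | yes e = e
    ... | no ne = ⊥-elim (nn' ne)

    module OneMoreFixed (ρ : ℤ → ℤ) (Aρ : Aff ρ) (Pf : signParity ρ ≡ false) (sm : ∀ y → InWindow y → Small (ρ (+ y)))
                 (ρ' : ℤ → ℤ) (x s : ℕ) (wx : InWindow x) (ws : InWindow s)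
                 (e-x : ρ' (+ x) ≡ + x) (nfx : ρ (+ x) ≢ + x) (nfs : ρ (+ s) ≢ + s)
                 (e-o : ∀ y → InWindow y → y ≢ x → y ≢ s → ρ' (+ y) ≡ ρ (+ y)) where
      #moved-< : #moved ρ' ℕ.< #moved ρ
      #moved-< = sum1to-mono-< _ _ n∸1 x h (proj₁ wx) (ℕP.≤-pred (proj₂ wx)) (subst (λ b → count-false b ℕ.< count-false (eqᵇ (ρ (+ x)) (+ x))) (sym (eqᵇ-true e-x)) (subst (λ b → 0 ℕ.< count-false b) (sym (eqᵇ-false nfx)) (s≤s z≤n)))
        where
        h : ∀ y → 0 ℕ.< y → y ℕ.≤ n∸1 → count-false (eqᵇ (ρ' (+ y)) (+ y)) ℕ.≤ count-false (eqᵇ (ρ (+ y)) (+ y))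
        h y a b with y ℕ.≟ x | y ℕ.≟ s
        ... | yes refl | _ = subst (λ c → count-false c ℕ.≤ _) (sym (eqᵇ-true e-x)) z≤n
        ... | no _ | yes refl = subst (λ c → _ ℕ.≤ count-false c) (sym (eqᵇ-false nfs)) (count-false≤1 _)
        ... | no n1' | no n2' = ℕP.≤-reflexive (cong (λ v → count-false (eqᵇ v (+ y))) (e-o y (a , s≤s b) n1' n2'))

    SmallerDone : (ℤ → ℤ) → Set
    SmallerDone ρ = ∀ ρ' → #moved ρ' ℕ.< #moved ρ → Aff ρ' → signParity ρ' ≡ false → (∀ y → InWindow y → Small (ρ' (+ y))) → Φ ρ'

    -x≢y : ∀ {x y} → InWindow x → - (+ x) ≢ + y
    -x≢y {suc x} _ ()

    fix-by-transp : ∀ ρ → Aff ρ → signParity ρ ≡ false → (∀ y → InWindow y → Small (ρ (+ y))) → SmallerDone ρ →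
            ∀ x s → InWindow x → InWindow s → ρ (+ x) ≢ + x → ρ (+ s) ≡ + x → Φ ρ
    fix-by-transp ρ Aρ Pf sm rec x s wx ws nfx es = step-transp Aρ wx ws ne (rec ρ' (S2.#moved-<) Aρ' P' sm')
      where
      ne : x ≢ s
      ne refl = nfx es
      module E = WindowTransp wx ws ne
      ρ' = λ z → ρ (transp n (+ x) (+ s) z)
      e-x : ρ' (+ x) ≡ + x
      e-x = trans (cong ρ E.transp-x) es
      nfs : ρ (+ s) ≢ + s
      nfs e = ne (ℤP.+-injective (trans (sym es) e))
      e-o : ∀ y → InWindow y → y ≢ x → y ≢ s → ρ' (+ y) ≡ ρ (+ y)
      e-o y wy n1' n2' = cong ρ (E.transp-other wy n1' n2')
      module S2 = OneMoreFixed ρ Aρ Pf sm ρ' x s wx ws e-x nfx nfs e-o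
      Aρ' : Aff ρ'
      Aρ' = Aff-∘ Aρ (Transp.aff E.nd) (λ _ → refl)
      P' : signParity ρ' ≡ false
      P' = trans (SignParity.signParity-transp Aρ E.nd (InWindow⇒≉0 wx) (InWindow⇒≉n wx) (InWindow⇒≉0 ws) (InWindow⇒≉n ws)) Pf
      sm' : ∀ y → InWindow y → Small (ρ' (+ y))
      sm' y wy with y ℕ.≟ x | y ℕ.≟ s
      ... | yes refl | _ = subst Small (sym e-x) (InWindow⇒Small wx)
      ... | no _ | yes refl = subst Small (sym (cong ρ E.transp-s)) (sm x wx)
      ... | no a | no b = subst Small (sym (e-o y wy a b)) (sm y wy)

    fix-by-transp⁻ : ∀ ρ → Aff ρ → signParity ρ ≡ false → (∀ y → InWindow y → Small (ρ (+ y))) → SmallerDone ρ →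
            ∀ x s → InWindow x → InWindow s → s ≢ x → ρ (+ x) ≢ + x → ρ (+ s) ≡ - (+ x) → Φ ρ
    fix-by-transp⁻ ρ Aρ Pf sm rec x s wx ws ne' nfx es = step-transp⁻ Aρ wx ws ne (rec ρ' (S2.#moved-<) Aρ' P' sm')
      where
      open AffProps Aρ
      ne : x ≢ s
      ne e = ne' (sym e)
      module E = WindowTransp wx ws ne
      ρ' = λ z → ρ (transp n (+ x) (- (+ s)) z)
      e-x : ρ' (+ x) ≡ + x
      e-x = trans (cong ρ E.transp⁻-x) (trans (odd (+ s)) (trans (cong -_ es) (neg-involutive (+ x))))
      nfs : ρ (+ s) ≢ + s
      nfs e = -x≢y wx (trans (sym es) e)
      e-o : ∀ y → InWindow y → y ≢ x → y ≢ s → ρ' (+ y) ≡ ρ (+ y)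
      e-o y wy n1' n2' = cong ρ (E.transp⁻-other wy n1' n2')
      module S2 = OneMoreFixed ρ Aρ Pf sm ρ' x s wx ws e-x nfx nfs e-o
      nd = Nondegenerate-window⁻ wx ws ne
      Aρ' : Aff ρ'
      Aρ' = Aff-∘ Aρ (Transp.aff nd) (λ _ → refl)
      P' : signParity ρ' ≡ false
      P' = trans (SignParity.signParity-transp Aρ nd (InWindow⇒≉0 wx) (InWindow⇒≉n wx) (≉0-neg (InWindow⇒≉0 ws)) (≉n-neg (InWindow⇒≉n ws))) Pf
      sm' : ∀ y → InWindow y → Small (ρ' (+ y))
      sm' y wy with y ℕ.≟ x | y ℕ.≟ s
      ... | yes refl | _ = subst Small (sym e-x) (InWindow⇒Small wx)
      ... | no _ | yes refl = subst Small (sym (trans (cong ρ E.transp⁻-s) (odd (+ x)))) (Small-neg {ρ (+ x)} (sm x wx))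
      ... | no a | no b = subst Small (sym (e-o y wy a b)) (sm y wy)

    fix-sign-via : ∀ ρ → Aff ρ → signParity ρ ≡ false → (∀ y → InWindow y → Small (ρ (+ y))) → SmallerDone ρ →
            ∀ x t → InWindow x → InWindow t → x ≢ t → ρ (+ x) ≡ - (+ x) → ρ (+ t) ≢ + t → Φ ρ
    fix-sign-via ρ Aρ Pf sm rec x t wx wt ne ex nft =
      step-transp Aρ wx wt ne (step-transp⁻ Aρ1 wx wt ne (rec ρ2 S2.#moved-< Aρ2 P2 sm'))
      where
      open AffProps Aρ
      module E = WindowTransp wx wt ne
      T1 = transp n (+ x) (+ t)
      ρ1 = λ z → ρ (T1 z)
      ρ2 = λ z → ρ1 (transp n (+ x) (- (+ t)) z)
      nd1 = E.nd
      nd2 = Nondegenerate-window⁻ wx wt ne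
      Aρ1 : Aff ρ1
      Aρ1 = Aff-∘ Aρ (Transp.aff nd1) (λ _ → refl)
      Aρ2 : Aff ρ2
      Aρ2 = Aff-∘ Aρ1 (Transp.aff nd2) (λ _ → refl)
      P2 : signParity ρ2 ≡ false
      P2 = trans (SignParity.signParity-transp Aρ1 nd2 (InWindow⇒≉0 wx) (InWindow⇒≉n wx) (≉0-neg (InWindow⇒≉0 wt)) (≉n-neg (InWindow⇒≉n wt)))
                 (trans (SignParity.signParity-transp Aρ nd1 (InWindow⇒≉0 wx) (InWindow⇒≉n wx) (InWindow⇒≉0 wt) (InWindow⇒≉n wt)) Pf)
      e-x : ρ2 (+ x) ≡ + x
      e-x = trans (cong ρ1 E.transp⁻-x) (trans (cong ρ (Transp.odd nd1 (+ t))) (trans (cong (λ z → ρ (- z)) E.transp-s)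
              (trans (odd (+ x)) (trans (cong -_ ex) (neg-involutive (+ x))))))
      e-t : ρ2 (+ t) ≡ - ρ (+ t)
      e-t = trans (cong ρ1 E.transp⁻-s) (trans (cong ρ (Transp.odd nd1 (+ x))) (trans (cong (λ z → ρ (- z)) E.transp-x) (odd (+ t))))
      e-o : ∀ y → InWindow y → y ≢ x → y ≢ t → ρ2 (+ y) ≡ ρ (+ y)
      e-o y wy n1' n2' = trans (cong ρ1 (E.transp⁻-other wy n1' n2')) (cong ρ (E.transp-other wy n1' n2'))
      nfx : ρ (+ x) ≢ + x
      nfx e = -x≢y wx (trans (sym ex) e)
      module S2 = OneMoreFixed ρ Aρ Pf sm ρ2 x t wx wt e-x nfx nft e-o
      sm' : ∀ y → InWindow y → Small (ρ2 (+ y))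
      sm' y wy with y ℕ.≟ x | y ℕ.≟ t
      ... | yes refl | _ = subst Small (sym e-x) (InWindow⇒Small wx)
      ... | no _ | yes refl = subst Small (sym e-t) (Small-neg {ρ (+ t)} (sm t wt))
      ... | no a | no b = subst Small (sym (e-o y wy a b)) (sm y wy)

    fix-sign : ∀ ρ → Aff ρ → signParity ρ ≡ false → (∀ y → InWindow y → Small (ρ (+ y))) → SmallerDone ρ →
            ∀ x → InWindow x → ρ (+ x) ≡ - (+ x) → Φ ρ
    fix-sign ρ Aρ Pf sm rec x wx ex with search1to (λ y → (y ≢ x) × (ρ (+ y) ≢ + y)) dec n∸1
      where
      dec : ∀ y → Dec ((y ≢ x) × (ρ (+ y) ≢ + y))
      dec y with y ℕ.≟ x | moved? ρ y
      ... | yes e | _ = no (λ p → proj₁ p e)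
      ... | no ne | yes q = yes (ne , q)
      ... | no ne | no q = no (λ p → q (proj₂ p))
    ... | inj₁ (t , 0<t , t≤ , t≢x , nft) = fix-sign-via ρ Aρ Pf sm rec x t wx (0<t , s≤s t≤) (λ e → t≢x (sym e)) ex nft
    ... | inj₂ h = ⊥-elim (true≢false (trans (sym (lone-sign-change ρ x wx ex fixed)) Pf))
      where
      fixed : ∀ y → InWindow y → y ≢ x → ρ (+ y) ≡ + y
      fixed y wy y≢x with ρ (+ y) ℤ.≟ + y
      ... | yes e = e
      ... | no q = ⊥-elim (h y (proj₁ wy) (ℕP.≤-pred (proj₂ wy)) (y≢x , q))

    reduce-small : ∀ bound ρ → #moved ρ ℕ.< bound → Aff ρ → signParity ρ ≡ false → (∀ y → InWindow y → Small (ρ (+ y))) → Φ ρ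
    reduce-small zero ρ () Aρ Pf sm
    reduce-small (suc bound) ρ lt Aρ Pf sm with search1to (λ y → ρ (+ y) ≢ + y) (moved? ρ) n∸1
    ... | inj₂ h = step-id (Aff-ext Aρ (Aff-id (λ _ → refl)) (λ y a b → not-moved ρ y (h y a (ℕP.≤-pred b))))
    ... | inj₁ (x , 0<x , x≤ , nfx) with window-preimage Aρ sm x (0<x , s≤s x≤)
    ...   | s , ws , inj₁ es = fix-by-transp ρ Aρ Pf sm rec x s (0<x , s≤s x≤) ws nfx es
      where
      rec : SmallerDone ρ
      rec ρ' lt' = reduce-small bound ρ' (ℕP.<-≤-trans lt' (ℕP.≤-pred lt))
    ...   | s , ws , inj₂ es with s ℕ.≟ x
    ...     | no ne = fix-by-transp⁻ ρ Aρ Pf sm rec x s (0<x , s≤s x≤) ws ne nfx es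
      where
      rec : SmallerDone ρ
      rec ρ' lt' = reduce-small bound ρ' (ℕP.<-≤-trans lt' (ℕP.≤-pred lt))
    ...     | yes refl = fix-sign ρ Aρ Pf sm rec s ws es
      where
      rec : SmallerDone ρ
      rec ρ' lt' = reduce-small bound ρ' (ℕP.<-≤-trans lt' (ℕP.≤-pred lt))

    -- Loops strictly decrease the window mass Σ |ρ y| until every window entry
    -- lies in (−n, n); then reduce-small lowers the number of moved entries.
    reduce-mass : ∀ bound ρ → windowMass ρ ℕ.< bound → Aff ρ → signParity ρ ≡ false → Φ ρ
    reduce-mass zero ρ () Aρ Pf
    reduce-mass (suc bound) ρ lt Aρ Pf with search1to (λ y → n ℕ.< ∣ ρ (+ y) ∣) (λ y → n ℕ.<? ∣ ρ (+ y) ∣) n∸1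
    ... | inj₂ h = reduce-small (suc (#moved ρ)) ρ ℕP.≤-refl Aρ Pf (window-Small Aρ (λ y a b → h y a (ℕP.≤-pred b)))
    ... | inj₁ (x , 0<x , x≤ , big) with ρ (+ x) in eq
    ...   | + v = step-loop⁻ Aρ wx (reduce-mass bound _ (ℕP.<-≤-trans (windowMass-loop⁻ Aρ wx eq big) (ℕP.≤-pred lt))
                    (Aff-∘ Aρ (Aff-loop (-x≉x wx)) (λ _ → refl)) (trans (SignParity.signParity-loop Aρ (- (+ x))) Pf))
      where wx = 0<x , s≤s x≤
    ...   | -[1+ v ] = step-loop Aρ wx (reduce-mass bound _ (ℕP.<-≤-trans (windowMass-loop Aρ wx eq big) (ℕP.≤-pred lt))
                    (Aff-∘ Aρ (Aff-loop (InWindow-≉- wx wx)) (λ _ → refl)) (trans (SignParity.signParity-loop Aρ (+ x)) Pf))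
      where wx = 0<x , s≤s x≤

    reduce : ∀ ρ → Aff ρ → signParity ρ ≡ false → Φ ρ
    reduce ρ Aρ Pf = reduce-mass (suc (windowMass ρ)) ρ ℕP.≤-refl Aρ Pf

  crossingParity-steps : ReductionSteps (λ ρ → CrossingParity ρ false)
  crossingParity-steps = record
    { step-id = CrossingParity-id
    ; step-loop = λ {ρ} {x} Aρ wx h → CrossingParity-resp (λ z → cong ρ (loop-inverseʳ (InWindow-≉- wx wx) z))
                (CrossingParity-loop⁻ (Aff-∘ Aρ (Aff-loop (InWindow-≉- wx wx)) (λ _ → refl)) wx h)
    ; step-loop⁻ = λ {ρ} {x} Aρ wx h → CrossingParity-resp (λ z → cong ρ (loop-inverseˡ (InWindow-≉- wx wx) z))
                (CrossingParity-loop (Aff-∘ Aρ (Aff-loop (nx wx)) (λ _ → refl)) wx h)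
    ; step-transp = λ {ρ} {a} {b} Aρ wa wb ne h → CrossingParity-resp (λ z → cong ρ (Transp.inv (Nondegenerate-window wa wb ne) z)) (CrossingParity-transp wa wb ne h)
    ; step-transp⁻ = λ {ρ} {a} {b} Aρ wa wb ne h → CrossingParity-resp (λ z → cong ρ (Transp.inv (Nondegenerate-window⁻ wa wb ne) z))
                (CrossingParity-transp⁻ (Aff-∘ Aρ (Transp.aff (Nondegenerate-window⁻ wa wb ne)) (λ _ → refl)) wa wb ne h)
    }
    where
    nx : ∀ {x} → InWindow x → ¬ (- (+ x)) ≈ - - (+ x)
    nx {x} wx p = InWindow-≉- wx wx (≈-sym (subst (λ z → - (+ x) ≈ z) (neg-involutive (+ x)) p))

  signParity⇒CrossingParity : ∀ ρ → Aff ρ → signParity ρ ≡ false → CrossingParity ρ false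
  signParity⇒CrossingParity = Reduction.reduce crossingParity-steps

  InWindow-1 : InWindow 1
  InWindow-1 = s≤s z≤n , s≤s (s≤s z≤n)

  JointlyEven⇒signParity : ∀ ρ → Aff ρ → JointlyEven n ρ → signParity ρ ≡ false
  JointlyEven⇒signParity ρ Aρ je with signParity ρ in eq
  ... | false = refl
  ... | true = ⊥-elim (true≢false (sym (CrossingParity-unique (JointlyEven⇒CrossingParity je) hp)))
    where
    X1 = + 1
    xx = InWindow-≉- InWindow-1 InWindow-1
    σ = λ z → ρ (signFlip X1 z)
    Aσ : Aff σ
    Aσ = Aff-∘ Aρ (SignFlip.aff xx) (λ _ → refl)
    Pσ : signParity σ ≡ false
    Pσ = trans (SignParity.signParity-flip Aρ 1 InWindow-1) (cong not eq)
    hp : CrossingParity ρ true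
    hp = CrossingParity-resp (λ z → cong ρ (SignFlip.inv xx z)) (CrossingParity-flip Aσ InWindow-1 (signParity⇒CrossingParity σ Aσ Pσ))

  GenS = Gen (SAndL1 n)

  GenS-s₀ : GenS (transp n (+ 1) (- (+ 2)))
  GenS-s₀ = gen-base (inj₁ (inj₁ (λ z → refl))) (λ z → refl)

  GenS-sᵢ : ∀ i → 1 ℕ.≤ i → i ℕ.≤ n ℕ.∸ 2 → GenS (transp n (+ i) (+ suc i))
  GenS-sᵢ i a b = gen-base (inj₁ (inj₂ (inj₁ (i , a , b , λ z → refl)))) (λ z → refl)

  GenS-ℓ₁ : GenS (loop n (+ 1))
  GenS-ℓ₁ = gen-base (inj₂ (λ z → refl)) (λ z → refl)

  GenS-sᵢ-window : ∀ i → InWindow i → InWindow (suc i) → GenS (transp n (+ i) (+ suc i))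
  GenS-sᵢ-window i wi ws = GenS-sᵢ i (proj₁ wi) (ℕP.≤-pred (ℕP.≤-pred (proj₂ ws)))

  Nondegenerate-swap : ∀ {a b} → Nondegenerate a b → Nondegenerate b a
  Nondegenerate-swap nd = record { a≉b = λ p → Nondegenerate.a≉b nd (≈-sym p) ; a≉-b = λ p → Nondegenerate.a≉-b nd (-≈⇒≈- (≈-sym p)) ; a≉-a = Nondegenerate.b≉-b nd ; b≉-b = Nondegenerate.a≉-a nd }

  -- Conjugation by s_i = ((i i+1)) carries the loop or reflection at i to i+1;
  -- this is how the generators at 1 reach the whole window.
  module ConjBySᵢ {i : ℕ} (wi : InWindow i) (ws : InWindow (suc i)) where
    S = transp n (+ i) (+ suc i)
    nd = Nondegenerate-window wi ws (ℕP.<⇒≢ (ℕP.n<1+n i))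
    AS : Aff S
    AS = Transp.aff nd
    inv = Transp.inv nd
    module E = WindowTransp wi ws (ℕP.<⇒≢ (ℕP.n<1+n i))

  cong-transp : ∀ {u u' v v' w w'} → u ≡ u' → v ≡ v' → w ≡ w' → transp n u v w ≡ transp n u' v' w'
  cong-transp refl refl refl = refl

  GenS-loop : ∀ x → InWindow x → GenS (loop n (+ x))
  GenS-loop zero (() , _)
  GenS-loop (suc zero) _ = GenS-ℓ₁
  GenS-loop (suc (suc x')) w = Gen-comp₃ (GenS-sᵢ-window (suc x') wi w) (GenS-loop (suc x') wi) (GenS-sᵢ-window (suc x') wi w) eq
    where
    i = suc x'
    wi : InWindow i
    wi = s≤s z≤n , ℕP.<-trans (ℕP.n<1+n _) (proj₂ w)
    open ConjBySᵢ wi w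
    eq : ∀ z → loop n (+ suc i) z ≡ S (loop n (+ i) (S z))
    eq z = sym (trans (Conjugation.conj-loop AS (+ i) (S z)) (cong₂ (loop n) E.transp-x (inv z)))

  GenS-transp< : ∀ b a → InWindow a → InWindow b → a ℕ.< b → GenS (transp n (+ a) (+ b))
  GenS-transp< zero a wa wb ()
  GenS-transp< (suc b') a wa wb (s≤s a≤b') with a ℕ.≟ b'
  ... | yes refl = GenS-sᵢ-window a wa wb
  ... | no ne = Gen-comp₃ (GenS-sᵢ-window b' wb' wb) (GenS-transp< b' a wa wb' (ℕP.≤∧≢⇒< a≤b' ne)) (GenS-sᵢ-window b' wb' wb) eq
    where
    wb' : InWindow b'
    wb' = ℕP.<-≤-trans (proj₁ wa) a≤b' , ℕP.<-trans (ℕP.n<1+n _) (proj₂ wb)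
    open ConjBySᵢ wb' wb
    sA : S (+ a) ≡ + a
    sA = E.transp-other wa ne (λ e → ℕP.<⇒≢ (s≤s a≤b') e)
    eq : ∀ z → transp n (+ a) (+ suc b') z ≡ S (transp n (+ a) (+ b') (S z))
    eq z = sym (trans (Conjugation.conj-transp AS (+ a) (+ b') (S z)) (cong-transp sA E.transp-x (inv z)))

  GenS-transp⁻-1 : ∀ b → InWindow b → 1 ℕ.< b → GenS (transp n (+ 1) (- (+ b)))
  GenS-transp⁻-1 zero wb ()
  GenS-transp⁻-1 (suc zero) wb (s≤s ())
  GenS-transp⁻-1 (suc (suc zero)) wb _ = GenS-s₀
  GenS-transp⁻-1 (suc (suc (suc b''))) wb _ = Gen-comp₃ (GenS-sᵢ-window b' wb' wb) (GenS-transp⁻-1 (suc (suc b'')) wb' (s≤s (s≤s z≤n))) (GenS-sᵢ-window b' wb' wb) eq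
    where
    b' = suc (suc b'')
    wb' : InWindow b'
    wb' = s≤s z≤n , ℕP.<-trans (ℕP.n<1+n _) (proj₂ wb)
    open ConjBySᵢ wb' wb
    s1 : S (+ 1) ≡ + 1
    s1 = E.transp-other InWindow-1 (λ ()) (λ ())
    sB : S (- (+ b')) ≡ - (+ suc b')
    sB = trans (Transp.odd nd (+ b')) (cong -_ E.transp-x)
    eq : ∀ z → transp n (+ 1) (- (+ suc b')) z ≡ S (transp n (+ 1) (- (+ b')) (S z))
    eq z = sym (trans (Conjugation.conj-transp AS (+ 1) (- (+ b')) (S z)) (cong-transp s1 sB (inv z)))

  GenS-transp⁻< : ∀ a b → InWindow a → InWindow b → a ℕ.< b → GenS (transp n (+ a) (- (+ b)))
  GenS-transp⁻< zero b (() , _) wb lt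
  GenS-transp⁻< (suc zero) b wa wb lt = GenS-transp⁻-1 b wb lt
  GenS-transp⁻< (suc (suc a'')) b wa wb lt = Gen-comp₃ (GenS-sᵢ-window a' wa' wa) (GenS-transp⁻< (suc a'') b wa' wb (ℕP.<-trans (ℕP.n<1+n _) lt)) (GenS-sᵢ-window a' wa' wa) eq
    where
    a' = suc a''
    wa' : InWindow a'
    wa' = s≤s z≤n , ℕP.<-trans (ℕP.n<1+n _) (proj₂ wa)
    open ConjBySᵢ wa' wa
    sA : S (+ a') ≡ + suc a'
    sA = E.transp-x
    sB : S (- (+ b)) ≡ - (+ b)
    sB = trans (Transp.odd nd (+ b)) (cong -_ (E.transp-other wb (λ e → ℕP.<⇒≢ (ℕP.<-trans (ℕP.n<1+n _) lt) (sym e)) (λ e → ℕP.<⇒≢ lt (sym e))))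
    eq : ∀ z → transp n (+ suc a') (- (+ b)) z ≡ S (transp n (+ a') (- (+ b)) (S z))
    eq z = sym (trans (Conjugation.conj-transp AS (+ a') (- (+ b)) (S z)) (cong-transp sA sB (inv z)))

  GenS-transp : ∀ {a b} → InWindow a → InWindow b → a ≢ b → GenS (transp n (+ a) (+ b))
  GenS-transp {a} {b} wa wb ne with ℕP.<-cmp a b
  ... | tri< lt _ _ = GenS-transp< b a wa wb lt
  ... | tri≈ _ e _ = ⊥-elim (ne e)
  ... | tri> _ _ gt = Gen-resp (GenS-transp< a b wb wa gt) (Transp.transp-comm (Nondegenerate-window wa wb ne))

  GenS-transp⁻ : ∀ {a b} → InWindow a → InWindow b → a ≢ b → GenS (transp n (+ a) (- (+ b)))
  GenS-transp⁻ {a} {b} wa wb ne with ℕP.<-cmp a b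
  ... | tri< lt _ _ = GenS-transp⁻< a b wa wb lt
  ... | tri≈ _ e _ = ⊥-elim (ne e)
  ... | tri> _ _ gt = Gen-resp (GenS-transp⁻< b a wb wa gt) eq
    where
    eq : ∀ z → transp n (+ a) (- (+ b)) z ≡ transp n (+ b) (- (+ a)) z
    eq z = trans (Transp.transp-comm (Nondegenerate-window⁻ wa wb ne) z) (trans (Transp.transp-neg (Nondegenerate-swap (Nondegenerate-window⁻ wa wb ne)) z) (cong (λ u → transp n u (- (+ a)) z) (neg-involutive (+ b))))

  GenS-loop⁻ : ∀ x → InWindow x → GenS (loop n (- (+ x)))
  GenS-loop⁻ x wx = gen-inv (GenS-loop x wx) (loop-inverseʳ (InWindow-≉- wx wx)) (loop-inverseˡ (InWindow-≉- wx wx))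

  GenS-steps : ReductionSteps GenS
  GenS-steps = record
    { step-id = gen-id
    ; step-loop = λ {ρ} {x} Aρ wx h → gen-comp h (GenS-loop⁻ x wx) (λ z → sym (cong ρ (loop-inverseʳ (InWindow-≉- wx wx) z)))
    ; step-loop⁻ = λ {ρ} {x} Aρ wx h → gen-comp h (GenS-loop x wx) (λ z → sym (cong ρ (loop-inverseˡ (InWindow-≉- wx wx) z)))
    ; step-transp = λ {ρ} {a} {b} Aρ wa wb ne h → gen-comp h (GenS-transp wa wb ne) (λ z → sym (cong ρ (Transp.inv (Nondegenerate-window wa wb ne) z)))
    ; step-transp⁻ = λ {ρ} {a} {b} Aρ wa wb ne h → gen-comp h (GenS-transp⁻ wa wb ne) (λ z → sym (cong ρ (Transp.inv (Nondegenerate-window⁻ wa wb ne) z)))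
    }

  PreservesSignParity : (ℤ → ℤ) → Set
  PreservesSignParity f = ∀ ρ → Aff ρ → signParity (λ z → ρ (f z)) ≡ signParity ρ

  signParity-ext : ∀ {ρ σ} → ρ ≗ σ → signParity ρ ≡ signParity σ
  signParity-ext e = xorSum-cong n∸1 (λ y _ _ → cong upperHalf (e (+ y)))

  Gen-preserves : ∀ {X} → (∀ {f} → X f → Aff f × PreservesSignParity f) → ∀ {π} → Gen X π → Aff π × PreservesSignParity π
  Gen-preserves h (gen-base {f} xf e) = Aff-resp (proj₁ (h xf)) e , λ ρ Aρ → trans (signParity-ext (λ z → cong ρ (e z))) (proj₂ (h xf) ρ Aρ)
  Gen-preserves h (gen-id e) = Aff-id e , λ ρ Aρ → signParity-ext (λ z → cong ρ (e z))
  Gen-preserves h (gen-comp {f} {g} gf gg e) =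
    Aff-∘ (proj₁ F) (proj₁ G) e ,
    λ ρ Aρ → trans (signParity-ext (λ z → cong ρ (e z))) (trans (proj₂ G (λ z → ρ (f z)) (Aff-∘ Aρ (proj₁ F) (λ _ → refl))) (proj₂ F ρ Aρ))
    where
    F = Gen-preserves h gf
    G = Gen-preserves h gg
  Gen-preserves h (gen-inv {f} {π} gf l r) =
    Aπ , λ ρ Aρ → trans (sym (proj₂ F (λ z → ρ (π z)) (Aff-∘ Aρ Aπ (λ _ → refl)))) (signParity-ext (λ z → cong ρ (r z)))
    where
    F = Gen-preserves h gf
    Aπ = Aff-inverse (proj₁ F) l r

  module CongBn = CongB (1 ℕ.+ m)

  nℤ∣2nℤ : nℤ ∣ 2nℤ
  nℤ∣2nℤ = divides (+ 2) (l nℤ 2nℤ 2nℤ≡nℤ+nℤ)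
    where
    l : ∀ n m → m ≡ n + n → m ≡ + 2 * n
    l n m refl = solve [ n ]

  nℤ∣⇒≡[mod-n]0 : ∀ {i} → nℤ ∣ i → i ≡[mod n ] + 0
  nℤ∣⇒≡[mod-n]0 {i} d = CongBn.∣⇒congB i (+ 0) (subst (nℤ ∣_) (sym (ℤP.+-identityʳ i)) d)

  not≡0[mod-n]⇒ : ∀ {i} → ¬ (i ≡[mod n ] + 0) → (¬ i ≈ 0ℤ) × (¬ i ≈ nℤ) × (¬ i ≈ - i)
  not≡0[mod-n]⇒ {i} h = X-2n , 2n-X , c3
    where
    X-2n : ¬ i ≈ 0ℤ
    X-2n (mk≈ d) = h (nℤ∣⇒≡[mod-n]0 (subst (nℤ ∣_) (ℤP.+-identityʳ i) (ZD.∣-trans nℤ∣2nℤ d)))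
    2n-X : ¬ i ≈ nℤ
    2n-X (mk≈ d) = h (nℤ∣⇒≡[mod-n]0 (subst (nℤ ∣_) (l i nℤ) (ZD.∣m∣n⇒∣m+n (ZD.∣-trans nℤ∣2nℤ d) (ZD.∣-refl {nℤ}))))
      where
      l : ∀ i n → i - n + n ≡ i
      l = solve-∀
    c3 : ¬ i ≈ - i
    c3 (mk≈ d) = h (nℤ∣⇒≡[mod-n]0 (ZD.*-cancelˡ-∣ (+ 2) (subst₂ _∣_ (ll1 nℤ 2nℤ 2nℤ≡nℤ+nℤ) (l2 i) d)))
      where
      ll1 : ∀ n m → m ≡ n + n → m ≡ + 2 * n
      ll1 n m refl = solve [ n ]
      l2 : ∀ i → i - - i ≡ + 2 * i
      l2 = solve-∀

  TAndL⇒Aff×PreservesSignParity : ∀ {f} → TAndL n f → Aff f × PreservesSignParity f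
  TAndL⇒Aff×PreservesSignParity {f} (inj₁ (i , j , hi , hj , hij , hi-j , e)) =
    Aff-resp (Transp.aff nd) e , λ ρ Aρ → trans (signParity-ext (λ z → cong ρ (e z))) (SignParity.signParity-transp Aρ nd (proj₁ ci) (proj₁ (proj₂ ci)) (proj₁ cj) (proj₁ (proj₂ cj)))
    where
    ci = not≡0[mod-n]⇒ hi
    cj = not≡0[mod-n]⇒ hj
    nd : Nondegenerate i j
    nd = record { a≉b = λ p → hij (≈⇒congᵇ p) ; a≉-b = λ p → hi-j (≈⇒congᵇ p) ; a≉-a = proj₂ (proj₂ ci) ; b≉-b = proj₂ (proj₂ cj) }
  TAndL⇒Aff×PreservesSignParity {f} (inj₂ (i , 1≤ , ≤n-1 , e)) = Aff-resp (Aff-loop ii) e , λ ρ Aρ → trans (signParity-ext (λ z → cong ρ (e z))) (SignParity.signParity-loop Aρ i)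
    where
    smi : Small i
    smi = s≤s ≤n-1
    ii : ¬ i ≈ - i
    ii p with Small-≈⇒≡ {i} { - i} smi (Small-neg {i} smi) p
    ... | q = ℕP.<⇒≢ 1≤ (sym (cong ∣_∣ (l i q)))
      where
      l : ∀ i → i ≡ - i → i ≡ 0ℤ
      l (+ zero) _ = refl
      l (+ suc m) ()
      l -[1+ m ] ()

  0<x<D⇒D∤x : ∀ D x → 0 ℕ.< x → x ℕ.< D → ¬ (D ℕDiv.∣ x)
  0<x<D⇒D∤x D (suc x) _ lt d = ℕDiv.>⇒∤ lt d

  not≡[mod-n] : ∀ {a b} → 0 ℕ.< ∣ a - b ∣ → ∣ a - b ∣ ℕ.< n → ¬ (a ≡[mod n ] b)
  not≡[mod-n] {a} {b} p q e = 0<x<D⇒D∤x n _ p q (ZD.∣⇒∣ᵤ (CongBn.congB⇒∣ a b e))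

  not≡[mod-2n] : ∀ {a b} → 0 ℕ.< ∣ a - b ∣ → ∣ a - b ∣ ℕ.< 2n → ¬ (a ≡[mod 2 ℕ.* n ] b)
  not≡[mod-2n] {a} {b} p q e = 0<x<D⇒D∤x 2n _ p q (ZD.∣⇒∣ᵤ (un≈ (congᵇ⇒≈ {a} {b} e)))

  ∣a-0∣≡∣a∣ : ∀ a → ∣ a - + 0 ∣ ≡ ∣ a ∣
  ∣a-0∣≡∣a∣ a = cong ∣_∣ (ℤP.+-identityʳ a)

  signParity≡false : ∀ {π} → Aff π → PreservesSignParity π → signParity π ≡ false
  signParity≡false {π} Aπ pinv = trans (pinv (λ z → z) (Aff-id (λ _ → refl))) (signParity-id {λ z → z} (λ _ → refl))

  Sjes⇒Gen-SAndL1 : ∀ {π} → Sjes n π → Gen (SAndL1 n) π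
  Sjes⇒Gen-SAndL1 {π} (Aπ , je) = Reduction.reduce GenS-steps π Aπ (JointlyEven⇒signParity π Aπ je)

  Gen-TAndL⇒Sjes : ∀ {π} → Gen (TAndL n) π → Sjes n π
  Gen-TAndL⇒Sjes {π} g with Gen-preserves TAndL⇒Aff×PreservesSignParity g
  ... | Aπ , pres = Aπ , CrossingParity⇒JointlyEven (signParity⇒CrossingParity π Aπ (signParity≡false Aπ pres))

module SimpleReflections (k : ℕ) where
  open AffineSigned (3 ℕ.+ k)

  3+k<n : 3 ℕ.+ k ℕ.< n
  3+k<n = ℕP.+-monoˡ-< k {3} {5} (s≤s (s≤s (s≤s (s≤s z≤n))))
  4+k<n : 4 ℕ.+ k ℕ.< n
  4+k<n = ℕP.+-monoˡ-< k {4} {5} (s≤s (s≤s (s≤s (s≤s (s≤s z≤n)))))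

  SAndL1⊆TAndL : ∀ {f} → SAndL1 n f → TAndL n f
  SAndL1⊆TAndL (inj₁ (inj₁ e)) = inj₁ (+ 1 , - (+ 2) , not≡[mod-n] {+ 1} {+ 0} (s≤s z≤n) (s≤s (s≤s z≤n)) , not≡[mod-n] { - (+ 2)} {+ 0} (s≤s z≤n) (s≤s (s≤s (s≤s z≤n))) ,
                              not≡[mod-2n] {+ 1} { - (+ 2)} (s≤s z≤n) (s≤s (s≤s (s≤s (s≤s z≤n)))) , not≡[mod-2n] {+ 1} { - - (+ 2)} (s≤s z≤n) (s≤s (s≤s z≤n)) , e)
  SAndL1⊆TAndL (inj₁ (inj₂ (inj₁ (i , 1≤i , i≤ , e)))) =
    inj₁ (+ i , + suc i ,
          not≡[mod-n] {+ i} {+ 0} (subst (0 ℕ.<_) (sym (∣a-0∣≡∣a∣ (+ i))) 1≤i) (subst (ℕ._< n) (sym (∣a-0∣≡∣a∣ (+ i))) (ℕP.≤-<-trans i≤ 3+k<n)) ,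
          not≡[mod-n] {+ suc i} {+ 0} (subst (0 ℕ.<_) (sym (∣a-0∣≡∣a∣ (+ suc i))) (s≤s z≤n)) (subst (ℕ._< n) (sym (∣a-0∣≡∣a∣ (+ suc i))) (ℕP.≤-<-trans (s≤s i≤) 4+k<n)) ,
          not≡[mod-2n] {+ i} {+ suc i} (subst (0 ℕ.<_) (sym d1) (s≤s z≤n)) (subst (ℕ._< 2n) (sym d1) (s≤s (s≤s z≤n))) ,
          not≡[mod-2n] {+ i} { - (+ suc i)} (ℕP.<-≤-trans (s≤s z≤n) (ℕP.m≤n+m (suc i) i)) lt2 , e)
    where
    d1 : ∣ + i - + suc i ∣ ≡ 1
    d1 = cong ∣_∣ (trans (cong (λ w → + i - w) (ℤP.pos-+ 1 i)) (l (+ i)))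
      where
      l : ∀ x → x - (+ 1 + x) ≡ - (+ 1)
      l = solve-∀
    lt2 : i ℕ.+ suc i ℕ.< 2n
    lt2 = ℕP.≤-<-trans (ℕP.+-mono-≤ i≤ (s≤s i≤)) (subst ((3 ℕ.+ k) ℕ.+ suc (3 ℕ.+ k) ℕ.<_) (sym 2n≡n+n) (ℕP.+-mono-< 3+k<n 4+k<n))
  SAndL1⊆TAndL (inj₁ (inj₂ (inj₂ e))) =
    inj₁ (+ (3 ℕ.+ k) , + (n ℕ.+ 1) ,
          not≡[mod-n] {+ (3 ℕ.+ k)} {+ 0} (subst (0 ℕ.<_) (sym (∣a-0∣≡∣a∣ (+ (3 ℕ.+ k)))) (s≤s z≤n)) (subst (ℕ._< n) (sym (∣a-0∣≡∣a∣ (+ (3 ℕ.+ k)))) 3+k<n) ,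
          nb ,
          not≡[mod-2n] {+ (3 ℕ.+ k)} {+ (n ℕ.+ 1)} (subst (0 ℕ.<_) (sym d3) (s≤s z≤n)) (subst (ℕ._< 2n) (sym d3) (s≤s (s≤s (s≤s (s≤s z≤n))))) ,
          not≡[mod-2n] {+ (3 ℕ.+ k)} { - (+ (n ℕ.+ 1))} (s≤s z≤n) lt9 , e)
    where
    nb : ¬ (+ (n ℕ.+ 1) ≡[mod n ] + 0)
    nb h = 0<x<D⇒D∤x n 1 (s≤s z≤n) (s≤s (s≤s z≤n)) (ZD.∣⇒∣ᵤ (ZD.∣m+n∣m⇒∣n {nℤ} {nℤ} {+ 1} d (ZD.∣-refl {nℤ})))
      where
      d : nℤ ∣ (nℤ + + 1)
      d = subst (nℤ ∣_) (trans (ℤP.+-identityʳ _) (ℤP.pos-+ n 1)) (CongBn.congB⇒∣ (+ (n ℕ.+ 1)) (+ 0) h)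
    d3 : ∣ + (3 ℕ.+ k) - + (n ℕ.+ 1) ∣ ≡ 3
    d3 = cong ∣_∣ (trans (cong₂ (λ u v → u - v) (ℤP.pos-+ 3 k) (trans (ℤP.pos-+ n 1) (cong (_+ + 1) (ℤP.pos-+ 5 k)))) (l (+ k)))
      where
      l : ∀ x → + 3 + x - (+ 5 + x + + 1) ≡ - (+ 3)
      l = solve-∀
    lt9 : (3 ℕ.+ k) ℕ.+ (n ℕ.+ 1) ℕ.< 2n
    lt9 = subst₂ ℕ._<_ (sym (q1 k)) (sym (trans 2n≡n+n (q2 k))) (ℕP.n<1+n _)
      where
      q1 : ∀ k → (3 ℕ.+ k) ℕ.+ ((5 ℕ.+ k) ℕ.+ 1) ≡ 9 ℕ.+ (k ℕ.+ k)
      q1 = NS.solve-∀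
      q2 : ∀ k → (5 ℕ.+ k) ℕ.+ (5 ℕ.+ k) ≡ 10 ℕ.+ (k ℕ.+ k)
      q2 = NS.solve-∀
  SAndL1⊆TAndL (inj₂ e) = inj₂ (+ 1 , s≤s z≤n , s≤s z≤n , e)

mainTheorem5 : (n : ℕ) → 5 ℕ.≤ n → (π : ℤ → ℤ) →
    ((Sjes n π → Gen (SAndL1 n) π) × (Gen (SAndL1 n) π → Sjes n π))
    × ((Sjes n π → Gen (TAndL n) π) × (Gen (TAndL n) π → Sjes n π))
mainTheorem5 (suc (suc (suc (suc (suc k))))) (s≤s (s≤s (s≤s (s≤s (s≤s z≤n))))) π =
  (Sjes⇒Gen-SAndL1 , λ g → Gen-TAndL⇒Sjes (Gen-mono SAndL1⊆TAndL g)) ,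
  ((λ s → Gen-mono SAndL1⊆TAndL (Sjes⇒Gen-SAndL1 s)) , Gen-TAndL⇒Sjes)
  where
  open AffineSigned (3 ℕ.+ k)
  open SimpleReflections k
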